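{- The functor $\mathcal{P}_{\mathcal{M}}$ (the hyperdoctrine of mass problems, defined in the context) is a first-order hyperdoctrine.
   Context: Notation. A mass problem is a subset of Baire space $\omega^\omega$. For $f,g\in\omega^\omega$, $f\oplus g$ is given by $(f\oplus g)(2n)=f(n)$, $(f\oplus g)(2n+1)=g(n)$; for $n\in\omega$, $n^\frown f$ is the function whose first value is $n$ followed by $f$, and $n^\frown\mathcal{A}=\{n^\frown f: f\in\mathcal{A}\}$. $\Phi_e$ is the $e$-th partial Turing functional; $\langle a_1,\dots,a_n\rangle$ is a fixed computable bijection $\omega^n\to\omega$. Medvedev reducibility: $\mathcal{A}\le_{\mathcal{M}}\mathcal{B}$ iff there is a partial Turing functional $\Phi$ with $\Phi(\mathcal{B})\subseteq\mathcal{A}$. The Medvedev lattice $\mathcal{M}$ is the set of equivalence classes; it is a Brouwer algebra (bounded distributive lattice with implication $\to$ such that $x\oplus y\ge z$ iff $y\ge x\to z$) with join $\mathcal{A}\oplus\mathcal{B}=\{f\oplus g: f\in\mathcal{A},g\in\mathcal{B}\}$, meet $\mathcal{A}\otimes\mathcal{B}=0^\frown\mathcal{A}\cup 1^\frown\mathcal{B}$, implication $\mathcal{A}\to\mathcal{B}=\{e^\frown f:\forall g\in\mathcal{A}\,(\Phi_e(g\oplus f)\in\mathcal{B})\}$; bottom is the degree of $\omega^\omega$, top is the degree of $\emptyset$. $\mathcal{M}^n$ is the $n$-fold product with componentwise order and operations. $\omega$-mass problems: an $\omega$-mass problem is a sequence $(\mathcal{A}_i)_{i\in\omega}$ of mass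 problems; $(\mathcal{A}_i)_i\le_{\mathcal{M}_\omega}(\mathcal{B}_i)_i$ iff there is a single partial Turing functional $\Phi$ with $\Phi(n^\frown\mathcal{B}_n)\subseteq\mathcal{A}_n$ for every $n$. $\mathcal{M}_\omega$ denotes the set of equivalence classes (a Brouwer algebra under componentwise operations). First-order hyperdoctrine. Let $\mathbf{C}$ be a category in which all finite powers $X^n$ of objects exist. A first-order hyperdoctrine over $\mathbf{C}$ is a contravariant functor $\mathcal{P}:\mathbf{C}^{op}\to\mathbf{Poset}$ such that: (i) each $\mathcal{P}(X)$ is a Brouwer algebra; (ii) for each morphism $f:X\to Y$, $f^*=\mathcal{P}(f):\mathcal{P}(Y)\to\mathcal{P}(X)$ is a Brouwer algebra homomorphism; (iii) for each diagonal $\Delta_X:X\to X\times X$ there is an element $=_X\in\mathcal{P}(X\times X)$ such that for all $A\in\mathcal{P}(X\times X)$: $\Delta_X^*(A)\le 0$ iff $A\le{=_X}$; (iv) for each product projection $\pi:\Gamma\times X\to\Gamma$, $\pi^*$ has a right adjoint $(\exists x)_\Gamma$ and a left adjoint $(\forall x)_\Gamma$ (i.e. $\pi^*(B)\le A$ iff $B\le(\exists x)_\Gamma(A)$, and $A\le\pi^*(B)$ iff $(\forall x)_\Gamma(A)\le B$), and these are natural in $\Gamma$ (Beck–Chevalley condition): for every $s:\Gamma\to\Gamma'$, $(\exists x)_\Gamma\circ(s\times 1_X)^*=s^*\circ(\exists x)_{\Gamma'}$ and $(\forall x)_\Gamma\circ(s\times 1_X)^*=s^*\circ(\forall x)_{\Gamma'}$.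 The hyperdoctrine of mass problems $\mathcal{P}_{\mathcal{M}}$: $\mathbf{C}$ is the category with objects $\{1\},\{1,2\},\{1,2,3\},\dots$ and $\omega$, and morphisms all computable functions between them (products $\omega^n$ identified with $\omega$ via $\langle\cdot\rangle$, and $\{1,\dots,m\}^n$ with $\{1,\dots,m^n\}$ via a fixed computable bijection). $\mathcal{P}_{\mathcal{M}}$ sends $\{1,\dots,n\}$ to $\mathcal{M}^n$, $\omega$ to $\mathcal{M}_\omega$, and a computable $\alpha:X\to Y$ to $\alpha^*:\mathcal{P}_{\mathcal{M}}(Y)\to\mathcal{P}_{\mathcal{M}}(X)$, $(\alpha^*((\mathcal{A}_j)_{j\in Y}))_i=\mathcal{A}_{\alpha(i)}$. -}

module Defs where

open import Data.Nat using (ℕ; zero; suc; _+_; _*_; _<_)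
open import Data.Fin using (Fin; toℕ; combine; remQuot)
import Data.Fin as F
open import Data.List using (List; []; _∷_)
open import Data.Product using (Σ; _×_; _,_; proj₁; proj₂; ∃)
open import Data.Sum using (_⊎_; inj₁; inj₂)
open import Data.Unit using (⊤; tt)
open import Data.Empty using (⊥)
open import Function using (_∘_; id; _⇔_)
open import Relation.Binary.PropositionalEquality
  using (_≡_; refl; sym; trans; cong; subst; _≗_)

Baire : Set
Baire = ℕ → ℕ

_⌢_ : ℕ → Baire → Baire
(n ⌢ f) zero    = n
(n ⌢ f) (suc k) = f k

tail : Baire → Baire
tail h = h ∘ suc

-- (f ⊕ g)(2n) = f n , (f ⊕ g)(2n+1) = g n
_⊕ᶠ_ : Baire → Baire → Baire
(f ⊕ᶠ g) zero          = f 0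
(f ⊕ᶠ g) (suc zero)    = g 0
(f ⊕ᶠ g) (suc (suc n)) = ((f ∘ suc) ⊕ᶠ (g ∘ suc)) n

⊕ᶠ-resp : ∀ {f f' g g'} → f ≗ f' → g ≗ g' → (f ⊕ᶠ g) ≗ (f' ⊕ᶠ g')
⊕ᶠ-resp ef eg zero          = ef 0
⊕ᶠ-resp ef eg (suc zero)    = eg 0
⊕ᶠ-resp ef eg (suc (suc n)) = ⊕ᶠ-resp (ef ∘ suc) (eg ∘ suc) n

tri : ℕ → ℕ
tri zero    = zero
tri (suc n) = suc n + tri n

pair : ℕ → ℕ → ℕ
pair a b = tri (a + b) + a

private
  next : ℕ × ℕ → ℕ × ℕ
  next (a , zero)  = (zero , suc a)
  next (a , suc b) = (suc a , b)

unpair : ℕ → ℕ × ℕ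
unpair zero    = (zero , zero)
unpair (suc n) = next (unpair n)

data Code : Set where
  zer  : Code
  sc   : Code
  prj  : ℕ → Code
  orc  : Code
  comp : Code → List Code → Code
  prec : Code → Code → Code      -- primitive recursion on first argument
  mu   : Code → Code             -- minimisation on first argument

nth : ℕ → List ℕ → ℕ
nth _       []       = 0
nth zero    (x ∷ xs) = x
nth (suc i) (x ∷ xs) = nth i xs

mutual
  data Eval (g : Baire) : Code → List ℕ → ℕ → Set where
    e-zer  : ∀ {xs} → Eval g zer xs 0
    e-sc   : ∀ {x xs} → Eval g sc (x ∷ xs) (suc x)
    e-prj  : ∀ {i xs} → Eval g (prj i) xs (nth i xs)
    e-orc  : ∀ {x xs} → Eval g orc (x ∷ xs) (g x)
    e-comp : ∀ {f hs xs ys y} → EvalL g hs xs ys → Eval g f ys y →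
             Eval g (comp f hs) xs y
    e-prec0 : ∀ {f h xs y} → Eval g f xs y → Eval g (prec f h) (0 ∷ xs) y
    e-precS : ∀ {f h n xs y z} → Eval g (prec f h) (n ∷ xs) y →
              Eval g h (n ∷ y ∷ xs) z → Eval g (prec f h) (suc n ∷ xs) z
    e-mu   : ∀ {f xs z} → Eval g f (z ∷ xs) 0 →
             (∀ w → w < z → Σ ℕ (λ v → Eval g f (w ∷ xs) (suc v))) →
             Eval g (mu f) xs z

  data EvalL (g : Baire) : List Code → List ℕ → List ℕ → Set where
    []  : ∀ {xs} → EvalL g [] xs []
    _∷_ : ∀ {c cs xs y ys} → Eval g c xs y → EvalL g cs xs ys →
          EvalL g (c ∷ cs) xs (y ∷ ys)

mutual
  Eval-resp : ∀ {g g' c xs y} → g ≗ g' → Eval g c xs y → Eval g' c xs y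
  Eval-resp eq e-zer = e-zer
  Eval-resp eq e-sc = e-sc
  Eval-resp eq e-prj = e-prj
  Eval-resp {g' = g'} eq (e-orc {x} {xs}) =
    subst (Eval g' orc (x ∷ xs)) (sym (eq x)) e-orc
  Eval-resp eq (e-comp l e) = e-comp (EvalL-resp eq l) (Eval-resp eq e)
  Eval-resp eq (e-prec0 e) = e-prec0 (Eval-resp eq e)
  Eval-resp eq (e-precS e e') = e-precS (Eval-resp eq e) (Eval-resp eq e')
  Eval-resp eq (e-mu e h) =
    e-mu (Eval-resp eq e) (λ w w<z → proj₁ (h w w<z) , Eval-resp eq (proj₂ (h w w<z)))

  EvalL-resp : ∀ {g g' cs xs ys} → g ≗ g' → EvalL g cs xs ys → EvalL g' cs xs ys
  EvalL-resp eq [] = []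
  EvalL-resp eq (e ∷ l) = Eval-resp eq e ∷ EvalL-resp eq l

-- A computable (surjective) numbering of codes: Φ_e = decode e.
mutual
  decodeF : ℕ → ℕ → Code
  decodeF zero    _ = zer
  decodeF (suc f) n with unpair n
  ... | (0 , r) = zer
  ... | (1 , r) = sc
  ... | (2 , r) = prj r
  ... | (3 , r) = orc
  ... | (4 , r) = comp (decodeF f (proj₁ (unpair r))) (decodeL f (proj₂ (unpair r)))
  ... | (5 , r) = prec (decodeF f (proj₁ (unpair r))) (decodeF f (proj₂ (unpair r)))
  ... | (6 , r) = mu (decodeF f r)
  ... | (_ , r) = zer

  decodeL : ℕ → ℕ → List Code
  decodeL zero    _       = []
  decodeL (suc f) zero    = []
  decodeL (suc f) (suc m) =
    decodeF f (proj₁ (unpair m)) ∷ decodeL f (proj₂ (unpair m))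

decode : ℕ → Code
decode e = decodeF e e

Φ[_]⟨_⟩_⇓_ : ℕ → Baire → ℕ → ℕ → Set
Φ[ e ]⟨ g ⟩ x ⇓ y = Eval g (decode e) (x ∷ []) y

-- Mass problems (subsets of Baire space, hence extensional predicates)

record MassProblem : Set₁ where
  field
    _∋_ : Baire → Set
    ext : ∀ {f g} → f ≗ g → _∋_ f → _∋_ g
open MassProblem public

Φ[_]⟨_⟩∈_ : ℕ → Baire → MassProblem → Set
Φ[ e ]⟨ g ⟩∈ A = Σ Baire λ f → (A ∋ f) × (∀ x → Φ[ e ]⟨ g ⟩ x ⇓ f x)

_≤M_ : MassProblem → MassProblem → Set
A ≤M B = Σ ℕ λ e → ∀ g → B ∋ g → Φ[ e ]⟨ g ⟩∈ A

botM : MassProblem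
botM = record { _∋_ = λ _ → ⊤ ; ext = λ _ _ → tt }

topM : MassProblem
topM = record { _∋_ = λ _ → ⊥ ; ext = λ _ () }

_⊕M_ : MassProblem → MassProblem → MassProblem
A ⊕M B = record
  { _∋_ = λ h → Σ Baire λ f → Σ Baire λ g → (A ∋ f) × (B ∋ g) × (h ≗ (f ⊕ᶠ g))
  ; ext = λ { eq (f , g , a , b , e) → f , g , a , b , (λ n → trans (sym (eq n)) (e n)) } }

_⊗M_ : MassProblem → MassProblem → MassProblem
A ⊗M B = record
  { _∋_ = λ h → ((h 0 ≡ 0) × (A ∋ tail h)) ⊎ ((h 0 ≡ 1) × (B ∋ tail h))
  ; ext = λ { eq (inj₁ (z , a)) → inj₁ (trans (sym (eq 0)) z , ext A (eq ∘ suc) a)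
            ; eq (inj₂ (z , b)) → inj₂ (trans (sym (eq 0)) z , ext B (eq ∘ suc) b) } }

_→M_ : MassProblem → MassProblem → MassProblem
A →M B = record
  { _∋_ = λ h → ∀ g → A ∋ g → Φ[ h 0 ]⟨ g ⊕ᶠ tail h ⟩∈ B
  ; ext = λ {h} {h'} eq H g a → lemma eq (H g a) }
  where
    lemma : ∀ {h h' g} → h ≗ h' → Φ[ h 0 ]⟨ g ⊕ᶠ tail h ⟩∈ B → Φ[ h' 0 ]⟨ g ⊕ᶠ tail h' ⟩∈ B
    lemma {h} {h'} {g} eq (f , b , c) = f , b , λ x →
      subst (λ e → Φ[ e ]⟨ g ⊕ᶠ tail h' ⟩ x ⇓ f x) (eq 0)
        (Eval-resp (⊕ᶠ-resp (λ _ → refl) (eq ∘ suc)) (c x))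

-- The base category C: objects {1,...,k+1} (written fin k) and ω.

data Obj : Set where
  fin   : ℕ → Obj
  omega : Obj

El : Obj → Set
El (fin k) = Fin (suc k)
El omega   = ℕ

enc : (X : Obj) → El X → ℕ
enc (fin k) = toℕ
enc omega   = id

Computable : (X Y : Obj) → (El X → El Y) → Set
Computable X Y s = Σ ℕ λ e → ∀ x → Φ[ e ]⟨ (λ _ → 0) ⟩ enc X x ⇓ enc Y (s (x))

-- finite powers: {1..k+1}^n = {1..(k+1)^n}, ω^0 = {1}, ω^(n+1) = ω
finpow : ℕ → ℕ → ℕ          -- (k+1)^n = finpow k n + 1
finpow k zero             = 0
finpow k (suc zero)       = k
finpow k (suc (suc n))    = k + finpow k (suc n) * suc k

pow : Obj → ℕ → Obj
pow (fin k) n     = fin (finpow k n)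
pow omega zero    = fin 0
pow omega (suc n) = omega

split : (X : Obj) (n : ℕ) → El (pow X (suc n)) → El (pow X n) × El X
split (fin k) zero    x = F.zero , x
split (fin k) (suc n) x = remQuot (suc k) x
split omega   zero    x = F.zero , x
split omega   (suc n) x = unpair x

glue : (X : Obj) (n : ℕ) → El (pow X n) × El X → El (pow X (suc n))
glue (fin k) zero    (_ , x) = x
glue (fin k) (suc n) (a , x) = combine a x
glue omega   zero    (_ , x) = x
glue omega   (suc n) (a , x) = pair a x

proj : (X : Obj) (n : ℕ) → El (pow X (suc n)) → El (pow X n)
proj X n = proj₁ ∘ split X n

times1 : (X : Obj) (n m : ℕ) → (El (pow X n) → El (pow X m)) →
         El (pow X (suc n)) → El (pow X (suc m))
times1 X n m s x = glue X m (s (proj₁ (split X n x)) , proj₂ (split X n x))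

diag : (X : Obj) → El X → El (pow X 2)
diag (fin k) x = glue (fin k) 1 (x , x)
diag omega   x = glue omega 1 (x , x)

Pred : Obj → Set₁
Pred X = El X → MassProblem

-- P_M({1..k+1}) = M^(k+1) (componentwise order);  P_M(ω) = M_ω
Leq : (X : Obj) → Pred X → Pred X → Set
Leq (fin k) A B = ∀ i → A i ≤M B i
Leq omega   A B = Σ ℕ λ e → ∀ n g → B n ∋ g → Φ[ e ]⟨ n ⌢ g ⟩∈ A n

Equiv : (X : Obj) → Pred X → Pred X → Set
Equiv X A B = Leq X A B × Leq X B A

⊕P ⊗P →P : ∀ {X} → Pred X → Pred X → Pred X
⊕P A B x = A x ⊕M B x
⊗P A B x = A x ⊗M B x
→P A B x = A x →M B x

botP topP : ∀ {X} → Pred X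
botP _ = botM
topP _ = topM

_* : ∀ {X Y : Obj} → (El X → El Y) → Pred Y → Pred X
(α *) A = A ∘ α

-- Brouwer algebra (on a preorder, i.e. on its quotient poset)

record IsBrouwerAlgebra {C : Set₁} (_≤_ : C → C → Set)
       (_⊕_ _⊗_ _⇒_ : C → C → C) (𝟘 𝟙 : C) : Set₁ where
  _≈_ : C → C → Set
  x ≈ y = (x ≤ y) × (y ≤ x)
  field
    refl≤   : ∀ x → x ≤ x
    trans≤  : ∀ {x y z} → x ≤ y → y ≤ z → x ≤ z
    ⊕-upperˡ : ∀ x y → x ≤ (x ⊕ y)
    ⊕-upperʳ : ∀ x y → y ≤ (x ⊕ y)
    ⊕-least  : ∀ {x y z} → x ≤ z → y ≤ z → (x ⊕ y) ≤ z
    ⊗-lowerˡ : ∀ x y → (x ⊗ y) ≤ x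
    ⊗-lowerʳ : ∀ x y → (x ⊗ y) ≤ y
    ⊗-greatest : ∀ {x y z} → z ≤ x → z ≤ y → z ≤ (x ⊗ y)
    distrib : ∀ x y z → (x ⊗ (y ⊕ z)) ≈ ((x ⊗ y) ⊕ (x ⊗ z))
    bot-least : ∀ x → 𝟘 ≤ x
    top-greatest : ∀ x → x ≤ 𝟙
    residuation : ∀ x y z → (z ≤ (x ⊕ y)) ⇔ ((x ⇒ z) ≤ y)

-- First-order hyperdoctrine conditions for P_M (finite powers X^n as contexts)

record IsFirstOrderHyperdoctrineP : Set₁ where
  field
    brouwer : ∀ X → IsBrouwerAlgebra (Leq X) (⊕P {X}) (⊗P {X}) (→P {X}) botP topP
    hom-mono : ∀ X Y (f : El X → El Y) → Computable X Y f →
               ∀ A B → Leq Y A B → Leq X ((f *) A) ((f *) B)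
    hom-⊕ : ∀ X Y (f : El X → El Y) → Computable X Y f →
            ∀ A B → Equiv X ((f *) (⊕P A B)) (⊕P ((f *) A) ((f *) B))
    hom-⊗ : ∀ X Y (f : El X → El Y) → Computable X Y f →
            ∀ A B → Equiv X ((f *) (⊗P A B)) (⊗P ((f *) A) ((f *) B))
    hom-→ : ∀ X Y (f : El X → El Y) → Computable X Y f →
            ∀ A B → Equiv X ((f *) (→P A B)) (→P ((f *) A) ((f *) B))
    hom-bot : ∀ X Y (f : El X → El Y) → Computable X Y f →
              Equiv X ((f *) botP) botP
    hom-top : ∀ X Y (f : El X → El Y) → Computable X Y f →
              Equiv X ((f *) topP) topP
    eqP : ∀ X → Pred (pow X 2)
    eqP-spec : ∀ X (A : Pred (pow X 2)) →
               Leq X ((diag X *) A) botP ⇔ Leq (pow X 2) A (eqP X)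
    ∃P ∀P : ∀ X n → Pred (pow X (suc n)) → Pred (pow X n)
    ∃P-adj : ∀ X n A B →
             Leq (pow X (suc n)) ((proj X n *) B) A ⇔ Leq (pow X n) B (∃P X n A)
    ∀P-adj : ∀ X n A B →
             Leq (pow X (suc n)) A ((proj X n *) B) ⇔ Leq (pow X n) (∀P X n A) B
    ∃P-BC : ∀ X n m (s : El (pow X n) → El (pow X m)) →
            Computable (pow X n) (pow X m) s → ∀ A →
            Equiv (pow X n) (∃P X n (((times1 X n m s) *) A)) ((s *) (∃P X m A))
    ∀P-BC : ∀ X n m (s : El (pow X n) → El (pow X m)) →
            Computable (pow X n) (pow X m) s → ∀ A →
            Equiv (pow X n) (∀P X n (((times1 X n m s) *) A)) ((s *) (∀P X m A))

-- Every reduction is given by an explicit code of a partial recursive functional.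
-- The only non-elementary ingredient is a universal functional, obtained by Kleene's
-- normal form: a primitive recursive check of coded computation traces followed by
-- an unbounded search for a valid one.  With it, families of mass problems under
-- reductions uniform in the index form a Brouwer algebra by the classical
-- constructions (interleaving for ⊕, a tag for ⊗, an index for →); this is M_ω,
-- and M^n is recovered because finitely many reductions combine into a uniform one
-- through a table of indices.  Substitution along a computable α is monotone since
-- α can be computed from the index, equality is the indicator of the diagonal, ∃
-- prefixes a witness, ∀ collects indices uniform in the bound variable, and the
-- Beck–Chevalley conditions hold on the nose.

module Submission where

open import Defs
open import Data.Nat using (ℕ; zero; suc; _+_; _≤_; _<_; z≤n; s≤s; _*_; _∸_; pred; _≟_; ⌊_/2⌋)
open import Data.Nat.Properties
  using (+-identityʳ; +-comm; +-suc; suc-injective; m≤m+n; m≤n+m; ≤-trans; ≤-pred; ≤-refl;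
         pred[m∸n]≡m∸[1+n]; ≤-antisym; m∸n≡0⇒m≤n; m+n≡0⇒m≡0; m+n≡0⇒n≡0; n∸n≡0; 0∸n≡0; *-zeroʳ;
         <-irrefl; m≤n⇒m≤1+n; ≤∧≢⇒<; ≤-reflexive; +-∸-assoc; m∸n+n≡m; m+[n∸m]≡n; m≤n⇒m<n∨m≡n;
         n≤1+n; <-cmp; 0≢1+n)
open import Data.Product using (_×_; _,_; proj₁; proj₂; Σ)
open import Relation.Binary.PropositionalEquality
  using (_≡_; refl; sym; trans; cong; module ≡-Reasoning; cong₂; subst; _≢_; subst₂; _≗_)
open import Data.List using (List; []; _∷_; length; _++_; tabulate)
open import Data.Sum using (_⊎_; inj₁; inj₂)
open import Data.Empty using (⊥-elim)
open import Relation.Nullary using (¬_; yes; no)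
open import Data.List.Membership.Propositional using (_∈_)
open import Data.List.Relation.Unary.Any using (here; there)
open import Data.Nat.Induction using (<-rec)
open import Data.Unit using (⊤; tt)
open import Data.List.Membership.Propositional.Properties using (∈-++⁺ˡ; ∈-++⁺ʳ; ∈-++⁻)
open import Data.List.Relation.Binary.Subset.Propositional using (_⊆_)
open import Function using (_∘_; _⇔_; mk⇔; Equivalence; id)
open import Relation.Binary.Definitions using (tri<; tri≈; tri>)
open import Data.Fin using (Fin; toℕ) renaming (zero to fzero; suc to fsuc)
import Data.Fin.Properties as Fin

private
  next : ℕ × ℕ → ℕ × ℕ
  next (a , zero)  = (zero , suc a)
  next (a , suc b) = (suc a , b)

unpair-suc : ∀ n → unpair (suc n) ≡ next (unpair n)
unpair-suc n with unpair n
... | (a , zero)  = refl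
... | (a , suc b) = refl

pair-next : ∀ p → pair (proj₁ (next p)) (proj₂ (next p)) ≡ suc (pair (proj₁ p) (proj₂ p))
pair-next (a , zero) = begin
  tri (suc a) + 0        ≡⟨ +-identityʳ _ ⟩
  suc a + tri a          ≡⟨ cong suc (+-comm a (tri a)) ⟩
  suc (tri a + a)        ≡⟨ cong (λ z → suc (tri z + a)) (sym (+-identityʳ a)) ⟩
  suc (tri (a + 0) + a)  ∎
  where open ≡-Reasoning
pair-next (a , suc b) = begin
  tri (suc (a + b)) + suc a    ≡⟨ +-suc _ a ⟩
  suc (tri (suc (a + b)) + a)  ≡⟨ cong (λ z → suc (tri z + a)) (sym (+-suc a b)) ⟩
  suc (tri (a + suc b) + a)    ∎
  where open ≡-Reasoning

pair-unpair : ∀ n → pair (proj₁ (unpair n)) (proj₂ (unpair n)) ≡ n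
pair-unpair zero    = refl
pair-unpair (suc n) rewrite unpair-suc n =
  trans (pair-next (unpair n)) (cong suc (pair-unpair n))

pair≡⇒unpair≡ : ∀ {n} a b → pair a b ≡ n → unpair n ≡ (a , b)
pair≡⇒unpair≡ {zero}  zero    zero    _  = refl
pair≡⇒unpair≡ {zero}  zero    (suc b) ()
pair≡⇒unpair≡ {zero}  (suc a) b       ()
pair≡⇒unpair≡ {suc n} zero    zero    ()
pair≡⇒unpair≡ {suc n} zero    (suc a) eq =
  trans (unpair-suc n) (cong next (pair≡⇒unpair≡ a zero
    (suc-injective (trans (sym (pair-next (a , zero))) eq))))
pair≡⇒unpair≡ {suc n} (suc a) b eq =
  trans (unpair-suc n) (cong next (pair≡⇒unpair≡ a (suc b)
    (suc-injective (trans (sym (pair-next (a , suc b))) eq))))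

unpair-pair : ∀ a b → unpair (pair a b) ≡ (a , b)
unpair-pair a b = pair≡⇒unpair≡ a b refl

n≤tri : ∀ n → n ≤ tri n
n≤tri zero    = z≤n
n≤tri (suc n) = m≤m+n (suc n) (tri n)

a≤pair : ∀ a b → a ≤ pair a b
a≤pair a b = m≤n+m a (tri (a + b))

b≤pair : ∀ a b → b ≤ pair a b
b≤pair a b = ≤-trans (m≤n+m b a) (≤-trans (n≤tri (a + b)) (m≤m+n (tri (a + b)) a))

b<pair-suc : ∀ a b → b < pair (suc a) b
b<pair-suc a b = ≤-trans (s≤s (m≤n+m b a))
  (≤-trans (m≤m+n (suc (a + b)) (tri (a + b))) (m≤m+n _ (suc a)))

opaque
  mutual
    encode : Code → ℕ
    encode zer         = 0
    encode sc          = pair 1 0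
    encode (prj i)     = pair 2 i
    encode orc         = pair 3 0
    encode (comp f hs) = pair 4 (pair (encode f) (encodeL hs))
    encode (prec f h)  = pair 5 (pair (encode f) (encode h))
    encode (mu f)      = pair 6 (encode f)

    encodeL : List Code → ℕ
    encodeL []       = 0
    encodeL (c ∷ cs) = suc (pair (encode c) (encodeL cs))

  private
    payload≤ : ∀ t r f → pair (suc t) r ≤ suc f → r ≤ f
    payload≤ t r f le = ≤-pred (≤-trans (b<pair-suc t r) le)

    left≤ : ∀ a b {f} → pair a b ≤ f → a ≤ f
    left≤ a b = ≤-trans (a≤pair a b)

    right≤ : ∀ a b {f} → pair a b ≤ f → b ≤ f
    right≤ a b = ≤-trans (b≤pair a b)

  mutual
    decodeF-encode : ∀ c f → encode c ≤ f → decodeF f (encode c) ≡ c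
    decodeF-encode zer zero _ = refl
    decodeF-encode zer (suc f) _ = refl
    decodeF-encode sc (suc f) _ rewrite unpair-pair 1 0 = refl
    decodeF-encode (prj i) (suc f) _ rewrite unpair-pair 2 i = refl
    decodeF-encode orc (suc f) _ rewrite unpair-pair 3 0 = refl
    decodeF-encode (comp c hs) (suc f) le
      rewrite unpair-pair 4 (pair (encode c) (encodeL hs))
            | unpair-pair (encode c) (encodeL hs) =
      let le' = payload≤ 3 _ f le in
      cong₂ comp (decodeF-encode c f (left≤ _ (encodeL hs) le')) (decodeL-encode hs f (right≤ (encode c) _ le'))
    decodeF-encode (prec c h) (suc f) le
      rewrite unpair-pair 5 (pair (encode c) (encode h))
            | unpair-pair (encode c) (encode h) =
      let le' = payload≤ 4 _ f le in
      cong₂ prec (decodeF-encode c f (left≤ _ (encode h) le')) (decodeF-encode h f (right≤ (encode c) _ le'))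
    decodeF-encode (mu c) (suc f) le rewrite unpair-pair 6 (encode c) =
      cong mu (decodeF-encode c f (payload≤ 5 _ f le))

    decodeL-encode : ∀ cs f → encodeL cs ≤ f → decodeL f (encodeL cs) ≡ cs
    decodeL-encode [] zero _ = refl
    decodeL-encode [] (suc f) _ = refl
    decodeL-encode (c ∷ cs) (suc f) (s≤s le) rewrite unpair-pair (encode c) (encodeL cs) =
      cong₂ _∷_ (decodeF-encode c f (left≤ _ (encodeL cs) le)) (decodeL-encode cs f (right≤ (encode c) _ le))

  decode-encode : ∀ c → decode (encode c) ≡ c
  decode-encode c = decodeF-encode c (encode c) ≤-refl

Φ-encode : ∀ {g c x y} → Eval g c (x ∷ []) y → Φ[ encode c ]⟨ g ⟩ x ⇓ y
Φ-encode {g} {c} {x} {y} = subst (λ d → Eval g d (x ∷ []) y) (sym (decode-encode c))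

record Prog (g : Baire) : Set where
  constructor prog
  field
    code : Code
    sem  : List ℕ → ℕ
    eval : ∀ ρ → Eval g code ρ (sem ρ)
open Prog public

constCode : ℕ → Code
constCode zero    = zer
constCode (suc n) = comp (comp sc (prj 0 ∷ [])) (constCode n ∷ [])

primRec : (List ℕ → ℕ) → (List ℕ → ℕ) → ℕ → List ℕ → ℕ
primRec B S zero    xs = B xs
primRec B S (suc n) xs = S (n ∷ primRec B S n xs ∷ xs)

module _ {g : Baire} where

  Arg : ℕ → Prog g
  Arg i = prog (prj i) (nth i) (λ _ → e-prj)

  Zero : Prog g
  Zero = prog zer (λ _ → 0) (λ _ → e-zer)

  Succ : Prog g
  Succ = prog (comp sc (prj 0 ∷ [])) (λ ρ → suc (nth 0 ρ)) (λ _ → e-comp (e-prj ∷ []) e-sc)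

  Oracle : Prog g
  Oracle = prog (comp orc (prj 0 ∷ [])) (λ ρ → g (nth 0 ρ)) (λ _ → e-comp (e-prj ∷ []) e-orc)

  constCode-eval : ∀ n ρ → Eval g (constCode n) ρ n
  constCode-eval zero    ρ = e-zer
  constCode-eval (suc n) ρ = e-comp (constCode-eval n ρ ∷ []) (e-comp (e-prj ∷ []) e-sc)

  Const : ℕ → Prog g
  Const n = prog (constCode n) (λ _ → n) (constCode-eval n)

  withSem : (p : Prog g) (F : List ℕ → ℕ) → (∀ ρ → sem p ρ ≡ F ρ) → Prog g
  withSem p F eq = prog (code p) F (λ ρ → subst (Eval g (code p) ρ) (eq ρ) (eval p ρ))

  semL : List (Prog g) → List ℕ → List ℕ
  semL []       ρ = []
  semL (p ∷ ps) ρ = sem p ρ ∷ semL ps ρ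

  codeL : List (Prog g) → List Code
  codeL []       = []
  codeL (p ∷ ps) = code p ∷ codeL ps

  evalL : ∀ ps ρ → EvalL g (codeL ps) ρ (semL ps ρ)
  evalL []       ρ = []
  evalL (p ∷ ps) ρ = eval p ρ ∷ evalL ps ρ

  infixl 6 _$_
  _$_ : Prog g → List (Prog g) → Prog g
  f $ ps = prog (comp (code f) (codeL ps)) (λ ρ → sem f (semL ps ρ))
                (λ ρ → e-comp (evalL ps ρ) (eval f (semL ps ρ)))

  prec-eval : (b s : Prog g) → ∀ n xs →
              Eval g (prec (code b) (code s)) (n ∷ xs) (primRec (sem b) (sem s) n xs)
  prec-eval b s zero    xs = e-prec0 (eval b xs)
  prec-eval b s (suc n) xs = e-precS (prec-eval b s n xs) (eval s _)

  -- Rec b s (n ∷ args): primitive recursion on the value of n; the step s sees (i ∷ acc ∷ args).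
  Rec : Prog g → Prog g → List (Prog g) → Prog g
  Rec b s []         = Zero
  Rec b s (n ∷ args) = prog (comp (prec (code b) (code s)) (codeL (n ∷ args)))
    (λ ρ → primRec (sem b) (sem s) (sem n ρ) (semL args ρ))
    (λ ρ → e-comp (evalL (n ∷ args) ρ) (prec-eval b s (sem n ρ) (semL args ρ)))

  Predecessor : Prog g
  Predecessor = withSem (Rec Zero (Arg 0) (Arg 0 ∷ [])) (λ ρ → pred (nth 0 ρ)) (λ ρ → lemma (nth 0 ρ))
    where lemma : ∀ n → primRec (λ _ → 0) (nth 0) n [] ≡ pred n
          lemma zero    = refl
          lemma (suc n) = refl

  Add : Prog g
  Add = withSem (Rec (Arg 0) (Succ $ (Arg 1 ∷ [])) (Arg 0 ∷ Arg 1 ∷ []))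
                (λ ρ → nth 0 ρ + nth 1 ρ) (λ ρ → lemma (nth 0 ρ) (nth 1 ρ))
    where lemma : ∀ n y → primRec (nth 0) (λ ρ → suc (nth 1 ρ)) n (y ∷ []) ≡ n + y
          lemma zero    y = refl
          lemma (suc n) y = cong suc (lemma n y)

  Monus : Prog g
  Monus = withSem (Rec (Arg 0) (Predecessor $ (Arg 1 ∷ [])) (Arg 1 ∷ Arg 0 ∷ []))
                  (λ ρ → nth 0 ρ ∸ nth 1 ρ) (λ ρ → lemma (nth 1 ρ) (nth 0 ρ))
    where lemma : ∀ n x → primRec (nth 0) (λ ρ → pred (nth 1 ρ)) n (x ∷ []) ≡ x ∸ n
          lemma zero    x = refl
          lemma (suc n) x = trans (cong pred (lemma n x)) (pred[m∸n]≡m∸[1+n] x n)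

  Mul : Prog g
  Mul = withSem (Rec Zero (Add $ (Arg 2 ∷ Arg 1 ∷ [])) (Arg 0 ∷ Arg 1 ∷ []))
                (λ ρ → nth 0 ρ * nth 1 ρ) (λ ρ → lemma (nth 0 ρ) (nth 1 ρ))
    where lemma : ∀ n y → primRec (λ _ → 0) (λ ρ → nth 2 ρ + nth 1 ρ) n (y ∷ []) ≡ n * y
          lemma zero    y = refl
          lemma (suc n) y = cong (y +_) (lemma n y)

  Tri : Prog g
  Tri = withSem (Rec Zero (Add $ (Succ $ (Arg 0 ∷ []) ∷ Arg 1 ∷ [])) (Arg 0 ∷ []))
                (λ ρ → tri (nth 0 ρ)) (λ ρ → lemma (nth 0 ρ))
    where lemma : ∀ n → primRec (λ _ → 0) (λ ρ → suc (nth 0 ρ) + nth 1 ρ) n [] ≡ tri n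
          lemma zero    = refl
          lemma (suc n) = cong (suc n +_) (lemma n)

  Pair : Prog g
  Pair = Add $ (Tri $ (Add $ (Arg 0 ∷ Arg 1 ∷ []) ∷ []) ∷ Arg 0 ∷ [])

-- The code of a program built from the combinators above does not depend on the oracle,
-- so it is read off at the zero oracle and the program evaluated at any other.
zeroOracle : Baire
zeroOracle _ = 0

ap₁ : (∀ {g} → Prog g) → Code → Code
ap₁ P a = comp (code (P {zeroOracle})) (a ∷ [])

ap₂ : (∀ {g} → Prog g) → Code → Code → Code
ap₂ P a b = comp (code (P {zeroOracle})) (a ∷ b ∷ [])

ap₃ : (∀ {g} → Prog g) → Code → Code → Code → Code
ap₃ P a b c = comp (code (P {zeroOracle})) (a ∷ b ∷ c ∷ [])

-- Decidable conditions are computed as numbers; a number counts as true when positive.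
✓ : ℕ → Set
✓ n = 0 < n

opaque
  isZero : ℕ → ℕ
  isZero x = 1 ∸ x

  equal : ℕ → ℕ → ℕ
  equal x y = isZero ((x ∸ y) + (y ∸ x))

  ✓isZero⇒≡0 : ∀ {x} → ✓ (isZero x) → x ≡ 0
  ✓isZero⇒≡0 {zero}        _ = refl
  ✓isZero⇒≡0 {suc zero}    ()
  ✓isZero⇒≡0 {suc (suc x)} ()

  ≡0⇒✓isZero : ∀ {x} → x ≡ 0 → ✓ (isZero x)
  ≡0⇒✓isZero refl = s≤s z≤n

  ✓⇒¬✓isZero : ∀ {x} → ✓ x → ¬ ✓ (isZero x)
  ✓⇒¬✓isZero {suc zero}    _ ()
  ✓⇒¬✓isZero {suc (suc x)} _ ()

  isZero-0 : isZero 0 ≡ 1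
  isZero-0 = refl

  isZero-suc : ∀ n → isZero (suc n) ≡ 0
  isZero-suc n = 0∸n≡0 n

  private
    distance≡0⇒≡ : ∀ x y → (x ∸ y) + (y ∸ x) ≡ 0 → x ≡ y
    distance≡0⇒≡ x y d =
      ≤-antisym (m∸n≡0⇒m≤n (m+n≡0⇒m≡0 (x ∸ y) d)) (m∸n≡0⇒m≤n (m+n≡0⇒n≡0 (x ∸ y) d))

  ✓equal⇒≡ : ∀ {x y} → ✓ (equal x y) → x ≡ y
  ✓equal⇒≡ {x} {y} h = distance≡0⇒≡ x y (✓isZero⇒≡0 {(x ∸ y) + (y ∸ x)} h)

  ≡⇒✓equal : ∀ {x y} → x ≡ y → ✓ (equal x y)
  ≡⇒✓equal {x} refl = ≡0⇒✓isZero (cong₂ _+_ (n∸n≡0 x) (n∸n≡0 x))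

  ≢⇒equal≡0 : ∀ {x y} → x ≢ y → equal x y ≡ 0
  ≢⇒equal≡0 {x} {y} ne with (x ∸ y) + (y ∸ x) in eq
  ... | zero  = ⊥-elim (ne (distance≡0⇒≡ x y eq))
  ... | suc k = 0∸n≡0 k

  equal-refl : ∀ x → equal x x ≡ 1
  equal-refl x rewrite n∸n≡0 x = refl

  isZero-unfold : ∀ x → 1 ∸ x ≡ isZero x
  isZero-unfold x = refl

  equal-unfold : ∀ x y → isZero ((x ∸ y) + (y ∸ x)) ≡ equal x y
  equal-unfold x y = refl

nonZero : ℕ → ℕ
nonZero x = isZero (isZero x)

✓nonZero⇒≡suc : ∀ {x} → ✓ (nonZero x) → x ≡ suc (pred x)
✓nonZero⇒≡suc {zero}  h = ⊥-elim (✓⇒¬✓isZero (≡0⇒✓isZero {0} refl) h)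
✓nonZero⇒≡suc {suc x} h = refl

≡suc⇒✓nonZero : ∀ {x m} → x ≡ suc m → ✓ (nonZero x)
≡suc⇒✓nonZero {m = m} refl = ≡0⇒✓isZero (isZero-suc m)

✓-dec : ∀ n → ✓ n ⊎ n ≡ 0
✓-dec zero    = inj₂ refl
✓-dec (suc n) = inj₁ (s≤s z≤n)

✓*⇒✓×✓ : ∀ {a b} → ✓ (a * b) → ✓ a × ✓ b
✓*⇒✓×✓ {suc a} {suc b} _ = s≤s z≤n , s≤s z≤n
✓*⇒✓×✓ {zero}          ()
✓*⇒✓×✓ {suc a} {zero}  h rewrite *-zeroʳ a = ⊥-elim (<-irrefl refl h)

✓×✓⇒✓* : ∀ {a b} → ✓ a → ✓ b → ✓ (a * b)
✓×✓⇒✓* {suc a} {suc b} _ _ = s≤s z≤n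

✓+⇒✓⊎✓ : ∀ {a b} → ✓ (a + b) → ✓ a ⊎ ✓ b
✓+⇒✓⊎✓ {suc a} _ = inj₁ (s≤s z≤n)
✓+⇒✓⊎✓ {zero}  h = inj₂ h

✓+ˡ : ∀ {a} b → ✓ a → ✓ (a + b)
✓+ˡ {suc a} b _ = s≤s z≤n

✓+ʳ : ∀ a {b} → ✓ b → ✓ (a + b)
✓+ʳ a {b} h = ≤-trans h (m≤n+m b a)

bsum : (ℕ → ℕ) → ℕ → ℕ
bsum f zero    = 0
bsum f (suc n) = bsum f n + f n

bprod : (ℕ → ℕ) → ℕ → ℕ
bprod f zero    = 1
bprod f (suc n) = bprod f n * f n

✓bsum⇒∃ : ∀ f n → ✓ (bsum f n) → Σ ℕ λ j → j < n × ✓ (f j)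
✓bsum⇒∃ f (suc n) h with ✓+⇒✓⊎✓ {bsum f n} h
... | inj₁ h' = let (j , j<n , fj) = ✓bsum⇒∃ f n h' in j , m≤n⇒m≤1+n j<n , fj
... | inj₂ h' = n , ≤-refl , h'

∃⇒✓bsum : ∀ f n j → j < n → ✓ (f j) → ✓ (bsum f n)
∃⇒✓bsum f (suc n) j j<1+n fj with j ≟ n
... | yes refl = ✓+ʳ (bsum f n) fj
... | no j≢n   = ✓+ˡ (f n) (∃⇒✓bsum f n j (≤∧≢⇒< (≤-pred j<1+n) j≢n) fj)

✓bprod⇒∀ : ∀ f n → ✓ (bprod f n) → ∀ j → j < n → ✓ (f j)
✓bprod⇒∀ f (suc n) h j j<1+n with ✓*⇒✓×✓ {bprod f n} h | j ≟ n
... | (_ , fn) | yes refl = fn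
... | (h' , _) | no j≢n   = ✓bprod⇒∀ f n h' j (≤∧≢⇒< (≤-pred j<1+n) j≢n)

∀⇒✓bprod : ∀ f n → (∀ j → j < n → ✓ (f j)) → ✓ (bprod f n)
∀⇒✓bprod f zero    h = s≤s z≤n
∀⇒✓bprod f (suc n) h = ✓×✓⇒✓* (∀⇒✓bprod f n (λ j j<n → h j (m≤n⇒m≤1+n j<n))) (h n ≤-refl)

module _ {g : Baire} where

  IsZero : Prog g
  IsZero = withSem (Monus $ (Const 1 ∷ Arg 0 ∷ [])) (λ ρ → isZero (nth 0 ρ))
                   (λ ρ → isZero-unfold (nth 0 ρ))

  Equal : Prog g
  Equal = withSem (IsZero $ (Add $ (Monus $ (Arg 0 ∷ Arg 1 ∷ []) ∷ Monus $ (Arg 1 ∷ Arg 0 ∷ []) ∷ []) ∷ []))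
                  (λ ρ → equal (nth 0 ρ) (nth 1 ρ)) (λ ρ → equal-unfold (nth 0 ρ) (nth 1 ρ))

  Bsum : Prog g → List (Prog g) → Prog g
  Bsum p args = Rec Zero (Add $ (Arg 1 ∷ p ∷ [])) args

  Bsum-sem : ∀ p n args ρ (F : ℕ → ℕ) →
             (∀ j a → sem p (j ∷ a ∷ semL args ρ) ≡ F j) →
             sem (Bsum p (n ∷ args)) ρ ≡ bsum F (sem n ρ)
  Bsum-sem p n args ρ F hyp = go (sem n ρ)
    where go : ∀ k → primRec (λ _ → 0) (λ σ → nth 1 σ + sem p σ) k (semL args ρ) ≡ bsum F k
          go zero    = refl
          go (suc k) = cong₂ _+_ (go k) (hyp k _)

  Bprod : Prog g → List (Prog g) → Prog g
  Bprod p args = Rec (Const 1) (Mul $ (Arg 1 ∷ p ∷ [])) args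

  Bprod-sem : ∀ p n args ρ (F : ℕ → ℕ) →
              (∀ j a → sem p (j ∷ a ∷ semL args ρ) ≡ F j) →
              sem (Bprod p (n ∷ args)) ρ ≡ bprod F (sem n ρ)
  Bprod-sem p n args ρ F hyp = go (sem n ρ)
    where go : ∀ k → primRec (λ _ → 1) (λ σ → nth 1 σ * sem p σ) k (semL args ρ) ≡ bprod F k
          go zero    = refl
          go (suc k) = cong₂ _*_ (go k) (hyp k _)

✓*₅ : ∀ {a b c d e} → ✓ (a * b * c * d * e) → ✓ a × ✓ b × ✓ c × ✓ d × ✓ e
✓*₅ {a} {b} {c} {d} h =
  let (h₄ , e) = ✓*⇒✓×✓ {a * b * c * d} h ; (h₃ , d) = ✓*⇒✓×✓ {a * b * c} h₄
      (h₂ , c) = ✓*⇒✓×✓ {a * b} h₃ ; (a , b) = ✓*⇒✓×✓ {a} h₂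
  in a , b , c , d , e

✓bsum²⇒∃ : ∀ (F : ℕ → ℕ → ℕ) n → ✓ (bsum (λ j → bsum (F j) n) n) →
           Σ ℕ λ j → Σ ℕ λ j' → j < n × j' < n × ✓ (F j j')
✓bsum²⇒∃ F n h =
  let (j , j<n , h') = ✓bsum⇒∃ (λ j → bsum (F j) n) n h ; (j' , j'<n , h'') = ✓bsum⇒∃ (F j) n h'
  in j , j' , j<n , j'<n , h''

infixl 7 _✓*_
_✓*_ : ∀ {a b} → ✓ a → ✓ b → ✓ (a * b)
_✓*_ = ✓×✓⇒✓*

✓⇒isZero≡0 : ∀ {a} → ✓ a → isZero a ≡ 0
✓⇒isZero≡0 {suc a} _ = isZero-suc a

-- unpair, recomputed by primitive recursion so that programs can compute it.

opaque
  diagonal : ℕ → ℕ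
  diagonal zero    = 0
  diagonal (suc n) = diagonal n + equal (tri (suc (diagonal n))) (suc n)

  unpair₁ : ℕ → ℕ
  unpair₁ n = n ∸ tri (diagonal n)

  unpair₂ : ℕ → ℕ
  unpair₂ n = diagonal n ∸ unpair₁ n

  -- n lies on the diagonal a + b = diagonal n of the pairing.
  diagonal-bounds : ∀ n → (tri (diagonal n) ≤ n) × (n ∸ tri (diagonal n) ≤ diagonal n)
  diagonal-bounds zero = z≤n , z≤n
  diagonal-bounds (suc n) with diagonal-bounds n | tri (suc (diagonal n)) ≟ suc n
  ... | _ | yes eq =
    subst (λ s' → (tri s' ≤ suc n) × (suc n ∸ tri s' ≤ s')) (sym step)
      (≤-reflexive eq , subst (λ z → suc n ∸ z ≤ suc (diagonal n)) (sym eq)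
                          (subst (_≤ suc (diagonal n)) (sym (n∸n≡0 (suc n))) z≤n))
    where
      step : diagonal (suc n) ≡ suc (diagonal n)
      step = trans (cong (diagonal n +_) (trans (cong (λ z → equal z (suc n)) eq) (equal-refl (suc n))))
                   (+-comm (diagonal n) 1)
  ... | (low , high) | no ne =
    subst (λ s' → (tri s' ≤ suc n) × (suc n ∸ tri s' ≤ s')) (sym step)
      (m≤n⇒m≤1+n low , ≤-trans (≤-reflexive (+-∸-assoc 1 low)) (≤∧≢⇒< high off-corner))
    where
      s : ℕ
      s = diagonal n
      step : diagonal (suc n) ≡ diagonal n
      step = trans (cong (diagonal n +_) (≢⇒equal≡0 ne)) (+-identityʳ (diagonal n))
      off-corner : n ∸ tri s ≢ s
      off-corner e = ne (begin
        tri (suc s)              ≡⟨ cong (λ z → suc z + tri s) (sym e) ⟩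
        suc (n ∸ tri s) + tri s  ≡⟨ cong suc (m∸n+n≡m low) ⟩
        suc n                    ∎)
        where open ≡-Reasoning

  unpair≡unpair₁₂ : ∀ n → unpair n ≡ (unpair₁ n , unpair₂ n)
  unpair≡unpair₁₂ n = pair≡⇒unpair≡ (unpair₁ n) (unpair₂ n) eq
    where
      bounds : (tri (diagonal n) ≤ n) × (n ∸ tri (diagonal n) ≤ diagonal n)
      bounds = diagonal-bounds n
      eq : tri (unpair₁ n + unpair₂ n) + unpair₁ n ≡ n
      eq rewrite m+[n∸m]≡n (proj₂ bounds) = m+[n∸m]≡n (proj₁ bounds)

  diagonal-suc : ∀ n → diagonal (suc n) ≡ diagonal n + equal (tri (suc (diagonal n))) (suc n)
  diagonal-suc n = refl

  unpair₁-unfold : ∀ n → n ∸ tri (diagonal n) ≡ unpair₁ n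
  unpair₁-unfold n = refl

  unpair₂-unfold : ∀ n → diagonal n ∸ unpair₁ n ≡ unpair₂ n
  unpair₂-unfold n = refl

  unpair₁-0 : unpair₁ 0 ≡ 0
  unpair₁-0 = refl

  unpair₂-0 : unpair₂ 0 ≡ 0
  unpair₂-0 = refl

  diagonal-0 : diagonal 0 ≡ 0
  diagonal-0 = refl

unpair₁-correct : ∀ n → proj₁ (unpair n) ≡ unpair₁ n
unpair₁-correct n = cong proj₁ (unpair≡unpair₁₂ n)

unpair₂-correct : ∀ n → proj₂ (unpair n) ≡ unpair₂ n
unpair₂-correct n = cong proj₂ (unpair≡unpair₁₂ n)

unpair₁-pair : ∀ a b → unpair₁ (pair a b) ≡ a
unpair₁-pair a b = trans (sym (unpair₁-correct (pair a b))) (cong proj₁ (unpair-pair a b))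

unpair₂-pair : ∀ a b → unpair₂ (pair a b) ≡ b
unpair₂-pair a b = trans (sym (unpair₂-correct (pair a b))) (cong proj₂ (unpair-pair a b))

pair-unpair₁₂ : ∀ q → pair (unpair₁ q) (unpair₂ q) ≡ q
pair-unpair₁₂ q = trans (cong₂ pair (sym (unpair₁-correct q)) (sym (unpair₂-correct q))) (pair-unpair q)

module _ {g : Baire} where

  Diagonal : Prog g
  Diagonal =
    withSem (Rec Zero (Add $ (Arg 1 ∷ Equal $ (Tri $ (Succ $ (Arg 1 ∷ []) ∷ []) ∷ Succ $ (Arg 0 ∷ []) ∷ []) ∷ []))
                 (Arg 0 ∷ []))
            (λ ρ → diagonal (nth 0 ρ)) (λ ρ → go (nth 0 ρ))
    where go : ∀ n → primRec (λ _ → 0) (λ ρ → nth 1 ρ + equal (tri (suc (nth 1 ρ))) (suc (nth 0 ρ))) n []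
                     ≡ diagonal n
          go zero    = sym diagonal-0
          go (suc n) = trans (cong (λ r → r + equal (tri (suc r)) (suc n)) (go n)) (sym (diagonal-suc n))

  Unpair₁ : Prog g
  Unpair₁ = withSem (Monus $ (Arg 0 ∷ Tri $ (Diagonal ∷ []) ∷ [])) (λ ρ → unpair₁ (nth 0 ρ))
                    (λ ρ → unpair₁-unfold (nth 0 ρ))

  Unpair₂ : Prog g
  Unpair₂ = withSem (Monus $ (Diagonal ∷ Unpair₁ ∷ [])) (λ ρ → unpair₂ (nth 0 ρ))
                    (λ ρ → unpair₂-unfold (nth 0 ρ))

encodeList : List ℕ → ℕ
encodeList []       = 0
encodeList (x ∷ xs) = suc (pair x (encodeList xs))

consᴺ : ℕ → ℕ → ℕ
consᴺ x l = suc (pair x l)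

headᴺ tailᴺ : ℕ → ℕ
headᴺ l = unpair₁ (pred l)
tailᴺ l = unpair₂ (pred l)

dropᴺ : ℕ → ℕ → ℕ
dropᴺ zero    l = l
dropᴺ (suc i) l = tailᴺ (dropᴺ i l)

nthᴺ : ℕ → ℕ → ℕ
nthᴺ i l = headᴺ (dropᴺ i l)

headᴺ-encode : ∀ x xs → headᴺ (encodeList (x ∷ xs)) ≡ x
headᴺ-encode x xs = unpair₁-pair x (encodeList xs)

tailᴺ-encode : ∀ x xs → tailᴺ (encodeList (x ∷ xs)) ≡ encodeList xs
tailᴺ-encode x xs = unpair₂-pair x (encodeList xs)

dropᴺ-suc : ∀ i l → dropᴺ (suc i) l ≡ dropᴺ i (tailᴺ l)
dropᴺ-suc zero    l = refl
dropᴺ-suc (suc i) l = cong tailᴺ (dropᴺ-suc i l)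

-- Out of range, both sides are 0.
nthᴺ-encode : ∀ i xs → nthᴺ i (encodeList xs) ≡ nth i xs
nthᴺ-encode zero    []       = unpair₁-0
nthᴺ-encode (suc i) []       = nthᴺ-0 i
  where nthᴺ-0 : ∀ i → headᴺ (dropᴺ (suc i) 0) ≡ 0
        nthᴺ-0 zero    = trans (cong (λ z → unpair₁ (pred z)) unpair₂-0) unpair₁-0
        nthᴺ-0 (suc i) = trans (cong headᴺ (dropᴺ-suc (suc i) 0))
                               (trans (cong (λ z → headᴺ (dropᴺ (suc i) z)) unpair₂-0) (nthᴺ-0 i))
nthᴺ-encode zero    (x ∷ xs) = headᴺ-encode x xs
nthᴺ-encode (suc i) (x ∷ xs) =
  trans (cong headᴺ (trans (dropᴺ-suc i (encodeList (x ∷ xs))) (cong (dropᴺ i) (tailᴺ-encode x xs))))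
        (nthᴺ-encode i xs)

nthᴺ-encode-∈ : ∀ (ns : List ℕ) i → i < length ns → nthᴺ i (encodeList ns) ∈ ns
nthᴺ-encode-∈ ns i i<len = subst (_∈ ns) (sym (nthᴺ-encode i ns)) (nth-∈ ns i i<len)
  where nth-∈ : ∀ (ns : List ℕ) i → i < length ns → nth i ns ∈ ns
        nth-∈ (x ∷ ns) zero    _         = here refl
        nth-∈ (x ∷ ns) (suc i) (s≤s i<n) = there (nth-∈ ns i i<n)

∈⇒nthᴺ-encode : ∀ {ns} {y : ℕ} → y ∈ ns → Σ ℕ λ j → j < length ns × nthᴺ j (encodeList ns) ≡ y
∈⇒nthᴺ-encode {ns} y∈ns = let (j , j<len , e) = index y∈ns in j , j<len , trans (nthᴺ-encode j ns) e
  where index : ∀ {ns} {y : ℕ} → y ∈ ns → Σ ℕ λ j → j < length ns × nth j ns ≡ y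
        index (here refl) = 0 , s≤s z≤n , refl
        index (there p)   = let (j , j<len , e) = index p in suc j , s≤s j<len , e

module _ {g : Baire} where

  Head : Prog g
  Head = Unpair₁ $ (Predecessor $ (Arg 0 ∷ []) ∷ [])

  Tail : Prog g
  Tail = Unpair₂ $ (Predecessor $ (Arg 0 ∷ []) ∷ [])

  -- arguments: index, then list
  Nth : Prog g
  Nth = withSem (Head $ (Rec (Arg 0) (Tail $ (Arg 1 ∷ [])) (Arg 0 ∷ Arg 1 ∷ []) ∷ []))
                (λ ρ → nthᴺ (nth 0 ρ) (nth 1 ρ)) (λ ρ → cong headᴺ (go (nth 0 ρ) (nth 1 ρ)))
    where go : ∀ i l → primRec (nth 0) (λ ρ → tailᴺ (nth 1 ρ)) i (l ∷ []) ≡ dropᴺ i l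
          go zero    l = refl
          go (suc i) l = cong tailᴺ (go i l)

-- A trace is a coded list of nodes.  The node ⟨0, f, n, a, y⟩ asserts
-- Eval g (decodeF f n) xs y and ⟨1, f, n, a, y⟩ asserts EvalL g (decodeL f n) xs ys,
-- where a and y code the lists xs and ys.
node : ℕ → ℕ → ℕ → ℕ → ℕ → ℕ
node k f n a y = pair k (pair f (pair n (pair a y)))

kindᴺ fuelᴺ indexᴺ inputᴺ outputᴺ : ℕ → ℕ
kindᴺ   X = unpair₁ X
fuelᴺ   X = unpair₁ (unpair₂ X)
indexᴺ  X = unpair₁ (unpair₂ (unpair₂ X))
inputᴺ  X = unpair₁ (unpair₂ (unpair₂ (unpair₂ X)))
outputᴺ X = unpair₂ (unpair₂ (unpair₂ (unpair₂ X)))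

-- The node X of trace T (of length L) is justified by other nodes of T,
-- following the clauses of Eval and EvalL and the decoding of n with fuel f.
module Justification (g : Baire) (T L : ℕ) (k f n a y : ℕ) where
  f' tag r : ℕ
  f'  = pred f
  tag = unpair₁ n
  r   = unpair₂ n

  entry : ℕ → ℕ
  entry j = nthᴺ j T

  compPremises : ℕ → ℕ → ℕ
  compPremises j j' =
    equal (kindᴺ (entry j)) 1 * equal (fuelᴺ (entry j)) f' * equal (indexᴺ (entry j)) (unpair₂ r)
    * equal (inputᴺ (entry j)) a * equal (entry j') (node 0 f' (unpair₁ r) (outputᴺ (entry j)) y)

  precBasePremise : ℕ → ℕ
  precBasePremise j = equal (entry j) (node 0 f' (unpair₁ r) (tailᴺ a) y)

  precStepPremises : ℕ → ℕ → ℕ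
  precStepPremises j j' =
    isZero (kindᴺ (entry j)) * equal (fuelᴺ (entry j)) f * equal (indexᴺ (entry j)) n
    * equal (inputᴺ (entry j)) (consᴺ (pred (headᴺ a)) (tailᴺ a))
    * equal (entry j') (node 0 f' (unpair₂ r)
                              (consᴺ (pred (headᴺ a)) (consᴺ (outputᴺ (entry j)) (tailᴺ a))) y)

  muZeroPremise : ℕ → ℕ
  muZeroPremise j = equal (entry j) (node 0 f' r (consᴺ y a) 0)

  muPositivePremise : ℕ → ℕ → ℕ
  muPositivePremise w j =
    isZero (kindᴺ (entry j)) * equal (fuelᴺ (entry j)) f' * equal (indexᴺ (entry j)) r
    * equal (inputᴺ (entry j)) (consᴺ w a) * nonZero (outputᴺ (entry j))

  consPremises : ℕ → ℕ → ℕ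
  consPremises j j' =
    equal (entry j) (node 0 f' (unpair₁ (pred n)) a (headᴺ y))
    * equal (entry j') (node 1 f' (unpair₂ (pred n)) a (tailᴺ y))

  -- Parametrised by the values of the bounded searches, so that the checking
  -- program can be shown to compute it one search at a time.
  module Combine (comp precBase precStep muZero muPositive cons : ℕ) where
    byTag : ℕ
    byTag = (isZero tag + isZero (7 ∸ tag)) * isZero y
          + equal tag 1 * (nonZero a * equal y (suc (headᴺ a)))
          + equal tag 2 * equal y (nthᴺ r a)
          + equal tag 3 * (nonZero a * equal y (g (headᴺ a)))
          + equal tag 4 * comp
          + equal tag 5 * (nonZero a * (isZero (headᴺ a) * precBase + nonZero (headᴺ a) * precStep))
          + equal tag 6 * (muZero * muPositive)

    codeJustified listJustified justified : ℕ
    codeJustified = isZero f * isZero y + nonZero f * byTag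
    listJustified = isZero f * isZero y + nonZero f * (isZero n * isZero y + nonZero n * (nonZero y * cons))
    justified     = isZero k * codeJustified + equal k 1 * listJustified

  hasComp hasPrecBase hasPrecStep hasMuZero allMuPositive hasCons : ℕ
  hasComp       = bsum (λ j → bsum (λ j' → compPremises j j') L) L
  hasPrecBase   = bsum precBasePremise L
  hasPrecStep   = bsum (λ j → bsum (λ j' → precStepPremises j j') L) L
  hasMuZero     = bsum muZeroPremise L
  allMuPositive = bprod (λ w → bsum (λ j → muPositivePremise w j) L) y
  hasCons       = bsum (λ j → bsum (λ j' → consPremises j j') L) L

  open Combine hasComp hasPrecBase hasPrecStep hasMuZero allMuPositive hasCons public

justifiedNode : Baire → ℕ → ℕ → ℕ → ℕ
justifiedNode g T L X =
  Justification.justified g T L (kindᴺ X) (fuelᴺ X) (indexᴺ X) (inputᴺ X) (outputᴺ X)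

validTrace : Baire → ℕ → ℕ → ℕ
validTrace g T L = bprod (λ i → justifiedNode g T L (nthᴺ i T)) L

-- w = ⟨y, ⟨L, T⟩⟩ certifies Φ_e(g)(x) = y when T is valid and contains the root node.
certifies : Baire → ℕ → ℕ → ℕ → ℕ
certifies g w e x = validTrace g T L * bsum (λ i → equal (nthᴺ i T) (node 0 e e (consᴺ x 0) y)) L
  where y = unpair₁ w ; L = unpair₁ (unpair₂ w) ; T = unpair₂ (unpair₂ w)

module CheckerPrograms {g : Baire} where

  infixl 7 _×ᵖ_
  infixl 6 _+ᵖ_
  _×ᵖ_ _+ᵖ_ _∸ᵖ_ equalᵖ pairᵖ consᵖ nthᵖ : Prog g → Prog g → Prog g
  a ×ᵖ b    = Mul $ (a ∷ b ∷ [])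
  a +ᵖ b    = Add $ (a ∷ b ∷ [])
  a ∸ᵖ b    = Monus $ (a ∷ b ∷ [])
  equalᵖ a b = Equal $ (a ∷ b ∷ [])
  pairᵖ a b = Pair $ (a ∷ b ∷ [])
  consᵖ a b = Succ $ (pairᵖ a b ∷ [])
  nthᵖ i l  = Nth $ (i ∷ l ∷ [])

  isZeroᵖ nonZeroᵖ unpair₁ᵖ unpair₂ᵖ headᵖ tailᵖ predᵖ sucᵖ oracleᵖ : Prog g → Prog g
  isZeroᵖ a  = IsZero $ (a ∷ [])
  nonZeroᵖ a = isZeroᵖ (isZeroᵖ a)
  unpair₁ᵖ a = Unpair₁ $ (a ∷ [])
  unpair₂ᵖ a = Unpair₂ $ (a ∷ [])
  headᵖ a    = Head $ (a ∷ [])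
  tailᵖ a    = Tail $ (a ∷ [])
  predᵖ a    = Predecessor $ (a ∷ [])
  sucᵖ a     = Succ $ (a ∷ [])
  oracleᵖ a  = Oracle $ (a ∷ [])

  kindᵖ fuelᵖ indexᵖ inputᵖ outputᵖ : Prog g → Prog g
  kindᵖ X   = unpair₁ᵖ X
  fuelᵖ X   = unpair₁ᵖ (unpair₂ᵖ X)
  indexᵖ X  = unpair₁ᵖ (unpair₂ᵖ (unpair₂ᵖ X))
  inputᵖ X  = unpair₁ᵖ (unpair₂ᵖ (unpair₂ᵖ (unpair₂ᵖ X)))
  outputᵖ X = unpair₂ᵖ (unpair₂ᵖ (unpair₂ᵖ (unpair₂ᵖ X)))

  nodeᵖ : Prog g → Prog g → Prog g → Prog g → Prog g → Prog g
  nodeᵖ k f n a y = pairᵖ k (pairᵖ f (pairᵖ n (pairᵖ a y)))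

  -- inner search, environment j' ∷ acc ∷ j ∷ T ∷ L ∷ X ∷ []
  module Inner where
    j' j T X f' r entry-j entry-j' : Prog g
    j' = Arg 0 ; j = Arg 2 ; T = Arg 3 ; X = Arg 5
    f' = predᵖ (fuelᵖ X)
    r = unpair₂ᵖ (indexᵖ X)
    entry-j = nthᵖ j T
    entry-j' = nthᵖ j' T

    compPremises : Prog g
    compPremises =
      equalᵖ (kindᵖ entry-j) (Const 1) ×ᵖ equalᵖ (fuelᵖ entry-j) f' ×ᵖ equalᵖ (indexᵖ entry-j) (unpair₂ᵖ r)
      ×ᵖ equalᵖ (inputᵖ entry-j) (inputᵖ X)
      ×ᵖ equalᵖ entry-j' (nodeᵖ (Const 0) f' (unpair₁ᵖ r) (outputᵖ entry-j) (outputᵖ X))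

    precStepPremises : Prog g
    precStepPremises =
      isZeroᵖ (kindᵖ entry-j) ×ᵖ equalᵖ (fuelᵖ entry-j) (fuelᵖ X) ×ᵖ equalᵖ (indexᵖ entry-j) (indexᵖ X)
      ×ᵖ equalᵖ (inputᵖ entry-j) (consᵖ (predᵖ (headᵖ (inputᵖ X))) (tailᵖ (inputᵖ X)))
      ×ᵖ equalᵖ entry-j' (nodeᵖ (Const 0) f' (unpair₂ᵖ r)
                                (consᵖ (predᵖ (headᵖ (inputᵖ X))) (consᵖ (outputᵖ entry-j) (tailᵖ (inputᵖ X))))
                                (outputᵖ X))

    -- here the outer variable j plays the role of the mu-candidate w
    muPositivePremise : Prog g
    muPositivePremise =
      isZeroᵖ (kindᵖ entry-j') ×ᵖ equalᵖ (fuelᵖ entry-j') f' ×ᵖ equalᵖ (indexᵖ entry-j') (unpair₂ᵖ (indexᵖ X))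
      ×ᵖ equalᵖ (inputᵖ entry-j') (consᵖ j (inputᵖ X)) ×ᵖ nonZeroᵖ (outputᵖ entry-j')

    consPremises : Prog g
    consPremises =
      equalᵖ entry-j (nodeᵖ (Const 0) f' (unpair₁ᵖ (predᵖ (indexᵖ X))) (inputᵖ X) (headᵖ (outputᵖ X)))
      ×ᵖ equalᵖ entry-j' (nodeᵖ (Const 1) f' (unpair₂ᵖ (predᵖ (indexᵖ X))) (inputᵖ X) (tailᵖ (outputᵖ X)))

  -- outer search, environment j ∷ acc ∷ T ∷ L ∷ X ∷ []
  module Outer where
    j T L X f' r entry-j : Prog g
    j = Arg 0 ; T = Arg 2 ; L = Arg 3 ; X = Arg 4
    f' = predᵖ (fuelᵖ X)
    r = unpair₂ᵖ (indexᵖ X)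
    entry-j = nthᵖ j T

    searchInner : Prog g → Prog g
    searchInner b = Bsum b (L ∷ Arg 0 ∷ T ∷ L ∷ X ∷ [])

    compPremises precBasePremise precStepPremises muZeroPremise muPositivePremise consPremises : Prog g
    compPremises      = searchInner Inner.compPremises
    precBasePremise   = equalᵖ entry-j (nodeᵖ (Const 0) f' (unpair₁ᵖ r) (tailᵖ (inputᵖ X)) (outputᵖ X))
    precStepPremises  = searchInner Inner.precStepPremises
    muZeroPremise     = equalᵖ entry-j (nodeᵖ (Const 0) f' r (consᵖ (outputᵖ X) (inputᵖ X)) (Const 0))
    muPositivePremise = searchInner Inner.muPositivePremise
    consPremises      = searchInner Inner.consPremises

  module Node (T L X : Prog g) where
    searchOuter : Prog g → Prog g
    searchOuter b = Bsum b (L ∷ T ∷ L ∷ X ∷ [])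

    k f n a y tag r : Prog g
    k = kindᵖ X ; f = fuelᵖ X ; n = indexᵖ X ; a = inputᵖ X ; y = outputᵖ X
    tag = unpair₁ᵖ n ; r = unpair₂ᵖ n

    byTag codeJustified listJustified justified : Prog g
    byTag = (isZeroᵖ tag +ᵖ isZeroᵖ (Const 7 ∸ᵖ tag)) ×ᵖ isZeroᵖ y
       +ᵖ equalᵖ tag (Const 1) ×ᵖ (nonZeroᵖ a ×ᵖ equalᵖ y (sucᵖ (headᵖ a)))
       +ᵖ equalᵖ tag (Const 2) ×ᵖ equalᵖ y (nthᵖ r a)
       +ᵖ equalᵖ tag (Const 3) ×ᵖ (nonZeroᵖ a ×ᵖ equalᵖ y (oracleᵖ (headᵖ a)))
       +ᵖ equalᵖ tag (Const 4) ×ᵖ searchOuter Outer.compPremises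
       +ᵖ equalᵖ tag (Const 5) ×ᵖ (nonZeroᵖ a ×ᵖ (isZeroᵖ (headᵖ a) ×ᵖ searchOuter Outer.precBasePremise
                                              +ᵖ nonZeroᵖ (headᵖ a) ×ᵖ searchOuter Outer.precStepPremises))
       +ᵖ equalᵖ tag (Const 6) ×ᵖ (searchOuter Outer.muZeroPremise
                                   ×ᵖ Bprod Outer.muPositivePremise (y ∷ T ∷ L ∷ X ∷ []))
    codeJustified = isZeroᵖ f ×ᵖ isZeroᵖ y +ᵖ nonZeroᵖ f ×ᵖ byTag
    listJustified = isZeroᵖ f ×ᵖ isZeroᵖ y
                 +ᵖ nonZeroᵖ f ×ᵖ (isZeroᵖ n ×ᵖ isZeroᵖ y
                                  +ᵖ nonZeroᵖ n ×ᵖ (nonZeroᵖ y ×ᵖ searchOuter Outer.consPremises))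
    justified = isZeroᵖ k ×ᵖ codeJustified +ᵖ equalᵖ k (Const 1) ×ᵖ listJustified

  module NodeSem (T L X : Prog g) (ρ : List ℕ) where
    private
      Tv = sem T ρ ; Lv = sem L ρ ; Xv = sem X ρ
      module J = Justification g Tv Lv (kindᴺ Xv) (fuelᴺ Xv) (indexᴺ Xv) (inputᴺ Xv) (outputᴺ Xv)
      args : List (Prog g)
      args = T ∷ L ∷ X ∷ []
      outer : ∀ (b : Prog g) F → (∀ j a → sem b (j ∷ a ∷ Tv ∷ Lv ∷ Xv ∷ []) ≡ F j) →
              sem (Node.searchOuter T L X b) ρ ≡ bsum F Lv
      outer b F = Bsum-sem b L args ρ F
      nested : ∀ (b : Prog g) (F : ℕ → ℕ → ℕ) → (∀ a j j' → sem b (j' ∷ a ∷ j ∷ Tv ∷ Lv ∷ Xv ∷ []) ≡ F j j') →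
               ∀ j a → sem (Outer.searchInner b) (j ∷ a ∷ Tv ∷ Lv ∷ Xv ∷ []) ≡ bsum (F j) Lv
      nested b F eq j a =
        Bsum-sem b (Arg 3) (Arg 0 ∷ Arg 2 ∷ Arg 3 ∷ Arg 4 ∷ []) (j ∷ a ∷ Tv ∷ Lv ∷ Xv ∷ []) (F j)
                 (λ j' a' → eq a' j j')
    open Node T L X

    justified-sem : sem justified ρ ≡ J.justified
    justified-sem = cong₆ J.Combine.justified
      (outer Outer.compPremises (λ j → bsum (J.compPremises j) Lv)
             (nested Inner.compPremises J.compPremises (λ _ _ _ → refl)))
      (outer Outer.precBasePremise J.precBasePremise (λ _ _ → refl))
      (outer Outer.precStepPremises (λ j → bsum (J.precStepPremises j) Lv)
             (nested Inner.precStepPremises J.precStepPremises (λ _ _ _ → refl)))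
      (outer Outer.muZeroPremise J.muZeroPremise (λ _ _ → refl))
      (Bprod-sem Outer.muPositivePremise y args ρ (λ w → bsum (J.muPositivePremise w) Lv)
                 (nested Inner.muPositivePremise J.muPositivePremise (λ _ _ _ → refl)))
      (outer Outer.consPremises (λ j → bsum (J.consPremises j) Lv)
             (nested Inner.consPremises J.consPremises (λ _ _ _ → refl)))
      where
        cong₆ : ∀ (F : ℕ → ℕ → ℕ → ℕ → ℕ → ℕ → ℕ) {a₁ b₁ a₂ b₂ a₃ b₃ a₄ b₄ a₅ b₅ a₆ b₆} →
                a₁ ≡ b₁ → a₂ ≡ b₂ → a₃ ≡ b₃ → a₄ ≡ b₄ → a₅ ≡ b₅ → a₆ ≡ b₆ →
                F a₁ a₂ a₃ a₄ a₅ a₆ ≡ F b₁ b₂ b₃ b₄ b₅ b₆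
        cong₆ F refl refl refl refl refl refl = refl

  -- environment i ∷ acc ∷ T ∷ L ∷ []
  ValidTrace : Prog g → Prog g → Prog g
  ValidTrace T L = Bprod (Node.justified (Arg 2) (Arg 3) (nthᵖ (Arg 0) (Arg 2))) (L ∷ T ∷ L ∷ [])

  ValidTrace-sem : ∀ T L ρ → sem (ValidTrace T L) ρ ≡ validTrace g (sem T ρ) (sem L ρ)
  ValidTrace-sem T L ρ =
    Bprod-sem (Node.justified (Arg 2) (Arg 3) (nthᵖ (Arg 0) (Arg 2))) L (T ∷ L ∷ []) ρ
              (λ i → justifiedNode g (sem T ρ) (sem L ρ) (nthᴺ i (sem T ρ)))
              (λ i a → NodeSem.justified-sem (Arg 2) (Arg 3) (nthᵖ (Arg 0) (Arg 2)) (i ∷ a ∷ sem T ρ ∷ sem L ρ ∷ []))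

  -- environment i ∷ acc ∷ T ∷ w ∷ e ∷ x ∷ []
  IsRoot : Prog g
  IsRoot = equalᵖ (nthᵖ (Arg 0) (Arg 2))
                  (nodeᵖ (Const 0) (Arg 4) (Arg 4) (consᵖ (Arg 5) (Const 0)) (unpair₁ᵖ (Arg 3)))

  -- environment w ∷ e ∷ x ∷ []
  Certifies : Prog g
  Certifies = ValidTrace T L ×ᵖ Bsum IsRoot (L ∷ T ∷ Arg 0 ∷ Arg 1 ∷ Arg 2 ∷ [])
    where T = unpair₂ᵖ (unpair₂ᵖ (Arg 0)) ; L = unpair₁ᵖ (unpair₂ᵖ (Arg 0))

  Certifies-sem : ∀ w e x → sem Certifies (w ∷ e ∷ x ∷ []) ≡ certifies g w e x
  Certifies-sem w e x = cong₂ _*_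
    (ValidTrace-sem (unpair₂ᵖ (unpair₂ᵖ (Arg 0))) (unpair₁ᵖ (unpair₂ᵖ (Arg 0))) (w ∷ e ∷ x ∷ []))
    (Bsum-sem IsRoot (unpair₁ᵖ (unpair₂ᵖ (Arg 0))) (unpair₂ᵖ (unpair₂ᵖ (Arg 0)) ∷ Arg 0 ∷ Arg 1 ∷ Arg 2 ∷ [])
              (w ∷ e ∷ x ∷ []) (λ i → equal (nthᴺ i T) (node 0 e e (consᴺ x 0) (unpair₁ w))) (λ i a → refl))
    where T = unpair₂ (unpair₂ w)

module _ (k f n a y : ℕ) where
  private
    tail₁ = pair f (pair n (pair a y))
    tail₂ = pair n (pair a y)

  kindᴺ-node : kindᴺ (node k f n a y) ≡ k
  kindᴺ-node = unpair₁-pair k _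

  fuelᴺ-node : fuelᴺ (node k f n a y) ≡ f
  fuelᴺ-node rewrite unpair₂-pair k tail₁ = unpair₁-pair f _

  indexᴺ-node : indexᴺ (node k f n a y) ≡ n
  indexᴺ-node rewrite unpair₂-pair k tail₁ | unpair₂-pair f tail₂ = unpair₁-pair n _

  inputᴺ-node : inputᴺ (node k f n a y) ≡ a
  inputᴺ-node rewrite unpair₂-pair k tail₁ | unpair₂-pair f tail₂ | unpair₂-pair n (pair a y) =
    unpair₁-pair a _

  outputᴺ-node : outputᴺ (node k f n a y) ≡ y
  outputᴺ-node rewrite unpair₂-pair k tail₁ | unpair₂-pair f tail₂ | unpair₂-pair n (pair a y) =
    unpair₂-pair a y

decodeTag : ℕ → ℕ → ℕ → Code
decodeTag f 0 r = zer
decodeTag f 1 r = sc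
decodeTag f 2 r = prj r
decodeTag f 3 r = orc
decodeTag f 4 r = comp (decodeF f (proj₁ (unpair r))) (decodeL f (proj₂ (unpair r)))
decodeTag f 5 r = prec (decodeF f (proj₁ (unpair r))) (decodeF f (proj₂ (unpair r)))
decodeTag f 6 r = mu (decodeF f r)
decodeTag f (suc (suc (suc (suc (suc (suc (suc _))))))) r = zer

decodeF-suc : ∀ f n → decodeF (suc f) n ≡ decodeTag f (unpair₁ n) (unpair₂ n)
decodeF-suc f n = trans (by-unpair n) (cong₂ (decodeTag f) (unpair₁-correct n) (unpair₂-correct n))
  where
    by-unpair : ∀ n → decodeF (suc f) n ≡ decodeTag f (proj₁ (unpair n)) (proj₂ (unpair n))
    by-unpair n with unpair n
    ... | (0 , r) = refl
    ... | (1 , r) = refl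
    ... | (2 , r) = refl
    ... | (3 , r) = refl
    ... | (4 , r) = refl
    ... | (5 , r) = refl
    ... | (6 , r) = refl
    ... | (suc (suc (suc (suc (suc (suc (suc _)))))) , r) = refl

decodeL-suc : ∀ f m → decodeL (suc f) (suc m) ≡ decodeF f (unpair₁ m) ∷ decodeL f (unpair₂ m)
decodeL-suc f m = cong₂ (λ u v → decodeF f u ∷ decodeL f v) (unpair₁-correct m) (unpair₂-correct m)

module _ {f r : ℕ} where
  decodeTag≡zer : ∀ t → decodeTag f t r ≡ zer → ✓ (isZero t + isZero (7 ∸ t))
  decodeTag≡zer 0 _ = ✓+ˡ {isZero 0} (isZero (7 ∸ 0)) (≡0⇒✓isZero refl)
  decodeTag≡zer (suc (suc (suc (suc (suc (suc (suc t))))))) _ =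
    ✓+ʳ (isZero (suc (suc (suc (suc (suc (suc (suc t)))))))) (≡0⇒✓isZero (0∸n≡0 t))
  decodeTag≡zer 1 () ; decodeTag≡zer 2 () ; decodeTag≡zer 3 ()
  decodeTag≡zer 4 () ; decodeTag≡zer 5 () ; decodeTag≡zer 6 ()

  decodeTag≡sc : ∀ t → decodeTag f t r ≡ sc → t ≡ 1
  decodeTag≡sc 1 _ = refl
  decodeTag≡sc 0 () ; decodeTag≡sc 2 () ; decodeTag≡sc 3 () ; decodeTag≡sc 4 ()
  decodeTag≡sc 5 () ; decodeTag≡sc 6 () ; decodeTag≡sc (suc (suc (suc (suc (suc (suc (suc t))))))) ()

  decodeTag≡prj : ∀ t {i} → decodeTag f t r ≡ prj i → (t ≡ 2) × (r ≡ i)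
  decodeTag≡prj 2 refl = refl , refl
  decodeTag≡prj 0 () ; decodeTag≡prj 1 () ; decodeTag≡prj 3 () ; decodeTag≡prj 4 ()
  decodeTag≡prj 5 () ; decodeTag≡prj 6 () ; decodeTag≡prj (suc (suc (suc (suc (suc (suc (suc t))))))) ()

  decodeTag≡orc : ∀ t → decodeTag f t r ≡ orc → t ≡ 3
  decodeTag≡orc 3 _ = refl
  decodeTag≡orc 0 () ; decodeTag≡orc 1 () ; decodeTag≡orc 2 () ; decodeTag≡orc 4 ()
  decodeTag≡orc 5 () ; decodeTag≡orc 6 () ; decodeTag≡orc (suc (suc (suc (suc (suc (suc (suc t))))))) ()

  decodeTag≡comp : ∀ t {c hs} → decodeTag f t r ≡ comp c hs →
                   (t ≡ 4) × (decodeF f (unpair₁ r) ≡ c) × (decodeL f (unpair₂ r) ≡ hs)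
  decodeTag≡comp 4 refl =
    refl , cong (decodeF f) (sym (unpair₁-correct r)) , cong (decodeL f) (sym (unpair₂-correct r))
  decodeTag≡comp 0 () ; decodeTag≡comp 1 () ; decodeTag≡comp 2 () ; decodeTag≡comp 3 ()
  decodeTag≡comp 5 () ; decodeTag≡comp 6 () ; decodeTag≡comp (suc (suc (suc (suc (suc (suc (suc t))))))) ()

  decodeTag≡prec : ∀ t {c h} → decodeTag f t r ≡ prec c h →
                   (t ≡ 5) × (decodeF f (unpair₁ r) ≡ c) × (decodeF f (unpair₂ r) ≡ h)
  decodeTag≡prec 5 refl =
    refl , cong (decodeF f) (sym (unpair₁-correct r)) , cong (decodeF f) (sym (unpair₂-correct r))
  decodeTag≡prec 0 () ; decodeTag≡prec 1 () ; decodeTag≡prec 2 () ; decodeTag≡prec 3 ()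
  decodeTag≡prec 4 () ; decodeTag≡prec 6 () ; decodeTag≡prec (suc (suc (suc (suc (suc (suc (suc t))))))) ()

  decodeTag≡mu : ∀ t {c} → decodeTag f t r ≡ mu c → (t ≡ 6) × (decodeF f r ≡ c)
  decodeTag≡mu 6 refl = refl , refl
  decodeTag≡mu 0 () ; decodeTag≡mu 1 () ; decodeTag≡mu 2 () ; decodeTag≡mu 3 ()
  decodeTag≡mu 4 () ; decodeTag≡mu 5 () ; decodeTag≡mu (suc (suc (suc (suc (suc (suc (suc t))))))) ()

NodeMeaning : Baire → ℕ → ℕ → ℕ → ℕ → ℕ → Set
NodeMeaning g 0 f n a y = ∀ xs → encodeList xs ≡ a → Eval g (decodeF f n) xs y
NodeMeaning g 1 f n a y = ∀ xs → encodeList xs ≡ a →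
                          Σ (List ℕ) λ ys → (encodeList ys ≡ y) × EvalL g (decodeL f n) xs ys
NodeMeaning g _ f n a y = ⊤

NodeHolds : Baire → ℕ → Set
NodeHolds g X = NodeMeaning g (kindᴺ X) (fuelᴺ X) (indexᴺ X) (inputᴺ X) (outputᴺ X)

NodeHolds-fields : ∀ {g X k f n a y} → kindᴺ X ≡ k → fuelᴺ X ≡ f → indexᴺ X ≡ n → inputᴺ X ≡ a →
                   outputᴺ X ≡ y → NodeHolds g X → NodeMeaning g k f n a y
NodeHolds-fields refl refl refl refl refl h = h

NodeHolds-node : ∀ {g X k f n a y} → X ≡ node k f n a y → NodeHolds g X → NodeMeaning g k f n a y
NodeHolds-node {k = k} {f} {n} {a} {y} refl =
  NodeHolds-fields (kindᴺ-node k f n a y) (fuelᴺ-node k f n a y) (indexᴺ-node k f n a y)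
                   (inputᴺ-node k f n a y) (outputᴺ-node k f n a y)

encodeList≡nonZero : ∀ {xs a} → encodeList xs ≡ a → ✓ (nonZero a) →
  Σ ℕ λ x → Σ (List ℕ) λ xs' → (xs ≡ x ∷ xs') × (headᴺ a ≡ x) × (tailᴺ a ≡ encodeList xs')
encodeList≡nonZero {[]}     refl h = ⊥-elim (✓⇒¬✓isZero (≡0⇒✓isZero {0} refl) h)
encodeList≡nonZero {x ∷ xs} refl h = x , xs , refl , headᴺ-encode x xs , tailᴺ-encode x xs

¬✓isZero-suc : ∀ {n} → ¬ ✓ (isZero (suc n))
¬✓isZero-suc h with ✓isZero⇒≡0 h
... | ()

module Soundness (g : Baire) (T L : ℕ) where

  entry : ℕ → ℕ
  entry j = nthᴺ j T

  -- Premises have smaller fuel, or (prec step) equal fuel and smaller first argument.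
  module Node (X : ℕ)
    (ih-fuel : ∀ j → j < L → fuelᴺ (entry j) < fuelᴺ X → NodeHolds g (entry j))
    (ih-head : ∀ j → j < L → fuelᴺ (entry j) ≡ fuelᴺ X →
               headᴺ (inputᴺ (entry j)) < headᴺ (inputᴺ X) → NodeHolds g (entry j)) where

    k f n a y : ℕ
    k = kindᴺ X ; f = fuelᴺ X ; n = indexᴺ X ; a = inputᴺ X ; y = outputᴺ X
    open Justification g T L k f n a y hiding (entry)

    module CodeNode (f≡ : f ≡ suc f') (xs : List ℕ) (xs≡ : encodeList xs ≡ a) where

      below-fuel : ∀ {z} → z ≡ f' → z < f
      below-fuel {z} z≡ = subst (z <_) (sym f≡) (s≤s (≤-reflexive z≡))

      premise : ∀ {j} k' m b z → j < L → entry j ≡ node k' f' m b z → NodeMeaning g k' f' m b z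
      premise {j} k' m b z j<L e =
        NodeHolds-node e (ih-fuel j j<L (below-fuel (trans (cong fuelᴺ e) (fuelᴺ-node k' f' m b z))))

      Goal : ℕ → Set
      Goal t = Eval g (decodeTag f' t r) xs y

      at-tag : ∀ {c} → ✓ (equal tag c) → Goal c → Goal tag
      at-tag t≡ = subst Goal (sym (✓equal⇒≡ t≡))

      case-zer : ✓ ((isZero tag + isZero (7 ∸ tag)) * isZero y) → Goal tag
      case-zer h with ✓*⇒✓×✓ h
      ... | (ht , hy) = subst (Eval g (decodeTag f' tag r) xs) (sym (✓isZero⇒≡0 hy)) (zer-tag tag (✓+⇒✓⊎✓ ht))
        where zer-tag : ∀ t → ✓ (isZero t) ⊎ ✓ (isZero (7 ∸ t)) → Eval g (decodeTag f' t r) xs 0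
              zer-tag 0 _ = e-zer
              zer-tag (suc (suc (suc (suc (suc (suc (suc _))))))) _ = e-zer
              zer-tag (suc t) (inj₁ h) = ⊥-elim (¬✓isZero-suc h)
              zer-tag 1 (inj₂ h) = ⊥-elim (¬✓isZero-suc h)
              zer-tag 2 (inj₂ h) = ⊥-elim (¬✓isZero-suc h)
              zer-tag 3 (inj₂ h) = ⊥-elim (¬✓isZero-suc h)
              zer-tag 4 (inj₂ h) = ⊥-elim (¬✓isZero-suc h)
              zer-tag 5 (inj₂ h) = ⊥-elim (¬✓isZero-suc h)
              zer-tag 6 (inj₂ h) = ⊥-elim (¬✓isZero-suc h)

      case-sc : ✓ (equal tag 1 * (nonZero a * equal y (suc (headᴺ a)))) → Goal tag
      case-sc h with ✓*⇒✓×✓ {equal tag 1} h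
      ... | (ht , ha) with ✓*⇒✓×✓ {nonZero a} ha
      ... | (a≢0 , hy) with encodeList≡nonZero xs≡ a≢0
      ... | (x , xs' , refl , hd≡ , _) =
        at-tag ht (subst (Eval g sc (x ∷ xs')) (sym (trans (✓equal⇒≡ hy) (cong suc hd≡))) e-sc)

      case-prj : ✓ (equal tag 2 * equal y (nthᴺ r a)) → Goal tag
      case-prj h with ✓*⇒✓×✓ {equal tag 2} h
      ... | (ht , hy) = at-tag ht (subst (Eval g (prj r) xs) (sym y≡) e-prj)
        where y≡ : y ≡ nth r xs
              y≡ = trans (✓equal⇒≡ hy) (trans (cong (nthᴺ r) (sym xs≡)) (nthᴺ-encode r xs))

      case-orc : ✓ (equal tag 3 * (nonZero a * equal y (g (headᴺ a)))) → Goal tag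
      case-orc h with ✓*⇒✓×✓ {equal tag 3} h
      ... | (ht , ha) with ✓*⇒✓×✓ {nonZero a} ha
      ... | (a≢0 , hy) with encodeList≡nonZero xs≡ a≢0
      ... | (x , xs' , refl , hd≡ , _) =
        at-tag ht (subst (Eval g orc (x ∷ xs')) (sym (trans (✓equal⇒≡ hy) (cong g hd≡))) e-orc)

      case-comp : ✓ (equal tag 4 * hasComp) → Goal tag
      case-comp h = at-tag ht (e-comp (subst (λ c → EvalL g (decodeL f' c) xs ys) (sym (unpair₂-correct r)) evL)
                                      (subst (λ c → Eval g (decodeF f' c) ys y) (sym (unpair₁-correct r)) evF))
        where
          ht = proj₁ (✓*⇒✓×✓ {equal tag 4} h)
          found = ✓bsum²⇒∃ compPremises L (proj₂ (✓*⇒✓×✓ {equal tag 4} h))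
          j = proj₁ found ; j' = proj₁ (proj₂ found)
          j<L = proj₁ (proj₂ (proj₂ found)) ; j'<L = proj₁ (proj₂ (proj₂ (proj₂ found)))
          hs = ✓*₅ (proj₂ (proj₂ (proj₂ (proj₂ found))))
          kind≡ = proj₁ hs ; fuel≡ = proj₁ (proj₂ hs) ; index≡ = proj₁ (proj₂ (proj₂ hs))
          input≡ = proj₁ (proj₂ (proj₂ (proj₂ hs))) ; entry-j'≡ = proj₂ (proj₂ (proj₂ (proj₂ hs)))
          list-node : NodeMeaning g 1 f' (unpair₂ r) a (outputᴺ (entry j))
          list-node = NodeHolds-fields (✓equal⇒≡ kind≡) (✓equal⇒≡ fuel≡) (✓equal⇒≡ index≡) (✓equal⇒≡ input≡) refl
                        (ih-fuel j j<L (below-fuel (✓equal⇒≡ fuel≡)))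
          ys = proj₁ (list-node xs xs≡)
          evL = proj₂ (proj₂ (list-node xs xs≡))
          evF = premise 0 (unpair₁ r) (outputᴺ (entry j)) y j'<L (✓equal⇒≡ entry-j'≡)
                        ys (proj₁ (proj₂ (list-node xs xs≡)))

      R₀ R₁ : Code
      R₀ = decodeF f' (proj₁ (unpair r))
      R₁ = decodeF f' (proj₂ (unpair r))

      module Prec (tag≡5 : tag ≡ 5) (a≢0 : ✓ (nonZero a)) where
        x : ℕ
        x = proj₁ (encodeList≡nonZero xs≡ a≢0)
        xs' : List ℕ
        xs' = proj₁ (proj₂ (encodeList≡nonZero xs≡ a≢0))
        xs≡x∷xs' : xs ≡ x ∷ xs'
        xs≡x∷xs' = proj₁ (proj₂ (proj₂ (encodeList≡nonZero xs≡ a≢0)))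
        head≡ : headᴺ a ≡ x
        head≡ = proj₁ (proj₂ (proj₂ (proj₂ (encodeList≡nonZero xs≡ a≢0))))
        tail≡ : tailᴺ a ≡ encodeList xs'
        tail≡ = proj₂ (proj₂ (proj₂ (proj₂ (encodeList≡nonZero xs≡ a≢0))))

        base : ✓ (isZero (headᴺ a) * hasPrecBase) → Eval g (prec R₀ R₁) (x ∷ xs') y
        base h = subst (λ u → Eval g (prec R₀ R₁) (u ∷ xs') y) (sym x≡0) (e-prec0 ev)
          where
            x≡0 : x ≡ 0
            x≡0 = trans (sym head≡) (✓isZero⇒≡0 (proj₁ (✓*⇒✓×✓ {isZero (headᴺ a)} h)))
            found = ✓bsum⇒∃ precBasePremise L (proj₂ (✓*⇒✓×✓ {isZero (headᴺ a)} h))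
            ev : Eval g R₀ xs' y
            ev = subst (λ c → Eval g (decodeF f' c) xs' y) (sym (unpair₁-correct r))
                   (premise 0 (unpair₁ r) (tailᴺ a) y (proj₁ (proj₂ found)) (✓equal⇒≡ (proj₂ (proj₂ found)))
                            xs' (sym tail≡))

        step : ✓ (nonZero (headᴺ a) * hasPrecStep) → Eval g (prec R₀ R₁) (x ∷ xs') y
        step h = subst (λ u → Eval g (prec R₀ R₁) (u ∷ xs') y) (trans m+1≡ head≡) (e-precS ev-rec ev-step)
          where
            m = pred (headᴺ a)
            m+1≡ : suc m ≡ headᴺ a
            m+1≡ = sym (✓nonZero⇒≡suc (proj₁ (✓*⇒✓×✓ {nonZero (headᴺ a)} h)))
            found = ✓bsum²⇒∃ precStepPremises L (proj₂ (✓*⇒✓×✓ {nonZero (headᴺ a)} h))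
            j = proj₁ found ; j' = proj₁ (proj₂ found)
            j<L = proj₁ (proj₂ (proj₂ found)) ; j'<L = proj₁ (proj₂ (proj₂ (proj₂ found)))
            hs = ✓*₅ (proj₂ (proj₂ (proj₂ (proj₂ found))))
            input≡ : inputᴺ (entry j) ≡ consᴺ m (tailᴺ a)
            input≡ = ✓equal⇒≡ (proj₁ (proj₂ (proj₂ (proj₂ hs))))
            head< : headᴺ (inputᴺ (entry j)) < headᴺ a
            head< = subst (_< headᴺ a) (sym (trans (cong headᴺ input≡) (unpair₁-pair m (tailᴺ a))))
                          (≤-reflexive m+1≡)
            rec-node : NodeMeaning g 0 f n (consᴺ m (tailᴺ a)) (outputᴺ (entry j))
            rec-node = NodeHolds-fields (✓isZero⇒≡0 (proj₁ hs)) (✓equal⇒≡ (proj₁ (proj₂ hs)))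
                         (✓equal⇒≡ (proj₁ (proj₂ (proj₂ hs)))) input≡ refl
                         (ih-head j j<L (✓equal⇒≡ (proj₁ (proj₂ hs))) head<)
            yⱼ = outputᴺ (entry j)
            ev-rec : Eval g (prec R₀ R₁) (m ∷ xs') yⱼ
            ev-rec = subst (λ c → Eval g c (m ∷ xs') yⱼ)
                       (trans (cong (λ q → decodeF q n) f≡) (trans (decodeF-suc f' n)
                              (cong (λ q → decodeTag f' q r) tag≡5)))
                       (rec-node (m ∷ xs') (cong (consᴺ m) (sym tail≡)))
            ev-step : Eval g R₁ (m ∷ yⱼ ∷ xs') y
            ev-step = subst (λ c → Eval g (decodeF f' c) (m ∷ yⱼ ∷ xs') y) (sym (unpair₂-correct r))
                        (premise 0 (unpair₂ r) (consᴺ m (consᴺ yⱼ (tailᴺ a))) y j'<L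
                                 (✓equal⇒≡ (proj₂ (proj₂ (proj₂ (proj₂ hs)))))
                                 (m ∷ yⱼ ∷ xs') (cong (λ z → consᴺ m (consᴺ yⱼ z)) (sym tail≡)))

      case-prec : ✓ (equal tag 5 * (nonZero a * (isZero (headᴺ a) * hasPrecBase
                                                + nonZero (headᴺ a) * hasPrecStep))) → Goal tag
      case-prec h with ✓*⇒✓×✓ {equal tag 5} h
      ... | (ht , ha) with ✓*⇒✓×✓ {nonZero a} ha
      ... | (a≢0 , hc) = at-tag ht (subst (λ u → Eval g (prec R₀ R₁) u y) (sym xs≡x∷xs') (by-head (✓+⇒✓⊎✓ hc)))
        where
          open Prec (✓equal⇒≡ ht) a≢0
          by-head : ✓ (isZero (headᴺ a) * hasPrecBase) ⊎ ✓ (nonZero (headᴺ a) * hasPrecStep) →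
                    Eval g (prec R₀ R₁) (x ∷ xs') y
          by-head (inj₁ h) = base h
          by-head (inj₂ h) = step h

      case-mu : ✓ (equal tag 6 * (hasMuZero * allMuPositive)) → Goal tag
      case-mu h with ✓*⇒✓×✓ {equal tag 6} h
      ... | (ht , hm) with ✓*⇒✓×✓ {hasMuZero} hm
      ... | (h-zero , h-pos) = at-tag ht (e-mu ev-zero below)
        where
          found = ✓bsum⇒∃ muZeroPremise L h-zero
          ev-zero : Eval g (decodeF f' r) (y ∷ xs) 0
          ev-zero = premise 0 r (consᴺ y a) 0 (proj₁ (proj₂ found)) (✓equal⇒≡ (proj₂ (proj₂ found)))
                            (y ∷ xs) (cong (consᴺ y) xs≡)
          below : ∀ w → w < y → Σ ℕ λ v → Eval g (decodeF f' r) (w ∷ xs) (suc v)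
          below w w<y = pred (outputᴺ (entry j)) , subst (Eval g (decodeF f' r) (w ∷ xs)) (✓nonZero⇒≡suc pos) ev
            where
              found-w = ✓bsum⇒∃ (muPositivePremise w) L (✓bprod⇒∀ _ y h-pos w w<y)
              j = proj₁ found-w
              hs = ✓*₅ (proj₂ (proj₂ found-w))
              pos = proj₂ (proj₂ (proj₂ (proj₂ hs)))
              node-w : NodeMeaning g 0 f' r (consᴺ w a) (outputᴺ (entry j))
              node-w = NodeHolds-fields (✓isZero⇒≡0 (proj₁ hs)) (✓equal⇒≡ (proj₁ (proj₂ hs)))
                         (✓equal⇒≡ (proj₁ (proj₂ (proj₂ hs)))) (✓equal⇒≡ (proj₁ (proj₂ (proj₂ (proj₂ hs))))) refl
                         (ih-fuel j (proj₁ (proj₂ found-w)) (below-fuel (✓equal⇒≡ (proj₁ (proj₂ hs)))))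
              ev : Eval g (decodeF f' r) (w ∷ xs) (outputᴺ (entry j))
              ev = node-w (w ∷ xs) (cong (consᴺ w) xs≡)

      case-byTag : ✓ byTag → Eval g (decodeF f n) xs y
      case-byTag h = subst (λ c → Eval g c xs y) (sym (trans (cong (λ q → decodeF q n) f≡) (decodeF-suc f' n)))
                           (by-case h)
        where
          by-case : ✓ byTag → Goal tag
          by-case h with ✓+⇒✓⊎✓ h
          ... | inj₂ h₆ = case-mu h₆
          ... | inj₁ h with ✓+⇒✓⊎✓ h
          ... | inj₂ h₅ = case-prec h₅
          ... | inj₁ h with ✓+⇒✓⊎✓ h
          ... | inj₂ h₄ = case-comp h₄
          ... | inj₁ h with ✓+⇒✓⊎✓ h
          ... | inj₂ h₃ = case-orc h₃
          ... | inj₁ h with ✓+⇒✓⊎✓ h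
          ... | inj₂ h₂ = case-prj h₂
          ... | inj₁ h with ✓+⇒✓⊎✓ h
          ... | inj₂ h₁ = case-sc h₁
          ... | inj₁ h₀ = case-zer h₀

    code-sound : ✓ codeJustified → NodeMeaning g 0 f n a y
    code-sound h xs xs≡ with ✓+⇒✓⊎✓ h
    ... | inj₁ h₀ = let (f≡0 , y≡0) = ✓*⇒✓×✓ {isZero f} h₀ in
      subst₂ (λ q z → Eval g (decodeF q n) xs z) (sym (✓isZero⇒≡0 f≡0)) (sym (✓isZero⇒≡0 y≡0)) e-zer
    ... | inj₂ h₁ = let (f≢0 , hb) = ✓*⇒✓×✓ {nonZero f} h₁ in
      CodeNode.case-byTag (✓nonZero⇒≡suc f≢0) xs xs≡ hb

    list-sound : ✓ listJustified → NodeMeaning g 1 f n a y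
    list-sound h xs xs≡ with ✓+⇒✓⊎✓ h
    ... | inj₁ h₀ = let (f≡0 , y≡0) = ✓*⇒✓×✓ {isZero f} h₀ in
      [] , sym (✓isZero⇒≡0 y≡0) , subst (λ q → EvalL g (decodeL q n) xs []) (sym (✓isZero⇒≡0 f≡0)) []
    ... | inj₂ h₁ with ✓*⇒✓×✓ {nonZero f} h₁
    ...   | (f≢0 , hc) with ✓+⇒✓⊎✓ hc
    ...     | inj₁ h-nil = let (n≡0 , y≡0) = ✓*⇒✓×✓ {isZero n} h-nil in
      [] , sym (✓isZero⇒≡0 y≡0) ,
      subst₂ (λ u v → EvalL g (decodeL u v) xs []) (sym (✓nonZero⇒≡suc f≢0)) (sym (✓isZero⇒≡0 n≡0)) []
    ...     | inj₂ h-cons = headᴺ y ∷ ys , ys-encoding , evL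
      where
        f≡ = ✓nonZero⇒≡suc f≢0
        n≢0 = proj₁ (✓*⇒✓×✓ {nonZero n} h-cons)
        y≢0 = proj₁ (✓*⇒✓×✓ {nonZero y} (proj₂ (✓*⇒✓×✓ {nonZero n} h-cons)))
        found = ✓bsum²⇒∃ consPremises L (proj₂ (✓*⇒✓×✓ {nonZero y} (proj₂ (✓*⇒✓×✓ {nonZero n} h-cons))))
        hs = ✓*⇒✓×✓ (proj₂ (proj₂ (proj₂ (proj₂ found))))
        open CodeNode f≡ xs xs≡ using (premise)
        m = pred n
        head-node = premise 0 (unpair₁ m) a (headᴺ y) (proj₁ (proj₂ (proj₂ found))) (✓equal⇒≡ (proj₁ hs))
        tail-node = premise 1 (unpair₂ m) a (tailᴺ y) (proj₁ (proj₂ (proj₂ (proj₂ found)))) (✓equal⇒≡ (proj₂ hs))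
                            xs xs≡
        ys = proj₁ tail-node
        ys-encoding : encodeList (headᴺ y ∷ ys) ≡ y
        ys-encoding = trans (cong (λ z → suc (pair (headᴺ y) z)) (proj₁ (proj₂ tail-node)))
                            (trans (cong suc (pair-unpair₁₂ (pred y))) (sym (✓nonZero⇒≡suc y≢0)))
        evL : EvalL g (decodeL f n) xs (headᴺ y ∷ ys)
        evL = subst (λ c → EvalL g c xs (headᴺ y ∷ ys))
                    (sym (trans (cong₂ decodeL f≡ (✓nonZero⇒≡suc n≢0)) (decodeL-suc f' m)))
                    (head-node xs xs≡ ∷ proj₂ (proj₂ tail-node))

    node-sound : ✓ justified → NodeHolds g X
    node-sound h with ✓+⇒✓⊎✓ h
    ... | inj₁ h₀ = let (k≡0 , hc) = ✓*⇒✓×✓ {isZero k} h₀ in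
      subst (λ q → NodeMeaning g q f n a y) (sym (✓isZero⇒≡0 k≡0)) (code-sound hc)
    ... | inj₂ h₁ = let (k≡1 , hl) = ✓*⇒✓×✓ {equal k 1} h₁ in
      subst (λ q → NodeMeaning g q f n a y) (sym (✓equal⇒≡ k≡1)) (list-sound hl)

  valid⇒nodes-hold : ✓ (validTrace g T L) → ∀ i → i < L → NodeHolds g (entry i)
  valid⇒nodes-hold valid i i<L =
    <-rec OnFuel (λ F ih-F → <-rec (OnHead F) (λ M ih-M → step F ih-F M ih-M))
          (fuelᴺ (entry i)) (headᴺ (inputᴺ (entry i))) i i<L refl refl
    where
      OnHead : ℕ → ℕ → Set
      OnHead F M = ∀ i → i < L → fuelᴺ (entry i) ≡ F → headᴺ (inputᴺ (entry i)) ≡ M → NodeHolds g (entry i)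
      OnFuel : ℕ → Set
      OnFuel F = ∀ M → OnHead F M
      step : ∀ F → (∀ {F'} → F' < F → OnFuel F') → ∀ M → (∀ {M'} → M' < M → OnHead F M') → OnHead F M
      step F ih-F M ih-M i i<L refl refl = Node.node-sound (entry i)
        (λ j j<L lt → ih-F lt _ j j<L refl refl)
        (λ j j<L fuel≡ lt → ih-M lt j j<L fuel≡ refl)
        (✓bprod⇒∀ _ L valid i i<L)

certified⇒Eval : ∀ g w e x → ✓ (certifies g w e x) → Eval g (decode e) (x ∷ []) (unpair₁ w)
certified⇒Eval g w e x h =
  NodeHolds-node {k = 0} {e} {e} {consᴺ x 0} {unpair₁ w} (✓equal⇒≡ (proj₂ (proj₂ root)))
                 (Soundness.valid⇒nodes-hold g T L valid i (proj₁ (proj₂ root))) (x ∷ []) refl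
  where
    T = unpair₂ (unpair₂ w) ; L = unpair₁ (unpair₂ w)
    valid = proj₁ (✓*⇒✓×✓ {validTrace g T L} h)
    root = ✓bsum⇒∃ _ L (proj₂ (✓*⇒✓×✓ {validTrace g T L} h))
    i = proj₁ root

module Introduction (g : Baire) (T L k f n a y : ℕ) where
  open Justification g T L k f n a y

  private
    s₀ s₁ s₂ s₃ s₄ s₅ s₆ : ℕ
    s₀ = (isZero tag + isZero (7 ∸ tag)) * isZero y
    s₁ = equal tag 1 * (nonZero a * equal y (suc (headᴺ a)))
    s₂ = equal tag 2 * equal y (nthᴺ r a)
    s₃ = equal tag 3 * (nonZero a * equal y (g (headᴺ a)))
    s₄ = equal tag 4 * hasComp
    s₅ = equal tag 5 * (nonZero a * (isZero (headᴺ a) * hasPrecBase + nonZero (headᴺ a) * hasPrecStep))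
    s₆ = equal tag 6 * (hasMuZero * allMuPositive)

  byTag-zer : ✓ s₀ → ✓ byTag
  byTag-zer h = ✓+ˡ s₆ (✓+ˡ s₅ (✓+ˡ s₄ (✓+ˡ s₃ (✓+ˡ s₂ (✓+ˡ s₁ h)))))
  byTag-sc : ✓ s₁ → ✓ byTag
  byTag-sc h = ✓+ˡ s₆ (✓+ˡ s₅ (✓+ˡ s₄ (✓+ˡ s₃ (✓+ˡ s₂ (✓+ʳ s₀ h)))))
  byTag-prj : ✓ s₂ → ✓ byTag
  byTag-prj h = ✓+ˡ s₆ (✓+ˡ s₅ (✓+ˡ s₄ (✓+ˡ s₃ (✓+ʳ (s₀ + s₁) h))))
  byTag-orc : ✓ s₃ → ✓ byTag
  byTag-orc h = ✓+ˡ s₆ (✓+ˡ s₅ (✓+ˡ s₄ (✓+ʳ (s₀ + s₁ + s₂) h)))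
  byTag-comp : ✓ s₄ → ✓ byTag
  byTag-comp h = ✓+ˡ s₆ (✓+ˡ s₅ (✓+ʳ (s₀ + s₁ + s₂ + s₃) h))
  byTag-prec : ✓ s₅ → ✓ byTag
  byTag-prec h = ✓+ˡ s₆ (✓+ʳ (s₀ + s₁ + s₂ + s₃ + s₄) h)
  byTag-mu : ✓ s₆ → ✓ byTag
  byTag-mu h = ✓+ʳ (s₀ + s₁ + s₂ + s₃ + s₄ + s₅) h

  code-fuel0 : f ≡ 0 → y ≡ 0 → ✓ codeJustified
  code-fuel0 f≡0 y≡0 = ✓+ˡ (nonZero f * byTag) (≡0⇒✓isZero f≡0 ✓* ≡0⇒✓isZero y≡0)

  code-byTag : ∀ {f''} → f ≡ suc f'' → ✓ byTag → ✓ codeJustified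
  code-byTag f≡ h = ✓+ʳ (isZero f * isZero y) (≡suc⇒✓nonZero f≡ ✓* h)

  list-fuel0 : f ≡ 0 → y ≡ 0 → ✓ listJustified
  list-fuel0 f≡0 y≡0 =
    ✓+ˡ (nonZero f * (isZero n * isZero y + nonZero n * (nonZero y * hasCons))) (≡0⇒✓isZero f≡0 ✓* ≡0⇒✓isZero y≡0)

  list-nil : ∀ {f''} → f ≡ suc f'' → n ≡ 0 → y ≡ 0 → ✓ listJustified
  list-nil f≡ n≡0 y≡0 = ✓+ʳ (isZero f * isZero y)
    (≡suc⇒✓nonZero f≡ ✓* ✓+ˡ (nonZero n * (nonZero y * hasCons)) (≡0⇒✓isZero n≡0 ✓* ≡0⇒✓isZero y≡0))

  list-cons : ∀ {f'' m y'} → f ≡ suc f'' → n ≡ suc m → y ≡ suc y' → ✓ hasCons → ✓ listJustified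
  list-cons f≡ n≡ y≡ h = ✓+ʳ (isZero f * isZero y)
    (≡suc⇒✓nonZero f≡ ✓* ✓+ʳ (isZero n * isZero y) (≡suc⇒✓nonZero n≡ ✓* (≡suc⇒✓nonZero y≡ ✓* h)))

  code-node : k ≡ 0 → ✓ codeJustified → ✓ justified
  code-node k≡0 h = ✓+ˡ (equal k 1 * listJustified) (≡0⇒✓isZero k≡0 ✓* h)

  list-node : k ≡ 1 → ✓ listJustified → ✓ justified
  list-node k≡1 h = ✓+ʳ (isZero k * codeJustified) (≡⇒✓equal k≡1 ✓* h)

justifiedNode-node : ∀ {g T L k f n a y} → ✓ (Justification.justified g T L k f n a y) →
                     ✓ (justifiedNode g T L (node k f n a y))
justifiedNode-node {g} {T} {L} {k} {f} {n} {a} {y} =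
  subst ✓ (sym (cong₅ (Justification.justified g T L) (kindᴺ-node k f n a y) (fuelᴺ-node k f n a y)
                      (indexᴺ-node k f n a y) (inputᴺ-node k f n a y) (outputᴺ-node k f n a y)))
  where cong₅ : ∀ (F : ℕ → ℕ → ℕ → ℕ → ℕ → ℕ) {a₁ b₁ a₂ b₂ a₃ b₃ a₄ b₄ a₅ b₅} →
                a₁ ≡ b₁ → a₂ ≡ b₂ → a₃ ≡ b₃ → a₄ ≡ b₄ → a₅ ≡ b₅ → F a₁ a₂ a₃ a₄ a₅ ≡ F b₁ b₂ b₃ b₄ b₅
        cong₅ F refl refl refl refl refl = refl

module NodeFields (k f n a y : ℕ) {X : ℕ} (X≡ : X ≡ node k f n a y) where
  kind≡ : kindᴺ X ≡ k
  kind≡ = trans (cong kindᴺ X≡) (kindᴺ-node k f n a y)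
  fuel≡ : fuelᴺ X ≡ f
  fuel≡ = trans (cong fuelᴺ X≡) (fuelᴺ-node k f n a y)
  index≡ : indexᴺ X ≡ n
  index≡ = trans (cong indexᴺ X≡) (indexᴺ-node k f n a y)
  input≡ : inputᴺ X ≡ a
  input≡ = trans (cong inputᴺ X≡) (inputᴺ-node k f n a y)
  output≡ : outputᴺ X ≡ y
  output≡ = trans (cong outputᴺ X≡) (outputᴺ-node k f n a y)

∈⇒✓bsum : ∀ ns {Y} → Y ∈ ns → (F : ℕ → ℕ) → (∀ j → nthᴺ j (encodeList ns) ≡ Y → ✓ (F j)) →
          ✓ (bsum F (length ns))
∈⇒✓bsum ns Y∈ns F h = let (j , j<len , e) = ∈⇒nthᴺ-encode Y∈ns in ∃⇒✓bsum F (length ns) j j<len (h j e)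

-- Each rule of Eval/EvalL justifies its conclusion in any trace containing its premises.
module Rules (g : Baire) (ns : List ℕ) where
  private
    T L : ℕ
    T = encodeList ns
    L = length ns
    module I = Introduction g T L
    module J = Justification g T L

  JustifiedIn : ℕ → Set
  JustifiedIn X = ✓ (justifiedNode g T L X)

  private
    conclude : ∀ {k f n a y} → ✓ (J.justified k f n a y) → JustifiedIn (node k f n a y)
    conclude = justifiedNode-node {g} {T} {L}

    byTag-justifies : ∀ f n a y → ✓ (J.byTag 0 (suc f) n a y) → JustifiedIn (node 0 (suc f) n a y)
    byTag-justifies f n a y h = conclude (I.code-node 0 (suc f) n a y refl (I.code-byTag 0 (suc f) n a y refl h))

    tag≡ : ∀ {f n c} → decodeF (suc f) n ≡ c → decodeTag f (unpair₁ n) (unpair₂ n) ≡ c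
    tag≡ {f} {n} eq = trans (sym (decodeF-suc f n)) eq

  justify-zer : ∀ f n xs → decodeF f n ≡ zer → JustifiedIn (node 0 f n (encodeList xs) 0)
  justify-zer zero n xs _ = conclude (I.code-node 0 0 n a 0 refl (I.code-fuel0 0 0 n a 0 refl refl))
    where a = encodeList xs
  justify-zer (suc f) n xs eq =
    byTag-justifies f n a 0 (byTag-zer (decodeTag≡zer (unpair₁ n) (tag≡ eq) ✓* ≡0⇒✓isZero refl))
    where a = encodeList xs
          open Introduction g T L 0 (suc f) n a 0

  justify-sc : ∀ f n x xs → decodeF (suc f) n ≡ sc → JustifiedIn (node 0 (suc f) n (encodeList (x ∷ xs)) (suc x))
  justify-sc f n x xs eq = byTag-justifies f n a (suc x) (byTag-sc
    (≡⇒✓equal (decodeTag≡sc (unpair₁ n) (tag≡ eq))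
     ✓* (≡suc⇒✓nonZero refl ✓* ≡⇒✓equal (cong suc (sym (headᴺ-encode x xs))))))
    where a = encodeList (x ∷ xs)
          open Introduction g T L 0 (suc f) n a (suc x)

  justify-prj : ∀ f n i xs → decodeF (suc f) n ≡ prj i → JustifiedIn (node 0 (suc f) n (encodeList xs) (nth i xs))
  justify-prj f n i xs eq = byTag-justifies f n a (nth i xs) (byTag-prj
    (≡⇒✓equal (proj₁ t≡) ✓* ≡⇒✓equal (trans (sym (nthᴺ-encode i xs)) (cong (λ q → nthᴺ q a) (sym (proj₂ t≡))))))
    where a = encodeList xs
          t≡ = decodeTag≡prj (unpair₁ n) (tag≡ eq)
          open Introduction g T L 0 (suc f) n a (nth i xs)

  justify-orc : ∀ f n x xs → decodeF (suc f) n ≡ orc → JustifiedIn (node 0 (suc f) n (encodeList (x ∷ xs)) (g x))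
  justify-orc f n x xs eq = byTag-justifies f n a (g x) (byTag-orc
    (≡⇒✓equal (decodeTag≡orc (unpair₁ n) (tag≡ eq))
     ✓* (≡suc⇒✓nonZero refl ✓* ≡⇒✓equal (cong g (sym (headᴺ-encode x xs))))))
    where a = encodeList (x ∷ xs)
          open Introduction g T L 0 (suc f) n a (g x)

  justify-comp : ∀ f n xs ys y → unpair₁ n ≡ 4 →
                 node 1 f (unpair₂ (unpair₂ n)) (encodeList xs) (encodeList ys) ∈ ns →
                 node 0 f (unpair₁ (unpair₂ n)) (encodeList ys) y ∈ ns →
                 JustifiedIn (node 0 (suc f) n (encodeList xs) y)
  justify-comp f n xs ys y t≡ m₁ m₂ = byTag-justifies f n a y (byTag-comp (≡⇒✓equal t≡ ✓* premises))
    where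
      a = encodeList xs
      open Introduction g T L 0 (suc f) n a y
      premises : ✓ (J.hasComp 0 (suc f) n a y)
      premises = ∈⇒✓bsum ns m₁ _ (λ j e → ∈⇒✓bsum ns m₂ (J.compPremises 0 (suc f) n a y j) (λ j' e' →
        let open NodeFields 1 f (unpair₂ (unpair₂ n)) a (encodeList ys) e in
        ≡⇒✓equal kind≡ ✓* ≡⇒✓equal fuel≡ ✓* ≡⇒✓equal index≡ ✓* ≡⇒✓equal input≡
        ✓* ≡⇒✓equal (trans e' (cong (λ q → node 0 f (unpair₁ (unpair₂ n)) q y) (sym output≡)))))

  justify-prec0 : ∀ f n xs y → unpair₁ n ≡ 5 →
                  node 0 f (unpair₁ (unpair₂ n)) (encodeList xs) y ∈ ns →
                  JustifiedIn (node 0 (suc f) n (encodeList (0 ∷ xs)) y)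
  justify-prec0 f n xs y t≡ m₁ = byTag-justifies f n a y (byTag-prec
    (≡⇒✓equal t≡ ✓* (≡suc⇒✓nonZero refl ✓* ✓+ˡ (nonZero (headᴺ a) * J.hasPrecStep 0 (suc f) n a y)
                                               (≡0⇒✓isZero (headᴺ-encode 0 xs) ✓* premise))))
    where
      a = encodeList (0 ∷ xs)
      open Introduction g T L 0 (suc f) n a y
      premise : ✓ (J.hasPrecBase 0 (suc f) n a y)
      premise = ∈⇒✓bsum ns m₁ (J.precBasePremise 0 (suc f) n a y)
        (λ j e → ≡⇒✓equal (trans e (cong (λ q → node 0 f (unpair₁ (unpair₂ n)) q y) (sym (tailᴺ-encode 0 xs)))))

  justify-precS : ∀ f n m xs y₁ y → unpair₁ n ≡ 5 →
                  node 0 (suc f) n (encodeList (m ∷ xs)) y₁ ∈ ns →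
                  node 0 f (unpair₂ (unpair₂ n)) (encodeList (m ∷ y₁ ∷ xs)) y ∈ ns →
                  JustifiedIn (node 0 (suc f) n (encodeList (suc m ∷ xs)) y)
  justify-precS f n m xs y₁ y t≡ m₁ m₂ = byTag-justifies f n a y (byTag-prec
    (≡⇒✓equal t≡ ✓* (≡suc⇒✓nonZero refl ✓* ✓+ʳ (isZero (headᴺ a) * J.hasPrecBase 0 (suc f) n a y)
                                               (≡suc⇒✓nonZero head≡ ✓* premises))))
    where
      a = encodeList (suc m ∷ xs)
      open Introduction g T L 0 (suc f) n a y
      head≡ : headᴺ a ≡ suc m
      head≡ = headᴺ-encode (suc m) xs
      tail≡ : tailᴺ a ≡ encodeList xs
      tail≡ = tailᴺ-encode (suc m) xs
      premises : ✓ (J.hasPrecStep 0 (suc f) n a y)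
      premises = ∈⇒✓bsum ns m₁ _ (λ j e → ∈⇒✓bsum ns m₂ (J.precStepPremises 0 (suc f) n a y j) (λ j' e' →
        let open NodeFields 0 (suc f) n (encodeList (m ∷ xs)) y₁ e in
        ≡0⇒✓isZero kind≡ ✓* ≡⇒✓equal fuel≡ ✓* ≡⇒✓equal index≡
        ✓* ≡⇒✓equal (trans input≡ (cong₂ consᴺ (cong pred (sym head≡)) (sym tail≡)))
        ✓* ≡⇒✓equal (trans e' (cong (λ q → node 0 f (unpair₂ (unpair₂ n)) q y)
                                    (cong₂ consᴺ (cong pred (sym head≡)) (cong₂ consᴺ (sym output≡) (sym tail≡)))))))

  justify-mu : ∀ f n xs z → unpair₁ n ≡ 6 →
               node 0 f (unpair₂ n) (encodeList (z ∷ xs)) 0 ∈ ns →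
               (∀ w → w < z → Σ ℕ λ v → node 0 f (unpair₂ n) (encodeList (w ∷ xs)) (suc v) ∈ ns) →
               JustifiedIn (node 0 (suc f) n (encodeList xs) z)
  justify-mu f n xs z t≡ m₀ below =
    byTag-justifies f n a z (byTag-mu (≡⇒✓equal t≡ ✓* (zero-premise ✓* positive-premises)))
    where
      a = encodeList xs
      open Introduction g T L 0 (suc f) n a z
      zero-premise : ✓ (J.hasMuZero 0 (suc f) n a z)
      zero-premise = ∈⇒✓bsum ns m₀ (J.muZeroPremise 0 (suc f) n a z) (λ j e → ≡⇒✓equal e)
      positive-premises : ✓ (J.allMuPositive 0 (suc f) n a z)
      positive-premises = ∀⇒✓bprod _ z (λ w w<z →
        ∈⇒✓bsum ns (proj₂ (below w w<z)) (J.muPositivePremise 0 (suc f) n a z w) (λ j e →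
          let open NodeFields 0 f (unpair₂ n) (encodeList (w ∷ xs)) (suc (proj₁ (below w w<z))) e in
          ≡0⇒✓isZero kind≡ ✓* ≡⇒✓equal fuel≡ ✓* ≡⇒✓equal index≡ ✓* ≡⇒✓equal input≡ ✓* ≡suc⇒✓nonZero output≡))

  justify-nil-fuel0 : ∀ n xs → JustifiedIn (node 1 0 n (encodeList xs) 0)
  justify-nil-fuel0 n xs = conclude (I.list-node 1 0 n a 0 refl (I.list-fuel0 1 0 n a 0 refl refl))
    where a = encodeList xs

  justify-nil : ∀ f xs → JustifiedIn (node 1 (suc f) 0 (encodeList xs) 0)
  justify-nil f xs = conclude (I.list-node 1 (suc f) 0 a 0 refl (I.list-nil 1 (suc f) 0 a 0 refl refl refl))
    where a = encodeList xs

  justify-cons : ∀ f m xs y₁ ys → node 0 f (unpair₁ m) (encodeList xs) y₁ ∈ ns →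
                 node 1 f (unpair₂ m) (encodeList xs) (encodeList ys) ∈ ns →
                 JustifiedIn (node 1 (suc f) (suc m) (encodeList xs) (encodeList (y₁ ∷ ys)))
  justify-cons f m xs y₁ ys m₁ m₂ = conclude (I.list-node 1 (suc f) (suc m) a y refl
    (I.list-cons 1 (suc f) (suc m) a y refl refl refl premises))
    where
      a = encodeList xs
      y = encodeList (y₁ ∷ ys)
      premises : ✓ (J.hasCons 1 (suc f) (suc m) a y)
      premises = ∈⇒✓bsum ns m₁ _ (λ j e → ∈⇒✓bsum ns m₂ (J.consPremises 1 (suc f) (suc m) a y j) (λ j' e' →
        ≡⇒✓equal (trans e (cong (node 0 f (unpair₁ m) a) (sym (headᴺ-encode y₁ ys))))
        ✓* ≡⇒✓equal (trans e' (cong (node 1 f (unpair₂ m) a) (sym (tailᴺ-encode y₁ ys))))))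

module TraceConstruction (g : Baire) where
  open Rules g using (JustifiedIn)

  Closed : List ℕ → Set
  Closed ns = ∀ {X} → X ∈ ns → ∀ ns' → ns ⊆ ns' → JustifiedIn ns' X

  Witnessed : ℕ → Set
  Witnessed X = Σ (List ℕ) λ ns → X ∈ ns × Closed ns

  ++-closed : ∀ {ns₁ ns₂} → Closed ns₁ → Closed ns₂ → Closed (ns₁ ++ ns₂)
  ++-closed {ns₁} {ns₂} cl₁ cl₂ X∈ ns' ⊆ns' with ∈-++⁻ ns₁ X∈
  ... | inj₁ X∈₁ = cl₁ X∈₁ ns' (⊆ns' ∘ ∈-++⁺ˡ)
  ... | inj₂ X∈₂ = cl₂ X∈₂ ns' (⊆ns' ∘ ∈-++⁺ʳ ns₁)

  extend : ∀ {X} ns → Closed ns → (∀ ns' → ns ⊆ ns' → JustifiedIn ns' X) → Witnessed X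
  extend {X} ns cl justify = X ∷ ns , here refl , closed
    where closed : Closed (X ∷ ns)
          closed (here refl) ns' ⊆ns' = justify ns' (⊆ns' ∘ there)
          closed (there Y∈) ns' ⊆ns' = cl Y∈ ns' (⊆ns' ∘ there)

  axiom : ∀ {X} → (∀ ns' → JustifiedIn ns' X) → Witnessed X
  axiom justify = extend [] (λ ()) (λ ns' _ → justify ns')

  rule₁ : ∀ {X₁ X} → Witnessed X₁ → (∀ ns' → X₁ ∈ ns' → JustifiedIn ns' X) → Witnessed X
  rule₁ (ns , X₁∈ , cl) justify = extend ns cl (λ ns' ⊆ns' → justify ns' (⊆ns' X₁∈))

  rule₂ : ∀ {X₁ X₂ X} → Witnessed X₁ → Witnessed X₂ →
          (∀ ns' → X₁ ∈ ns' → X₂ ∈ ns' → JustifiedIn ns' X) → Witnessed X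
  rule₂ (ns₁ , X₁∈ , cl₁) (ns₂ , X₂∈ , cl₂) justify =
    extend (ns₁ ++ ns₂) (++-closed cl₁ cl₂)
      (λ ns' ⊆ns' → justify ns' (⊆ns' (∈-++⁺ˡ X₁∈)) (⊆ns' (∈-++⁺ʳ ns₁ X₂∈)))

  -- witnesses for the non-zero values below the minimiser of mu
  WitnessedBelow : ℕ → (ℕ → ℕ → ℕ) → Set
  WitnessedBelow z N = Σ (List ℕ) λ ns → (∀ w → w < z → Σ ℕ λ v → N w v ∈ ns) × Closed ns

  muNode : ℕ → ℕ → List ℕ → ℕ → ℕ → ℕ
  muNode f r xs w v = node 0 f r (encodeList (w ∷ xs)) (suc v)

  below-suc : ∀ {k N v} → WitnessedBelow k N → Witnessed (N k v) → WitnessedBelow (suc k) N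
  below-suc {k} {N} {v} (ns₁ , below∈ , cl₁) (ns₂ , k∈ , cl₂) = ns₁ ++ ns₂ , found , ++-closed cl₁ cl₂
    where found : ∀ w → w < suc k → Σ ℕ λ v → N w v ∈ ns₁ ++ ns₂
          found w (s≤s w≤k) with m≤n⇒m<n∨m≡n w≤k
          ... | inj₁ w<k  = let (v' , w∈) = below∈ w w<k in v' , ∈-++⁺ˡ w∈
          ... | inj₂ refl = v , ∈-++⁺ʳ ns₁ k∈

  mutual
    witness : ∀ {c xs y} → Eval g c xs y → ∀ f n → decodeF f n ≡ c → Witnessed (node 0 f n (encodeList xs) y)
    witness (e-zer {xs}) f n eq = axiom (λ ns' → Rules.justify-zer g ns' f n xs eq)
    witness (e-sc {x} {xs}) (suc f) n eq = axiom (λ ns' → Rules.justify-sc g ns' f n x xs eq)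
    witness (e-prj {i} {xs}) (suc f) n eq = axiom (λ ns' → Rules.justify-prj g ns' f n i xs eq)
    witness (e-orc {x} {xs}) (suc f) n eq = axiom (λ ns' → Rules.justify-orc g ns' f n x xs eq)
    witness (e-comp {xs = xs} {ys} {y} args e) (suc f) n eq =
      let (t≡ , c≡ , hs≡) = decodeTag≡comp (unpair₁ n) (trans (sym (decodeF-suc f n)) eq) in
      rule₂ (witnessL args f _ hs≡) (witness e f _ c≡) (λ ns' → Rules.justify-comp g ns' f n xs ys y t≡)
    witness (e-prec0 {xs = xs} {y} e) (suc f) n eq =
      let (t≡ , b≡ , _) = decodeTag≡prec (unpair₁ n) (trans (sym (decodeF-suc f n)) eq) in
      rule₁ (witness e f _ b≡) (λ ns' → Rules.justify-prec0 g ns' f n xs y t≡)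
    witness (e-precS {n = m} {xs} {y₁} {y} e₁ e₂) (suc f) n eq =
      let (t≡ , _ , s≡) = decodeTag≡prec (unpair₁ n) (trans (sym (decodeF-suc f n)) eq) in
      rule₂ (witness e₁ (suc f) n eq) (witness e₂ f _ s≡) (λ ns' → Rules.justify-precS g ns' f n m xs y₁ y t≡)
    witness (e-mu {xs = xs} {z} e₀ below) (suc f) n eq =
      let (t≡ , c≡) = decodeTag≡mu (unpair₁ n) (trans (sym (decodeF-suc f n)) eq)
          (ns₀ , z∈ , cl₀) = witness e₀ f (unpair₂ n) c≡
          (ns₁ , below∈ , cl₁) = witness-below below f (unpair₂ n) c≡ z ≤-refl
      in extend (ns₀ ++ ns₁) (++-closed cl₀ cl₁) (λ ns' ⊆ns' →
           Rules.justify-mu g ns' f n xs z t≡ (⊆ns' (∈-++⁺ˡ z∈))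
             (λ w w<z → let (v , w∈) = below∈ w w<z in v , ⊆ns' (∈-++⁺ʳ ns₀ w∈)))

    witness-below : ∀ {c xs z} → (∀ w → w < z → Σ ℕ λ v → Eval g c (w ∷ xs) (suc v)) →
                    ∀ f r → decodeF f r ≡ c → ∀ k → k ≤ z → WitnessedBelow k (muNode f r xs)
    witness-below below f r eq zero _ = [] , (λ w ()) , (λ ())
    witness-below {xs = xs} below f r eq (suc k) k<z =
      let (v , ev) = below k k<z in
      below-suc (witness-below below f r eq k (≤-trans (n≤1+n k) k<z)) (witness ev f r eq)

    witnessL : ∀ {cs xs ys} → EvalL g cs xs ys → ∀ f n → decodeL f n ≡ cs →
               Witnessed (node 1 f n (encodeList xs) (encodeList ys))
    witnessL ([] {xs}) zero n eq = axiom (λ ns' → Rules.justify-nil-fuel0 g ns' n xs)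
    witnessL ([] {xs}) (suc f) zero eq = axiom (λ ns' → Rules.justify-nil g ns' f xs)
    witnessL (_∷_ {xs = xs} {y₁} {ys} e es) (suc f) (suc m) eq
      with trans (sym (decodeL-suc f m)) eq
    ... | refl = rule₂ (witness e f (unpair₁ m) refl) (witnessL es f (unpair₂ m) refl)
                       (λ ns' → Rules.justify-cons g ns' f m xs y₁ ys)

Eval⇒certified : ∀ g e x y → Eval g (decode e) (x ∷ []) y → Σ ℕ λ w → ✓ (certifies g w e x) × (unpair₁ w ≡ y)
Eval⇒certified g e x y ev = w , subst ✓ (sym certifies-w) (valid ✓* root) , unpair₁-pair y _
  where
    open TraceConstruction g
    witnessed = witness ev e e refl
    ns = proj₁ witnessed
    T = encodeList ns
    L = length ns
    w = pair y (pair L T)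
    Certifies : ℕ → ℕ → ℕ → ℕ
    Certifies T' L' y' = validTrace g T' L' * bsum (λ i → equal (nthᴺ i T') (node 0 e e (consᴺ x 0) y')) L'
    certifies-w : certifies g w e x ≡ Certifies T L y
    certifies-w = cong₃ Certifies (trans (cong unpair₂ (unpair₂-pair y (pair L T))) (unpair₂-pair L T))
                                  (trans (cong unpair₁ (unpair₂-pair y (pair L T))) (unpair₁-pair L T))
                                  (unpair₁-pair y (pair L T))
      where cong₃ : ∀ (F : ℕ → ℕ → ℕ → ℕ) {a b c a' b' c'} → a ≡ a' → b ≡ b' → c ≡ c' → F a b c ≡ F a' b' c'
            cong₃ F refl refl refl = refl
    valid : ✓ (validTrace g T L)
    valid = ∀⇒✓bprod _ L (λ i i<L → proj₂ (proj₂ witnessed) (nthᴺ-encode-∈ ns i i<L) ns (λ m → m))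
    root : ✓ (bsum (λ i → equal (nthᴺ i T) (node 0 e e (consᴺ x 0) y)) L)
    root = ∈⇒✓bsum ns (proj₁ (proj₂ witnessed)) _ (λ j e → ≡⇒✓equal e)

mutual
  Eval-deterministic : ∀ {g c xs y y'} → Eval g c xs y → Eval g c xs y' → y ≡ y'
  Eval-deterministic e-zer e-zer = refl
  Eval-deterministic e-sc e-sc = refl
  Eval-deterministic e-prj e-prj = refl
  Eval-deterministic e-orc e-orc = refl
  Eval-deterministic (e-comp l e) (e-comp l' e') with EvalL-deterministic l l'
  ... | refl = Eval-deterministic e e'
  Eval-deterministic (e-prec0 e) (e-prec0 e') = Eval-deterministic e e'
  Eval-deterministic (e-precS e₁ e₂) (e-precS e₁' e₂') with Eval-deterministic e₁ e₁'
  ... | refl = Eval-deterministic e₂ e₂'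
  Eval-deterministic (e-mu {z = z} e below) (e-mu {z = z'} e' below') with <-cmp z z'
  ... | tri< z<z' _ _ = ⊥-elim (0≢1+n (Eval-deterministic e (proj₂ (below' z z<z'))))
  ... | tri≈ _ z≡z' _ = z≡z'
  ... | tri> _ _ z'<z = ⊥-elim (0≢1+n (Eval-deterministic e' (proj₂ (below z' z'<z))))

  EvalL-deterministic : ∀ {g cs xs ys ys'} → EvalL g cs xs ys → EvalL g cs xs ys' → ys ≡ ys'
  EvalL-deterministic [] [] = refl
  EvalL-deterministic (e ∷ l) (e' ∷ l') = cong₂ _∷_ (Eval-deterministic e e') (EvalL-deterministic l l')

least-witness : (P : ℕ → ℕ) → ∀ w → ✓ (P w) → Σ ℕ λ w₀ → ✓ (P w₀) × (∀ w' → w' < w₀ → P w' ≡ 0)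
least-witness P w Pw = search 0 (λ _ ()) w Pw
  where
    search : ∀ k → (∀ w' → w' < k → P w' ≡ 0) → ∀ d → ✓ (P (k + d)) →
             Σ ℕ λ w₀ → ✓ (P w₀) × (∀ w' → w' < w₀ → P w' ≡ 0)
    search k below d P[k+d] with ✓-dec (P k)
    ... | inj₁ Pk  = k , Pk , below
    ... | inj₂ Pk≡0 with d
    ...   | zero   = ⊥-elim (<-irrefl (sym Pk≡0) (subst (λ q → ✓ (P q)) (+-identityʳ k) P[k+d]))
    ...   | suc d' = search (suc k) below' d' (subst (λ q → ✓ (P q)) (+-suc k d') P[k+d])
      where below' : ∀ w' → w' < suc k → P w' ≡ 0
            below' w' (s≤s w'≤k) with m≤n⇒m<n∨m≡n w'≤k
            ... | inj₁ w'<k = below w' w'<k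
            ... | inj₂ refl = Pk≡0

NotCertified : ∀ {g} → Prog g
NotCertified {g} = CheckerPrograms.isZeroᵖ {g} (CheckerPrograms.Certifies {g})

NotCertified-sem : ∀ {g} w e x → sem (NotCertified {g}) (w ∷ e ∷ x ∷ []) ≡ isZero (certifies g w e x)
NotCertified-sem {g} w e x = cong isZero (CheckerPrograms.Certifies-sem {g} w e x)

-- Kleene normal form: search for the least certificate, then read off its result.
opaque
  universal : Code
  universal = comp (code (Unpair₁ {zeroOracle}))
                   (comp (mu (code (NotCertified {zeroOracle}))) (prj 0 ∷ prj 1 ∷ []) ∷ [])

  universal-eval : ∀ {g e x y} ρ → Eval g (decode e) (x ∷ []) y → Eval g universal (e ∷ x ∷ ρ) y
  universal-eval {g} {e} {x} {y} ρ ev =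
    e-comp (e-comp (e-prj ∷ e-prj ∷ []) (e-mu at-least below) ∷ [])
           (subst (Eval g (code (Unpair₁ {g})) (w₀ ∷ [])) result≡y (eval Unpair₁ (w₀ ∷ [])))
    where
      certificate : Σ ℕ λ w → ✓ (certifies g w e x) × (unpair₁ w ≡ y)
      certificate = Eval⇒certified g e x y ev
      least : Σ ℕ λ w₀ → ✓ (certifies g w₀ e x) × (∀ w' → w' < w₀ → certifies g w' e x ≡ 0)
      least = least-witness (λ w → certifies g w e x) (proj₁ certificate) (proj₁ (proj₂ certificate))
      w₀ : ℕ
      w₀ = proj₁ least
      at-least : Eval g (code (NotCertified {g})) (w₀ ∷ e ∷ x ∷ []) 0
      at-least = subst (Eval g (code (NotCertified {g})) (w₀ ∷ e ∷ x ∷ []))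
                       (trans (NotCertified-sem {g} w₀ e x) (✓⇒isZero≡0 (proj₁ (proj₂ least))))
                       (eval (NotCertified {g}) _)
      below : ∀ w → w < w₀ → Σ ℕ λ v → Eval g (code (NotCertified {g})) (w ∷ e ∷ x ∷ []) (suc v)
      below w w<w₀ = 0 , subst (Eval g (code (NotCertified {g})) (w ∷ e ∷ x ∷ []))
                               (trans (NotCertified-sem {g} w e x)
                                      (trans (cong isZero (proj₂ (proj₂ least) w w<w₀)) isZero-0))
                               (eval (NotCertified {g}) _)
      result≡y : unpair₁ w₀ ≡ y
      result≡y = Eval-deterministic (certified⇒Eval g w₀ e x (proj₁ (proj₂ least))) ev

_⊢_⇓_ : Baire → Code → Baire → Set
h ⊢ c ⇓ f = ∀ x → Eval h c (x ∷ []) (f x)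

⇓-resp : ∀ {h h' c f f'} → h ≗ h' → f ≗ f' → h ⊢ c ⇓ f → h' ⊢ c ⇓ f'
⇓-resp {h' = h'} {c} h≗h' f≗f' ev x = subst (Eval h' c (x ∷ [])) (f≗f' x) (Eval-resp h≗h' (ev x))

reduction : ∀ {h c f} (A : MassProblem) → h ⊢ c ⇓ f → A ∋ f → Φ[ encode c ]⟨ h ⟩∈ A
reduction A ev f∈A = _ , f∈A , λ x → Φ-encode (ev x)

Φ-resp : ∀ {e h h'} (A : MassProblem) → h ≗ h' → Φ[ e ]⟨ h ⟩∈ A → Φ[ e ]⟨ h' ⟩∈ A
Φ-resp A h≗h' (f , f∈A , ev) = f , f∈A , λ x → Eval-resp h≗h' (ev x)

-- Replacing each oracle call by a code S turns a computation relative to σ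
-- into one relative to h, provided S computes σ from h.
mutual
  substitute : Code → Code → Code
  substitute S zer         = zer
  substitute S sc          = sc
  substitute S (prj i)     = prj i
  substitute S orc         = comp S (prj 0 ∷ [])
  substitute S (comp f hs) = comp (substitute S f) (substituteL S hs)
  substitute S (prec f k)  = prec (substitute S f) (substitute S k)
  substitute S (mu f)      = mu (substitute S f)

  substituteL : Code → List Code → List Code
  substituteL S []       = []
  substituteL S (c ∷ cs) = substitute S c ∷ substituteL S cs

module _ {h σ : Baire} {S : Code} (S⇓σ : h ⊢ S ⇓ σ) where
  mutual
    substitute-eval : ∀ {c xs y} → Eval σ c xs y → Eval h (substitute S c) xs y
    substitute-eval e-zer           = e-zer
    substitute-eval e-sc            = e-sc
    substitute-eval e-prj           = e-prj
    substitute-eval (e-orc {x})     = e-comp (e-prj ∷ []) (S⇓σ x)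
    substitute-eval (e-comp l e)    = e-comp (substituteL-eval l) (substitute-eval e)
    substitute-eval (e-prec0 e)     = e-prec0 (substitute-eval e)
    substitute-eval (e-precS e₁ e₂) = e-precS (substitute-eval e₁) (substitute-eval e₂)
    substitute-eval (e-mu e below)  =
      e-mu (substitute-eval e) (λ w w<z → proj₁ (below w w<z) , substitute-eval (proj₂ (below w w<z)))

    substituteL-eval : ∀ {cs xs ys} → EvalL σ cs xs ys → EvalL h (substituteL S cs) xs ys
    substituteL-eval []      = []
    substituteL-eval (e ∷ l) = substitute-eval e ∷ substituteL-eval l

  Φ-relativize : ∀ {e} (A : MassProblem) → Φ[ e ]⟨ σ ⟩∈ A → Φ[ encode (substitute S (decode e)) ]⟨ h ⟩∈ A
  Φ-relativize A (f , f∈A , ev) = reduction A (λ x → substitute-eval (ev x)) f∈A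

run : Code → Code → Code → Code
run S e x = comp (substitute S universal) (e ∷ x ∷ [])

run-eval : ∀ {h σ S ce cx ρ e x y} → h ⊢ S ⇓ σ → Eval h ce ρ e → Eval h cx ρ x → Φ[ e ]⟨ σ ⟩ x ⇓ y →
           Eval h (run S ce cx) ρ y
run-eval S⇓σ ev-e ev-x φ = e-comp (ev-e ∷ ev-x ∷ []) (substitute-eval S⇓σ (universal-eval [] φ))

if0 : ℕ → ℕ → ℕ → ℕ
if0 zero    a b = a
if0 (suc _) a b = b

if0-0 : ∀ {c a b} → c ≡ 0 → if0 c a b ≡ a
if0-0 refl = refl

if0-suc : ∀ {c c' a b} → c ≡ suc c' → if0 c a b ≡ b
if0-suc refl = refl

if0-⌢ : ∀ q a (f : Baire) → if0 q a (f (pred q)) ≡ (a ⌢ f) q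
if0-⌢ zero    a f = refl
if0-⌢ (suc q) a f = refl

parityᴺ : ℕ → ℕ
parityᴺ 0             = 0
parityᴺ 1             = 1
parityᴺ (suc (suc n)) = parityᴺ n

parityᴺ-suc : ∀ j → parityᴺ (suc j) ≡ isZero (parityᴺ j)
parityᴺ-suc 0             = sym isZero-0
parityᴺ-suc 1             = sym (isZero-suc 0)
parityᴺ-suc (suc (suc j)) = parityᴺ-suc j

⌊suc/2⌋ : ∀ j → ⌊ suc j /2⌋ ≡ ⌊ j /2⌋ + parityᴺ j
⌊suc/2⌋ 0             = refl
⌊suc/2⌋ 1             = refl
⌊suc/2⌋ (suc (suc j)) = cong suc (⌊suc/2⌋ j)

⊕ᶠ-even : ∀ (f g : Baire) n → (f ⊕ᶠ g) (n + n) ≡ f n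
⊕ᶠ-even f g zero    = refl
⊕ᶠ-even f g (suc n) rewrite +-suc n n = ⊕ᶠ-even (f ∘ suc) (g ∘ suc) n

⊕ᶠ-odd : ∀ (f g : Baire) n → (f ⊕ᶠ g) (suc (n + n)) ≡ g n
⊕ᶠ-odd f g zero    = refl
⊕ᶠ-odd f g (suc n) rewrite +-suc n n = ⊕ᶠ-odd (f ∘ suc) (g ∘ suc) n

⊕ᶠ-if0 : ∀ (f g : Baire) j → (f ⊕ᶠ g) j ≡ if0 (parityᴺ j) (f ⌊ j /2⌋) (g ⌊ j /2⌋)
⊕ᶠ-if0 f g 0             = refl
⊕ᶠ-if0 f g 1             = refl
⊕ᶠ-if0 f g (suc (suc j)) = ⊕ᶠ-if0 (f ∘ suc) (g ∘ suc) j

module _ {g : Baire} where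

  Parity : Prog g
  Parity = withSem (Rec Zero (IsZero $ (Arg 1 ∷ [])) (Arg 0 ∷ [])) (λ ρ → parityᴺ (nth 0 ρ)) (λ ρ → go (nth 0 ρ))
    where go : ∀ n → primRec (λ _ → 0) (λ ρ → isZero (nth 1 ρ)) n [] ≡ parityᴺ n
          go zero    = refl
          go (suc n) = trans (cong isZero (go n)) (sym (parityᴺ-suc n))

  Half : Prog g
  Half = withSem (Rec Zero (Add $ (Arg 1 ∷ Parity $ (Arg 0 ∷ []) ∷ [])) (Arg 0 ∷ [])) (λ ρ → ⌊ nth 0 ρ /2⌋)
                 (λ ρ → go (nth 0 ρ))
    where go : ∀ n → primRec (λ _ → 0) (λ ρ → nth 1 ρ + parityᴺ (nth 0 ρ)) n [] ≡ ⌊ n /2⌋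
          go zero    = refl
          go (suc n) = trans (cong (_+ parityᴺ n) (go n)) (sym (⌊suc/2⌋ n))

  If0 : Prog g
  If0 = withSem (Add $ (Mul $ (IsZero $ (Arg 0 ∷ []) ∷ Arg 1 ∷ [])
                      ∷ Mul $ (IsZero $ (IsZero $ (Arg 0 ∷ []) ∷ []) ∷ Arg 2 ∷ []) ∷ []))
                (λ ρ → if0 (nth 0 ρ) (nth 1 ρ) (nth 2 ρ)) (λ ρ → arith (nth 0 ρ) (nth 1 ρ) (nth 2 ρ))
    where arith : ∀ c a b → isZero c * a + isZero (isZero c) * b ≡ if0 c a b
          arith zero a b rewrite isZero-0 | isZero-suc 0 = trans (+-identityʳ _) (+-identityʳ a)
          arith (suc c) a b rewrite isZero-suc c | isZero-0 = +-identityʳ b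

argᶜ : Code
argᶜ = prj 0

constᶜ : ℕ → Code
constᶜ = constCode

readᶜ sucᶜ predᶜ doubleᶜ halfᶜ parityᶜ unpair₁ᶜ unpair₂ᶜ : Code → Code
readᶜ a     = comp orc (a ∷ [])
sucᶜ a      = comp sc (a ∷ [])
predᶜ       = ap₁ Predecessor
doubleᶜ a   = ap₂ Add a a
halfᶜ       = ap₁ Half
parityᶜ     = ap₁ Parity
unpair₁ᶜ    = ap₁ Unpair₁
unpair₂ᶜ    = ap₁ Unpair₂

pairᶜ nthᶜ : Code → Code → Code
pairᶜ = ap₂ Pair
nthᶜ  = ap₂ Nth

if0ᶜ : Code → Code → Code → Code
if0ᶜ = ap₃ If0

module _ {h : Baire} {ρ : List ℕ} where

  arg-eval : ∀ {x} → Eval h argᶜ (x ∷ ρ) x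
  arg-eval = e-prj

  const-eval : ∀ n → Eval h (constᶜ n) ρ n
  const-eval n = constCode-eval n ρ

  read-eval : ∀ {a x} → Eval h a ρ x → Eval h (readᶜ a) ρ (h x)
  read-eval ea = e-comp (ea ∷ []) e-orc

  suc-eval : ∀ {a x} → Eval h a ρ x → Eval h (sucᶜ a) ρ (suc x)
  suc-eval ea = e-comp (ea ∷ []) e-sc

  pred-eval : ∀ {a x} → Eval h a ρ x → Eval h (predᶜ a) ρ (pred x)
  pred-eval ea = e-comp (ea ∷ []) (eval Predecessor _)

  double-eval : ∀ {a x} → Eval h a ρ x → Eval h (doubleᶜ a) ρ (x + x)
  double-eval ea = e-comp (ea ∷ ea ∷ []) (eval Add _)

  half-eval : ∀ {a x} → Eval h a ρ x → Eval h (halfᶜ a) ρ ⌊ x /2⌋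
  half-eval ea = e-comp (ea ∷ []) (eval Half _)

  parity-eval : ∀ {a x} → Eval h a ρ x → Eval h (parityᶜ a) ρ (parityᴺ x)
  parity-eval ea = e-comp (ea ∷ []) (eval Parity _)

  unpair₁-eval : ∀ {a x} → Eval h a ρ x → Eval h (unpair₁ᶜ a) ρ (unpair₁ x)
  unpair₁-eval ea = e-comp (ea ∷ []) (eval Unpair₁ _)

  unpair₂-eval : ∀ {a x} → Eval h a ρ x → Eval h (unpair₂ᶜ a) ρ (unpair₂ x)
  unpair₂-eval ea = e-comp (ea ∷ []) (eval Unpair₂ _)

  pair-eval : ∀ {a b x y} → Eval h a ρ x → Eval h b ρ y → Eval h (pairᶜ a b) ρ (pair x y)
  pair-eval ea eb = e-comp (ea ∷ eb ∷ []) (eval Pair _)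

  nth-eval : ∀ {a b i l} → Eval h a ρ i → Eval h b ρ l → Eval h (nthᶜ a b) ρ (nthᴺ i l)
  nth-eval ea eb = e-comp (ea ∷ eb ∷ []) (eval Nth _)

  if0-eval : ∀ {a b c x y z} → Eval h a ρ x → Eval h b ρ y → Eval h c ρ z → Eval h (if0ᶜ a b c) ρ (if0 x y z)
  if0-eval ea eb ec = e-comp (ea ∷ eb ∷ ec ∷ []) (eval If0 _)

_after_ : Code → Code → Code
c after d = comp c (d ∷ [])

oracleᶜ tailᶜ : Code
oracleᶜ = readᶜ argᶜ
tailᶜ   = readᶜ (sucᶜ argᶜ)

prefixᶜ : Code → Code → Code
prefixᶜ v r = if0ᶜ argᶜ v (r after predᶜ argᶜ)

interleaveᶜ : Code → Code → Code
interleaveᶜ l r = if0ᶜ (parityᶜ argᶜ) (l after halfᶜ argᶜ) (r after halfᶜ argᶜ)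

module _ {h : Baire} where

  after-⇓ : ∀ {c d f k} → h ⊢ c ⇓ f → h ⊢ d ⇓ k → h ⊢ c after d ⇓ (f ∘ k)
  after-⇓ c⇓ d⇓ x = e-comp (d⇓ x ∷ []) (c⇓ _)

  oracle-⇓ : h ⊢ oracleᶜ ⇓ h
  oracle-⇓ x = read-eval arg-eval

  tail-⇓ : h ⊢ tailᶜ ⇓ tail h
  tail-⇓ x = read-eval (suc-eval arg-eval)

  const-⇓ : ∀ n → h ⊢ constᶜ n ⇓ (λ _ → n)
  const-⇓ n x = const-eval n

  prefix-⇓ : ∀ {v r a f} → h ⊢ v ⇓ (λ _ → a) → h ⊢ r ⇓ f → h ⊢ prefixᶜ v r ⇓ (a ⌢ f)
  prefix-⇓ {a = a} {f} v⇓ r⇓ q =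
    subst (Eval h _ (q ∷ [])) (if0-⌢ q a f)
          (if0-eval arg-eval (v⇓ q) (e-comp (pred-eval arg-eval ∷ []) (r⇓ (pred q))))

  interleave-⇓ : ∀ {l r f f'} → h ⊢ l ⇓ f → h ⊢ r ⇓ f' → h ⊢ interleaveᶜ l r ⇓ (f ⊕ᶠ f')
  interleave-⇓ {f = f} {f'} l⇓ r⇓ j =
    subst (Eval h _ (j ∷ [])) (sym (⊕ᶠ-if0 f f' j))
      (if0-eval (parity-eval arg-eval) (e-comp (half-eval arg-eval ∷ []) (l⇓ _))
                                       (e-comp (half-eval arg-eval ∷ []) (r⇓ _)))

  run-⇓ : ∀ {S σ e f} → h ⊢ S ⇓ σ → (∀ x → Φ[ e ]⟨ σ ⟩ x ⇓ f x) → h ⊢ run S (constᶜ e) argᶜ ⇓ f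
  run-⇓ {e = e} S⇓ φ x = run-eval S⇓ (const-eval e) arg-eval (φ x)

  read-const-⇓ : ∀ n → h ⊢ readᶜ (constᶜ n) ⇓ (λ _ → h n)
  read-const-⇓ n x = read-eval (const-eval n)

  if0-⇓ : ∀ {a b c fa fb fc} → h ⊢ a ⇓ fa → h ⊢ b ⇓ fb → h ⊢ c ⇓ fc →
          h ⊢ if0ᶜ a b c ⇓ (λ q → if0 (fa q) (fb q) (fc q))
  if0-⇓ a⇓ b⇓ c⇓ q = if0-eval (a⇓ q) (b⇓ q) (c⇓ q)

evenᶜ oddᶜ secondᶜ : Code
evenᶜ   = oracleᶜ after doubleᶜ argᶜ
oddᶜ    = oracleᶜ after sucᶜ (doubleᶜ argᶜ)
secondᶜ = oracleᶜ after sucᶜ (sucᶜ (doubleᶜ argᶜ))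

module _ {f g : Baire} where

  even-⇓ : (f ⊕ᶠ g) ⊢ evenᶜ ⇓ f
  even-⇓ ℓ = subst (Eval (f ⊕ᶠ g) evenᶜ (ℓ ∷ [])) (⊕ᶠ-even f g ℓ)
                   (e-comp (double-eval arg-eval ∷ []) (read-eval arg-eval))

  odd-⇓ : (f ⊕ᶠ g) ⊢ oddᶜ ⇓ g
  odd-⇓ ℓ = subst (Eval (f ⊕ᶠ g) oddᶜ (ℓ ∷ [])) (⊕ᶠ-odd f g ℓ)
                  (e-comp (suc-eval (double-eval arg-eval) ∷ []) (read-eval arg-eval))

module _ {n : ℕ} {k f g : Baire} (k≗ : k ≗ (f ⊕ᶠ g)) where

  first-⇓ : (n ⌢ k) ⊢ oddᶜ ⇓ f
  first-⇓ ℓ = subst (Eval (n ⌢ k) oddᶜ (ℓ ∷ [])) (trans (k≗ (ℓ + ℓ)) (⊕ᶠ-even f g ℓ))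
                    (e-comp (suc-eval (double-eval arg-eval) ∷ []) (read-eval arg-eval))

  second-⇓ : (n ⌢ k) ⊢ secondᶜ ⇓ g
  second-⇓ ℓ = subst (Eval (n ⌢ k) secondᶜ (ℓ ∷ [])) (trans (k≗ (suc (ℓ + ℓ))) (⊕ᶠ-odd f g ℓ))
                     (e-comp (suc-eval (suc-eval (double-eval arg-eval)) ∷ []) (read-eval arg-eval))

-- Reductions between families of mass problems that are uniform in the index,
-- the index being supplied as the first value of the oracle.
module UniformReducibility (I : Set) (⌜_⌝ : I → ℕ) where

  Family : Set₁
  Family = I → MassProblem

  infix 4 _≼_
  _≼_ : Family → Family → Set
  A ≼ B = Σ ℕ λ e → ∀ i g → B i ∋ g → Φ[ e ]⟨ ⌜ i ⌝ ⌢ g ⟩∈ A i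

  _⊕ᴵ_ _⊗ᴵ_ _→ᴵ_ : Family → Family → Family
  (A ⊕ᴵ B) i = A i ⊕M B i
  (A ⊗ᴵ B) i = A i ⊗M B i
  (A →ᴵ B) i = A i →M B i

  ≼-refl : ∀ A → A ≼ A
  ≼-refl A = encode tailᶜ , λ i g g∈A → reduction (A i) tail-⇓ g∈A

  ≼-trans : ∀ {A B C} → A ≼ B → B ≼ C → A ≼ C
  ≼-trans {A} {B} {C} (e₁ , A≼B) (e₂ , B≼C) = encode (substitute S (decode e₁)) , reduce
    where
      S = prefixᶜ (readᶜ (constᶜ 0)) (run oracleᶜ (constᶜ e₂) argᶜ)
      reduce : ∀ i g → C i ∋ g → Φ[ encode (substitute S (decode e₁)) ]⟨ ⌜ i ⌝ ⌢ g ⟩∈ A i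
      reduce i g g∈C = Φ-relativize (prefix-⇓ (read-const-⇓ 0) (run-⇓ oracle-⇓ (proj₂ (proj₂ f∈B)))) {e₁}
                                    (A i) (A≼B i (proj₁ f∈B) (proj₁ (proj₂ f∈B)))
        where f∈B = B≼C i g g∈C

  ⊕-upperˡ : ∀ A B → A ≼ A ⊕ᴵ B
  ⊕-upperˡ A B = encode oddᶜ , λ { i k (f , _ , f∈A , _ , k≗) → reduction (A i) (first-⇓ k≗) f∈A }

  ⊕-upperʳ : ∀ A B → B ≼ A ⊕ᴵ B
  ⊕-upperʳ A B = encode secondᶜ , λ { i k (_ , f' , _ , f'∈B , k≗) → reduction (B i) (second-⇓ k≗) f'∈B }

  ⊕-least : ∀ {A B C} → A ≼ C → B ≼ C → A ⊕ᴵ B ≼ C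
  ⊕-least {A} {B} {C} (e₁ , A≼C) (e₂ , B≼C) =
    encode (interleaveᶜ (run oracleᶜ (constᶜ e₁) argᶜ) (run oracleᶜ (constᶜ e₂) argᶜ)) , λ i g g∈C →
      let (f₁ , f₁∈A , ev₁) = A≼C i g g∈C ; (f₂ , f₂∈B , ev₂) = B≼C i g g∈C in
      reduction (A i ⊕M B i) (interleave-⇓ (run-⇓ oracle-⇓ ev₁) (run-⇓ oracle-⇓ ev₂))
                (f₁ , f₂ , f₁∈A , f₂∈B , λ _ → refl)

  ⊗-lowerˡ : ∀ A B → A ⊗ᴵ B ≼ A
  ⊗-lowerˡ A B = encode (prefixᶜ (constᶜ 0) tailᶜ) , λ i g g∈A →
    reduction (A i ⊗M B i) (prefix-⇓ (const-⇓ 0) tail-⇓) (inj₁ (refl , g∈A))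

  ⊗-lowerʳ : ∀ A B → A ⊗ᴵ B ≼ B
  ⊗-lowerʳ A B = encode (prefixᶜ (constᶜ 1) tailᶜ) , λ i g g∈B →
    reduction (A i ⊗M B i) (prefix-⇓ (const-⇓ 1) tail-⇓) (inj₂ (refl , g∈B))

  -- The tag k 0 of an element k of A ⊗ B selects which reduction to run on ⌜ i ⌝ ⌢ tail k.
  ⊗-greatest : ∀ {A B C} → C ≼ A → C ≼ B → C ≼ A ⊗ᴵ B
  ⊗-greatest {A} {B} {C} (e₁ , C≼A) (e₂ , C≼B) = encode (run S choice argᶜ) , reduce
    where
      S = prefixᶜ (readᶜ (constᶜ 0)) (oracleᶜ after sucᶜ (sucᶜ argᶜ))
      choice = if0ᶜ (readᶜ (constᶜ 1)) (constᶜ e₁) (constᶜ e₂)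
      reduce : ∀ i k → (A i ⊗M B i) ∋ k → Φ[ encode (run S choice argᶜ) ]⟨ ⌜ i ⌝ ⌢ k ⟩∈ C i
      reduce i k k∈A⊗B = by-tag k∈A⊗B
        where
          h = ⌜ i ⌝ ⌢ k
          S⇓ : h ⊢ S ⇓ (⌜ i ⌝ ⌢ tail k)
          S⇓ = prefix-⇓ (read-const-⇓ 0) (after-⇓ oracle-⇓ (λ q → suc-eval (suc-eval arg-eval)))
          choice⇓ : ∀ {q} → Eval h choice (q ∷ []) (if0 (k 0) e₁ e₂)
          choice⇓ = if0-eval (read-eval (const-eval 1)) (const-eval e₁) (const-eval e₂)
          chosen : ∀ {e} → if0 (k 0) e₁ e₂ ≡ e → Φ[ e ]⟨ ⌜ i ⌝ ⌢ tail k ⟩∈ C i →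
                   Φ[ encode (run S choice argᶜ) ]⟨ h ⟩∈ C i
          chosen e≡ (f , f∈C , ev) =
            reduction (C i) (λ q → run-eval S⇓ (subst (Eval h choice _) e≡ choice⇓) arg-eval (ev q)) f∈C
          by-tag : (A i ⊗M B i) ∋ k → Φ[ encode (run S choice argᶜ) ]⟨ h ⟩∈ C i
          by-tag (inj₁ (k₀≡0 , tail∈A)) = chosen (if0-0 k₀≡0) (C≼A i (tail k) tail∈A)
          by-tag (inj₂ (k₀≡1 , tail∈B)) = chosen (if0-suc k₀≡1) (C≼B i (tail k) tail∈B)

  ⊥-least : ∀ A → (λ _ → botM) ≼ A
  ⊥-least A = encode zer , λ i g _ → reduction botM (λ _ → e-zer) tt

  ⊤-greatest : ∀ A → A ≼ (λ _ → topM)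
  ⊤-greatest A = 0 , λ i g ()

  -- Output k₁ or k₂ if its tag puts it in A, else 1 ⌢ (tail k₁ ⊕ tail k₂).
  distribˡ : ∀ A B C → A ⊗ᴵ (B ⊕ᴵ C) ≼ (A ⊗ᴵ B) ⊕ᴵ (A ⊗ᴵ C)
  distribˡ A B C = encode D , λ { i k (k₁ , k₂ , k₁∈ , k₂∈ , k≗) → reduce i k k₁ k₂ k≗ k₁∈ k₂∈ }
    where
      L = oddᶜ
      R = secondᶜ
      D = if0ᶜ (L after constᶜ 0) L
            (if0ᶜ (R after constᶜ 0) R (prefixᶜ (constᶜ 1) (interleaveᶜ (L after sucᶜ argᶜ) (R after sucᶜ argᶜ))))
      reduce : ∀ i k k₁ k₂ → k ≗ (k₁ ⊕ᶠ k₂) → (A i ⊗M B i) ∋ k₁ → (A i ⊗M C i) ∋ k₂ →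
               Φ[ encode D ]⟨ ⌜ i ⌝ ⌢ k ⟩∈ (A i ⊗M (B i ⊕M C i))
      reduce i k k₁ k₂ k≗ k₁∈ k₂∈ = reduction (A i ⊗M (B i ⊕M C i)) D⇓ (member k₁∈ k₂∈)
        where
          h = ⌜ i ⌝ ⌢ k
          L⇓ : h ⊢ L ⇓ k₁
          L⇓ = first-⇓ k≗
          R⇓ : h ⊢ R ⇓ k₂
          R⇓ = second-⇓ k≗
          o : Baire
          o q = if0 (k₁ 0) (k₁ q) (if0 (k₂ 0) (k₂ q) ((1 ⌢ (tail k₁ ⊕ᶠ tail k₂)) q))
          D⇓ : h ⊢ D ⇓ o
          D⇓ = if0-⇓ (after-⇓ L⇓ (const-⇓ 0)) L⇓
                     (if0-⇓ (after-⇓ R⇓ (const-⇓ 0)) R⇓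
                            (prefix-⇓ (const-⇓ 1) (interleave-⇓ (after-⇓ L⇓ (λ _ → suc-eval arg-eval))
                                                                 (after-⇓ R⇓ (λ _ → suc-eval arg-eval)))))
          member : (A i ⊗M B i) ∋ k₁ → (A i ⊗M C i) ∋ k₂ → (A i ⊗M (B i ⊕M C i)) ∋ o
          member (inj₁ (k₁₀≡0 , t₁∈A)) _ =
            ext (A i ⊗M (B i ⊕M C i)) {g = o} (λ q → sym (if0-0 k₁₀≡0)) (inj₁ (k₁₀≡0 , t₁∈A))
          member (inj₂ (k₁₀≡1 , _)) (inj₁ (k₂₀≡0 , t₂∈A)) =
            ext (A i ⊗M (B i ⊕M C i)) {g = o} (λ q → sym (trans (if0-suc k₁₀≡1) (if0-0 k₂₀≡0))) (inj₁ (k₂₀≡0 , t₂∈A))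
          member (inj₂ (k₁₀≡1 , t₁∈B)) (inj₂ (k₂₀≡1 , t₂∈C)) =
            ext (A i ⊗M (B i ⊕M C i)) {g = o} (λ q → sym (trans (if0-suc k₁₀≡1) (if0-suc k₂₀≡1)))
                (inj₂ (refl , tail k₁ , tail k₂ , t₁∈B , t₂∈C , λ _ → refl))

  -- From k in A ⊗ (B ⊕ C): k itself if k 0 = 0, else 1 ⌢ (either half of tail k).
  distribʳ : ∀ A B C → (A ⊗ᴵ B) ⊕ᴵ (A ⊗ᴵ C) ≼ A ⊗ᴵ (B ⊕ᴵ C)
  distribʳ A B C = encode (interleaveᶜ (H (doubleᶜ argᶜ)) (H (sucᶜ (doubleᶜ argᶜ)))) , reduce
    where
      H : Code → Code
      H half = if0ᶜ (readᶜ (constᶜ 1)) tailᶜ (prefixᶜ (constᶜ 1) (tailᶜ after sucᶜ half))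
      reduce : ∀ i k → (A i ⊗M (B i ⊕M C i)) ∋ k →
               Φ[ encode (interleaveᶜ (H (doubleᶜ argᶜ)) (H (sucᶜ (doubleᶜ argᶜ)))) ]⟨ ⌜ i ⌝ ⌢ k ⟩∈
                 ((A i ⊗M B i) ⊕M (A i ⊗M C i))
      reduce i k k∈ = reduction ((A i ⊗M B i) ⊕M (A i ⊗M C i))
                        (interleave-⇓ (H⇓ (λ _ → double-eval arg-eval))
                                      (H⇓ (λ _ → suc-eval (double-eval arg-eval))))
                        (H₁ , H₂ , member₁ k∈ , member₂ k∈ , λ _ → refl)
        where
          h = ⌜ i ⌝ ⌢ k
          H-sem : (ℕ → ℕ) → Baire
          H-sem d q = if0 (k 0) (k q) ((1 ⌢ (λ ℓ → k (suc (d ℓ)))) q)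
          H₁ H₂ : Baire
          H₁ = H-sem (λ ℓ → ℓ + ℓ)
          H₂ = H-sem (λ ℓ → suc (ℓ + ℓ))
          H⇓ : ∀ {c d} → h ⊢ c ⇓ d → h ⊢ H c ⇓ H-sem d
          H⇓ c⇓ = if0-⇓ (read-const-⇓ 1) tail-⇓
                        (prefix-⇓ (const-⇓ 1) (after-⇓ tail-⇓ (λ q → suc-eval (c⇓ q))))
          member₁ : (A i ⊗M (B i ⊕M C i)) ∋ k → (A i ⊗M B i) ∋ H₁
          member₁ (inj₁ (k₀≡0 , t∈A)) = ext (A i ⊗M B i) {g = H₁} (λ q → sym (if0-0 k₀≡0)) (inj₁ (k₀≡0 , t∈A))
          member₁ (inj₂ (k₀≡1 , (f , f' , f∈B , _ , t≗))) =
            inj₂ (if0-suc k₀≡1 , ext (B i) {g = tail H₁}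
                                     (λ ℓ → sym (trans (if0-suc k₀≡1) (trans (t≗ (ℓ + ℓ)) (⊕ᶠ-even f f' ℓ)))) f∈B)
          member₂ : (A i ⊗M (B i ⊕M C i)) ∋ k → (A i ⊗M C i) ∋ H₂
          member₂ (inj₁ (k₀≡0 , t∈A)) = ext (A i ⊗M C i) {g = H₂} (λ q → sym (if0-0 k₀≡0)) (inj₁ (k₀≡0 , t∈A))
          member₂ (inj₂ (k₀≡1 , (f , f' , _ , f'∈C , t≗))) =
            inj₂ (if0-suc k₀≡1 , ext (C i) {g = tail H₂}
                                     (λ ℓ → sym (trans (if0-suc k₀≡1) (trans (t≗ (suc (ℓ + ℓ))) (⊕ᶠ-odd f f' ℓ)))) f'∈C)

module UniformResiduation (I : Set) (⌜_⌝ : I → ℕ) where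
  open UniformReducibility I ⌜_⌝

  -- The element e* ⌢ g of A → C, where e* runs e on ⌜ i ⌝ ⌢ (f ⊕ g) rebuilt from f ⊕ (e* ⌢ g).
  residuate : ∀ {A B C} → C ≼ A ⊕ᴵ B → A →ᴵ C ≼ B
  residuate {A} {B} {C} (e , C≼A⊕B) = encode (prefixᶜ (constᶜ e*) oracleᶜ) , reduce
    where
      S = prefixᶜ (readᶜ (constᶜ 1)) (interleaveᶜ evenᶜ (oddᶜ after sucᶜ argᶜ))
      e* = encode (substitute S (decode e))
      reduce : ∀ i g → B i ∋ g → Φ[ encode (prefixᶜ (constᶜ e*) oracleᶜ) ]⟨ ⌜ i ⌝ ⌢ g ⟩∈ (A i →M C i)
      reduce i g g∈B = reduction (A i →M C i) (prefix-⇓ (const-⇓ e*) oracle-⇓) implication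
        where
          implication : (A i →M C i) ∋ (e* ⌢ (⌜ i ⌝ ⌢ g))
          implication f f∈A = Φ-relativize S⇓ {e} (C i) (C≼A⊕B i (f ⊕ᶠ g) (f , g , f∈A , g∈B , λ _ → refl))
            where
              w = f ⊕ᶠ (⌜ i ⌝ ⌢ g)
              S⇓ : w ⊢ S ⇓ (⌜ i ⌝ ⌢ (f ⊕ᶠ g))
              S⇓ = prefix-⇓ (read-const-⇓ 1) (interleave-⇓ even-⇓ (after-⇓ odd-⇓ (λ _ → suc-eval arg-eval)))

  -- Compute H = Φ_d(⌜ i ⌝ ⌢ g) ∈ A → C from the oracle, then run H 0 on f ⊕ tail H.
  unresiduate : ∀ {A B C} → A →ᴵ C ≼ B → C ≼ A ⊕ᴵ B
  unresiduate {A} {B} {C} (d , A→C≼B) = encode (run S₂ (Hᶜ after constᶜ 0) argᶜ) , reduce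
    where
      S₁ = prefixᶜ (readᶜ (constᶜ 0)) secondᶜ
      Hᶜ = run S₁ (constᶜ d) argᶜ
      S₂ = interleaveᶜ oddᶜ (Hᶜ after sucᶜ argᶜ)
      reduce : ∀ i k → (A i ⊕M B i) ∋ k → Φ[ encode (run S₂ (Hᶜ after constᶜ 0) argᶜ) ]⟨ ⌜ i ⌝ ⌢ k ⟩∈ C i
      reduce i k (f , g , f∈A , g∈B , k≗) =
        reduction (C i) (λ q → run-eval S₂⇓ (after-⇓ H⇓ (const-⇓ 0) q) arg-eval (evF q)) F∈C
        where
          h = ⌜ i ⌝ ⌢ k
          S₁⇓ : h ⊢ S₁ ⇓ (⌜ i ⌝ ⌢ g)
          S₁⇓ = prefix-⇓ (read-const-⇓ 0) (second-⇓ k≗)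
          H-result = A→C≼B i g g∈B
          H = proj₁ H-result
          H⇓ : h ⊢ Hᶜ ⇓ H
          H⇓ = run-⇓ S₁⇓ (proj₂ (proj₂ H-result))
          S₂⇓ : h ⊢ S₂ ⇓ (f ⊕ᶠ tail H)
          S₂⇓ = interleave-⇓ (first-⇓ k≗) (after-⇓ H⇓ (λ _ → suc-eval arg-eval))
          F-result = proj₁ (proj₂ H-result) f f∈A
          F∈C = proj₁ (proj₂ F-result)
          evF = proj₂ (proj₂ F-result)

IsBrouwerAlgebra-transfer :
  ∀ {C : Set₁} {_≤₁_ _≤₂_ : C → C → Set} {_⊕_ _⊗_ _⇒_ : C → C → C} {𝟘 𝟙 : C} →
  (∀ {x y} → x ≤₁ y → x ≤₂ y) → (∀ {x y} → x ≤₂ y → x ≤₁ y) →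
  IsBrouwerAlgebra _≤₁_ _⊕_ _⊗_ _⇒_ 𝟘 𝟙 → IsBrouwerAlgebra _≤₂_ _⊕_ _⊗_ _⇒_ 𝟘 𝟙
IsBrouwerAlgebra-transfer to from ba = record
  { refl≤        = λ x → to (refl≤ x)
  ; trans≤       = λ p q → to (trans≤ (from p) (from q))
  ; ⊕-upperˡ     = λ x y → to (⊕-upperˡ x y)
  ; ⊕-upperʳ     = λ x y → to (⊕-upperʳ x y)
  ; ⊕-least      = λ p q → to (⊕-least (from p) (from q))
  ; ⊗-lowerˡ     = λ x y → to (⊗-lowerˡ x y)
  ; ⊗-lowerʳ     = λ x y → to (⊗-lowerʳ x y)
  ; ⊗-greatest   = λ p q → to (⊗-greatest (from p) (from q))
  ; distrib      = λ x y z → to (proj₁ (distrib x y z)) , to (proj₂ (distrib x y z))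
  ; bot-least    = λ x → to (bot-least x)
  ; top-greatest = λ x → to (top-greatest x)
  ; residuation  = λ x y z → mk⇔ (to ∘ Equivalence.to (residuation x y z) ∘ from)
                                 (to ∘ Equivalence.from (residuation x y z) ∘ from)
  }
  where open IsBrouwerAlgebra ba

module _ (I : Set) (⌜_⌝ : I → ℕ) where
  open UniformReducibility I ⌜_⌝
  open UniformResiduation I ⌜_⌝

  uniform-brouwer : IsBrouwerAlgebra _≼_ _⊕ᴵ_ _⊗ᴵ_ _→ᴵ_ (λ _ → botM) (λ _ → topM)
  uniform-brouwer = record
    { refl≤        = ≼-refl
    ; trans≤       = λ {A} {B} {C} → ≼-trans {A} {B} {C}
    ; ⊕-upperˡ     = ⊕-upperˡ
    ; ⊕-upperʳ     = ⊕-upperʳ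
    ; ⊕-least      = λ {A} {B} {C} → ⊕-least {A} {B} {C}
    ; ⊗-lowerˡ     = ⊗-lowerˡ
    ; ⊗-lowerʳ     = ⊗-lowerʳ
    ; ⊗-greatest   = λ {A} {B} {C} → ⊗-greatest {A} {B} {C}
    ; distrib      = λ A B C → distribˡ A B C , distribʳ A B C
    ; bot-least    = ⊥-least
    ; top-greatest = ⊤-greatest
    ; residuation  = λ A B C → mk⇔ (residuate {A} {B} {C}) (unresiduate {A} {B} {C})
    }

  -- Specialising a uniform reduction to one index i: prepend ⌜ i ⌝ to the oracle.
  uniform⇒≤M : ∀ {A B} → A ≼ B → ∀ i → A i ≤M B i
  uniform⇒≤M {A} (e , A≼B) i = encode (substitute S (decode e)) , λ g g∈B →
    Φ-relativize (prefix-⇓ (const-⇓ ⌜ i ⌝) oracle-⇓) {e} (A i) (A≼B i g g∈B)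
    where S = prefixᶜ (constᶜ ⌜ i ⌝) oracleᶜ

nth-tabulate : ∀ {n} (f : Fin n → ℕ) i → nth (toℕ i) (tabulate f) ≡ f i
nth-tabulate f fzero    = refl
nth-tabulate f (fsuc i) = nth-tabulate (f ∘ fsuc) i

module _ (k : ℕ) where
  open UniformReducibility (Fin (suc k)) toℕ

  -- Finitely many reductions combine into a uniform one by looking the index up in a table.
  ≤M-pointwise⇒uniform : ∀ {A B} → (∀ i → A i ≤M B i) → A ≼ B
  ≤M-pointwise⇒uniform {A} A≤B = encode (run tailᶜ index argᶜ) , λ i g g∈B →
    let (f , f∈A , ev) = proj₂ (A≤B i) g g∈B in
    reduction (A i) (λ q → run-eval tail-⇓ (index⇓ i) arg-eval (ev q)) f∈A
    where
      table = tabulate (proj₁ ∘ A≤B)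
      index = nthᶜ (readᶜ (constᶜ 0)) (constᶜ (encodeList table))
      index⇓ : ∀ i {g q} → Eval (toℕ i ⌢ g) index (q ∷ []) (proj₁ (A≤B i))
      index⇓ i = subst (Eval _ index _) (trans (nthᴺ-encode (toℕ i) table) (nth-tabulate (proj₁ ∘ A≤B) i))
                       (nth-eval (read-eval (const-eval 0)) (const-eval _))

  Leq-fin⇔uniform : ∀ {A B} → Leq (fin k) A B ⇔ A ≼ B
  Leq-fin⇔uniform {A} {B} = mk⇔ (≤M-pointwise⇒uniform {A} {B}) (uniform⇒≤M (Fin (suc k)) toℕ {A} {B})

brouwer : ∀ X → IsBrouwerAlgebra (Leq X) (⊕P {X}) (⊗P {X}) (→P {X}) botP topP
brouwer (fin k) = IsBrouwerAlgebra-transfer (λ {A} {B} → Equivalence.from (Leq-fin⇔uniform k {A} {B}))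
                                            (λ {A} {B} → Equivalence.to (Leq-fin⇔uniform k {A} {B}))
                                            (uniform-brouwer (Fin (suc k)) toℕ)
brouwer omega   = uniform-brouwer ℕ (λ n → n)

UniformLeq : (X : Obj) → Pred X → Pred X → Set
UniformLeq X = UniformReducibility._≼_ (El X) (enc X)

Leq⇔UniformLeq : ∀ X {A B} → Leq X A B ⇔ UniformLeq X A B
Leq⇔UniformLeq (fin k) {A} {B} = Leq-fin⇔uniform k {A} {B}
Leq⇔UniformLeq omega           = mk⇔ id id

-- Φ_e run after replacing the first value n of the oracle by the value F computes from it.
reindexed : Code → ℕ → ℕ
reindexed F e = encode (substitute (prefixᶜ (F after readᶜ (constᶜ 0)) tailᶜ) (decode e))

reindex : ∀ {n v g e} (F : Code) (A : MassProblem) → Eval (n ⌢ g) F (n ∷ []) v → Φ[ e ]⟨ v ⌢ g ⟩∈ A →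
          Φ[ reindexed F e ]⟨ n ⌢ g ⟩∈ A
reindex {e = e} F A F⇓v = Φ-relativize (prefix-⇓ (λ _ → e-comp (read-eval (const-eval 0) ∷ []) F⇓v) tail-⇓) {e} A

-- A computable map is evaluated with the constant zero oracle, which the code zer supplies.
Computable-eval : ∀ {X Y f} → (c : Computable X Y f) → ∀ {g} x →
                  Eval (enc X x ⌢ g) (substitute zer (decode (proj₁ c))) (enc X x ∷ []) (enc Y (f x))
Computable-eval (_ , c⇓) x = substitute-eval (λ _ → e-zer) (c⇓ x)

UniformLeq-reindex : ∀ X Y (f : El X → El Y) → Computable X Y f →
                     ∀ A B → UniformLeq Y A B → UniformLeq X (A ∘ f) (B ∘ f)
UniformLeq-reindex X Y f c A B (e , A≼B) =
  reindexed (substitute zer (decode (proj₁ c))) e ,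
  λ x g g∈B → reindex {e = e} (substitute zer (decode (proj₁ c))) (A (f x)) (Computable-eval {X} {Y} {f} c x)
                       (A≼B (f x) g g∈B)

hom-mono : ∀ X Y (f : El X → El Y) → Computable X Y f → ∀ A B → Leq Y A B → Leq X ((f *) A) ((f *) B)
hom-mono X Y f c A B = Equivalence.from (Leq⇔UniformLeq X {A ∘ f} {B ∘ f}) ∘ UniformLeq-reindex X Y f c A B
                     ∘ Equivalence.to (Leq⇔UniformLeq Y {A} {B})

eqP : ∀ X → Pred (pow X 2)
eqP X j = record { _∋_ = λ _ → Σ (El X) λ x → diag X x ≡ j ; ext = λ _ p → p }

module _ (k : ℕ) (A : Pred (pow (fin k) 2)) where
  private X = fin k

  eqP-fin⇒ : Leq X ((diag X *) A) botP → Leq (pow X 2) A (eqP X)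
  eqP-fin⇒ A∘diag≤⊥ j with Fin.any? (λ x → diag X x Fin.≟ j)
  ... | yes (x , refl) = proj₁ (A∘diag≤⊥ x) , λ g _ → proj₂ (A∘diag≤⊥ x) g _
  ... | no off-diagonal = 0 , λ g j∈diag → ⊥-elim (off-diagonal j∈diag)

  eqP-fin⇐ : Leq (pow X 2) A (eqP X) → Leq X ((diag X *) A) botP
  eqP-fin⇐ A≤eq x = proj₁ (A≤eq (diag X x)) , λ g _ → proj₂ (A≤eq (diag X x)) g (x , refl)

module _ (A : Pred (pow omega 2)) where

  eqP-ω⇒ : Leq omega ((diag omega *) A) botP → Leq omega A (eqP omega)
  eqP-ω⇒ (e , A∘diag≤⊥) = reindexed (unpair₁ᶜ argᶜ) e ,
    λ { j g (x , refl) →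
    reindex {e = e} (unpair₁ᶜ argᶜ) (A (pair x x))
            (subst (Eval _ (unpair₁ᶜ argᶜ) _) (unpair₁-pair x x) (unpair₁-eval arg-eval))
            (A∘diag≤⊥ x g _) }

  eqP-ω⇐ : Leq omega A (eqP omega) → Leq omega ((diag omega *) A) botP
  eqP-ω⇐ (e , A≤eq) = reindexed (pairᶜ argᶜ argᶜ) e ,
    λ x g _ →
    reindex {e = e} (pairᶜ argᶜ argᶜ) (A (pair x x)) (pair-eval arg-eval arg-eval) (A≤eq (pair x x) g (x , refl))

eqP-spec : ∀ X (A : Pred (pow X 2)) → Leq X ((diag X *) A) botP ⇔ Leq (pow X 2) A (eqP X)
eqP-spec (fin k) A = mk⇔ (eqP-fin⇒ k A) (eqP-fin⇐ k A)
eqP-spec omega   A = mk⇔ (eqP-ω⇒ A) (eqP-ω⇐ A)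

split-glue : ∀ X n p → split X n (glue X n p) ≡ p
split-glue (fin k) zero    (fzero , x) = refl
split-glue (fin k) (suc n) (a , x)     = Fin.remQuot-combine a x
split-glue omega   zero    (fzero , x) = refl
split-glue omega   (suc n) (a , x)     = unpair-pair a x

glue-split : ∀ X n i → glue X n (split X n i) ≡ i
glue-split (fin k) zero    i = refl
glue-split (fin k) (suc n) i = Fin.combine-remQuot {suc (finpow k (suc n))} (suc k) i
glue-split omega   zero    i = refl
glue-split omega   (suc n) i = pair-unpair i

-- ∃ collects the witnesses x ⌢ f with f in the fibre over (b, x);
-- ∀ collects the indices of functionals uniformly mapping x to the fibre over (b, x).
∃P : ∀ X n → Pred (pow X (suc n)) → Pred (pow X n)
∃P X n A b = record
  { _∋_ = λ h → Σ (El X) λ x → (h 0 ≡ enc X x) × (A (glue X n (b , x)) ∋ tail h)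
  ; ext = λ { h≗ (x , h₀≡ , t∈A) → x , trans (sym (h≗ 0)) h₀≡ , ext (A (glue X n (b , x))) (h≗ ∘ suc) t∈A } }

∀P : ∀ X n → Pred (pow X (suc n)) → Pred (pow X n)
∀P X n A b = record
  { _∋_ = λ h → ∀ (x : El X) → Φ[ h 0 ]⟨ enc X x ⌢ tail h ⟩∈ A (glue X n (b , x))
  ; ext = λ {h} {h'} h≗ H x →
      subst (λ e → Φ[ e ]⟨ enc X x ⌢ tail h' ⟩∈ A (glue X n (b , x))) (h≗ 0)
            (Φ-resp {h 0} (A (glue X n (b , x))) (λ { zero → refl ; (suc q) → h≗ (suc q) }) (H x)) }

module Fibre (X : Obj) (n : ℕ) (A : Pred (pow X (suc n))) (B : Pred (pow X n)) (b : El (pow X n)) where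

  Aᵇ Bᵇ : Pred X
  Aᵇ x = A (glue X n (b , x))
  Bᵇ _ = B b

  const≼fibre⇒≤M∃ : UniformLeq X Bᵇ Aᵇ → B b ≤M ∃P X n A b
  const≼fibre⇒≤M∃ (e , B≼A) = e , λ { h (x , h₀≡ , t∈A) →
    Φ-resp {e} (B b) (λ { zero → sym h₀≡ ; (suc q) → refl }) (B≼A x (tail h) t∈A) }

  ≤M∃⇒const≼fibre : B b ≤M ∃P X n A b → UniformLeq X Bᵇ Aᵇ
  ≤M∃⇒const≼fibre (e , B≤∃A) = e , λ x g g∈A → B≤∃A (enc X x ⌢ g) (x , refl , g∈A)

  fibre≼const⇒∀≤M : UniformLeq X Aᵇ Bᵇ → ∀P X n A b ≤M B b
  fibre≼const⇒∀≤M (e , A≼B) = encode (prefixᶜ (constᶜ e) oracleᶜ) , λ g g∈B →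
    reduction (∀P X n A b) (prefix-⇓ (const-⇓ e) oracle-⇓) (λ x → A≼B x g g∈B)

  -- Compute H = Φ_d(g) in ∀ A, then run H 0 on enc x ⌢ tail H.
  ∀≤M⇒fibre≼const : ∀P X n A b ≤M B b → UniformLeq X Aᵇ Bᵇ
  ∀≤M⇒fibre≼const (d , ∀A≤B) = encode (run S (Hᶜ after constᶜ 0) argᶜ) , reduce
    where
      Hᶜ = run tailᶜ (constᶜ d) argᶜ
      S = prefixᶜ (readᶜ (constᶜ 0)) (Hᶜ after sucᶜ argᶜ)
      reduce : ∀ x g → B b ∋ g → Φ[ encode (run S (Hᶜ after constᶜ 0) argᶜ) ]⟨ enc X x ⌢ g ⟩∈ Aᵇ x
      reduce x g g∈B =
        reduction (Aᵇ x) (λ q → run-eval S⇓ (after-⇓ H⇓ (const-⇓ 0) q) arg-eval (proj₂ (proj₂ F-result) q))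
                  (proj₁ (proj₂ F-result))
        where
          H-result = ∀A≤B g g∈B
          H = proj₁ H-result
          H⇓ : (enc X x ⌢ g) ⊢ Hᶜ ⇓ H
          H⇓ = run-⇓ tail-⇓ (proj₂ (proj₂ H-result))
          S⇓ : (enc X x ⌢ g) ⊢ S ⇓ (enc X x ⌢ tail H)
          S⇓ = prefix-⇓ (read-const-⇓ 0) (after-⇓ H⇓ (λ _ → suc-eval arg-eval))
          F-result = proj₁ (proj₂ H-result) x

-- On ω^(n+1) = ω the index i codes the pair (unpair₁ i, unpair₂ i) of ω^n × ω.
module Omega (n : ℕ) (A : Pred omega) (B : Pred omega) where

  proj₁-unpair-pair : ∀ b x → proj₁ (unpair (pair b x)) ≡ b
  proj₁-unpair-pair b x = cong proj₁ (unpair-pair b x)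

  ∃-intro : Leq omega ((proj omega (suc n) *) B) A → Leq omega B (∃P omega (suc n) A)
  ∃-intro (e , B≤A) = encode (substitute S (decode e)) , λ { b h (x , h₀≡ , t∈A) →
    Φ-relativize (S⇓ b h x h₀≡) {e} (B b)
      (subst (λ j → Φ[ e ]⟨ pair b x ⌢ tail h ⟩∈ B j) (proj₁-unpair-pair b x) (B≤A (pair b x) (tail h) t∈A)) }
    where
      S = prefixᶜ (pairᶜ (readᶜ (constᶜ 0)) (readᶜ (constᶜ 1))) (oracleᶜ after sucᶜ (sucᶜ argᶜ))
      S⇓ : ∀ b h x → h 0 ≡ x → (b ⌢ h) ⊢ S ⇓ (pair b x ⌢ tail h)
      S⇓ b h x refl = prefix-⇓ (λ _ → pair-eval (read-eval (const-eval 0)) (read-eval (const-eval 1)))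
                               (after-⇓ oracle-⇓ (λ _ → suc-eval (suc-eval arg-eval)))

  ∃-elim : Leq omega B (∃P omega (suc n) A) → Leq omega ((proj omega (suc n) *) B) A
  ∃-elim (e , B≤∃A) = encode (substitute S (decode e)) , λ i g g∈A →
    Φ-relativize S⇓ {e} (B (proj₁ (unpair i)))
      (B≤∃A (proj₁ (unpair i)) (proj₂ (unpair i) ⌢ g)
            (proj₂ (unpair i) , refl , subst (λ j → A j ∋ g) (sym (pair-unpair i)) g∈A))
    where
      S = prefixᶜ (unpair₁ᶜ (readᶜ (constᶜ 0))) (prefixᶜ (unpair₂ᶜ (readᶜ (constᶜ 0))) tailᶜ)
      S⇓ : ∀ {i g} → (i ⌢ g) ⊢ S ⇓ (proj₁ (unpair i) ⌢ (proj₂ (unpair i) ⌢ g))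
      S⇓ {i} = ⇓-resp (λ _ → refl)
                 (λ { zero → sym (unpair₁-correct i) ; (suc zero) → sym (unpair₂-correct i) ; (suc (suc q)) → refl })
                 (prefix-⇓ (λ _ → unpair₁-eval (read-eval (const-eval 0)))
                           (prefix-⇓ (λ _ → unpair₂-eval (read-eval (const-eval 0))) tail-⇓))

  -- The output e* ⌢ b ⌢ g, where e* runs e on ⟨b, x⟩ ⌢ g rebuilt from x ⌢ b ⌢ g.
  ∀-intro : Leq omega A ((proj omega (suc n) *) B) → Leq omega (∀P omega (suc n) A) B
  ∀-intro (e , A≤B) = encode (prefixᶜ (constᶜ e*) oracleᶜ) , λ b g g∈B →
    reduction (∀P omega (suc n) A b) (prefix-⇓ (const-⇓ e*) oracle-⇓) (λ x →
      Φ-relativize S⇓ {e} (A (pair b x))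
        (A≤B (pair b x) g (subst (λ j → B j ∋ g) (sym (proj₁-unpair-pair b x)) g∈B)))
    where
      S = prefixᶜ (pairᶜ (readᶜ (constᶜ 1)) (readᶜ (constᶜ 0))) (oracleᶜ after sucᶜ (sucᶜ argᶜ))
      e* = encode (substitute S (decode e))
      S⇓ : ∀ {b g x} → (x ⌢ (b ⌢ g)) ⊢ S ⇓ (pair b x ⌢ g)
      S⇓ = prefix-⇓ (λ _ → pair-eval (read-eval (const-eval 1)) (read-eval (const-eval 0)))
                    (after-⇓ oracle-⇓ (λ _ → suc-eval (suc-eval arg-eval)))

  -- Compute H = Φ_d(b ⌢ g) in ∀ A, then run H 0 on x ⌢ tail H, where i = ⟨b, x⟩.
  ∀-elim : Leq omega (∀P omega (suc n) A) B → Leq omega A ((proj omega (suc n) *) B)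
  ∀-elim (d , ∀A≤B) = encode (run S₂ (Hᶜ after constᶜ 0) argᶜ) , reduce
    where
      S₁ = prefixᶜ (unpair₁ᶜ (readᶜ (constᶜ 0))) tailᶜ
      Hᶜ = run S₁ (constᶜ d) argᶜ
      S₂ = prefixᶜ (unpair₂ᶜ (readᶜ (constᶜ 0))) (Hᶜ after sucᶜ argᶜ)
      reduce : ∀ i g → B (proj₁ (unpair i)) ∋ g → Φ[ encode (run S₂ (Hᶜ after constᶜ 0) argᶜ) ]⟨ i ⌢ g ⟩∈ A i
      reduce i g g∈B =
        reduction (A i) (λ q → run-eval S₂⇓ (after-⇓ H⇓ (const-⇓ 0) q) arg-eval (proj₂ (proj₂ F-result) q))
                  (proj₁ (proj₂ F-result))
        where
          b = proj₁ (unpair i)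
          x = proj₂ (unpair i)
          S₁⇓ : (i ⌢ g) ⊢ S₁ ⇓ (b ⌢ g)
          S₁⇓ = ⇓-resp (λ _ → refl) (λ { zero → sym (unpair₁-correct i) ; (suc q) → refl })
                       (prefix-⇓ (λ _ → unpair₁-eval (read-eval (const-eval 0))) tail-⇓)
          H-result = ∀A≤B b g g∈B
          H = proj₁ H-result
          H⇓ : (i ⌢ g) ⊢ Hᶜ ⇓ H
          H⇓ = run-⇓ S₁⇓ (proj₂ (proj₂ H-result))
          S₂⇓ : (i ⌢ g) ⊢ S₂ ⇓ (x ⌢ tail H)
          S₂⇓ = ⇓-resp (λ _ → refl) (λ { zero → sym (unpair₂-correct i) ; (suc q) → refl })
                       (prefix-⇓ (λ _ → unpair₂-eval (read-eval (const-eval 0)))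
                                 (after-⇓ H⇓ (λ _ → suc-eval arg-eval)))
          F-result = subst (λ j → Φ[ H 0 ]⟨ x ⌢ tail H ⟩∈ A j) (pair-unpair i) (proj₁ (proj₂ H-result) x)

module Finite (k n : ℕ) (A : Pred (pow (fin k) (suc n))) (B : Pred (pow (fin k) n)) where
  private
    X = fin k
    module F b = Fibre X n A B b

  proj-glue : ∀ b x → proj X n (glue X n (b , x)) ≡ b
  proj-glue b x = cong proj₁ (split-glue X n (b , x))

  to-uniform : ∀ {P Q : Pred X} → Leq X P Q → UniformLeq X P Q
  to-uniform {P} {Q} = Equivalence.to (Leq⇔UniformLeq X {P} {Q})

  from-uniform : ∀ {P Q : Pred X} → UniformLeq X P Q → Leq X P Q
  from-uniform {P} {Q} = Equivalence.from (Leq⇔UniformLeq X {P} {Q})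

  ∃-adj : Leq (pow X (suc n)) ((proj X n *) B) A ⇔ Leq (pow X n) B (∃P X n A)
  ∃-adj = mk⇔
    (λ B≤A b → F.const≼fibre⇒≤M∃ b (to-uniform {F.Bᵇ b} {F.Aᵇ b}
                 (λ x → subst (λ j → B j ≤M A (glue X n (b , x))) (proj-glue b x) (B≤A (glue X n (b , x))))))
    (λ B≤∃A i → subst (λ j → B (proj X n i) ≤M A j) (glue-split X n i)
                  (from-uniform {F.Bᵇ (proj X n i)} {F.Aᵇ (proj X n i)}
                                (F.≤M∃⇒const≼fibre (proj X n i) (B≤∃A (proj X n i))) (proj₂ (split X n i))))

  ∀-adj : Leq (pow X (suc n)) A ((proj X n *) B) ⇔ Leq (pow X n) (∀P X n A) B
  ∀-adj = mk⇔
    (λ A≤B b → F.fibre≼const⇒∀≤M b (to-uniform {F.Aᵇ b} {F.Bᵇ b}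
                 (λ x → subst (λ j → A (glue X n (b , x)) ≤M B j) (proj-glue b x) (A≤B (glue X n (b , x))))))
    (λ ∀A≤B i → subst (λ j → A j ≤M B (proj X n i)) (glue-split X n i)
                  (from-uniform {F.Aᵇ (proj X n i)} {F.Bᵇ (proj X n i)}
                                (F.∀≤M⇒fibre≼const (proj X n i) (∀A≤B (proj X n i))) (proj₂ (split X n i))))

∃P-adj : ∀ X n A B → Leq (pow X (suc n)) ((proj X n *) B) A ⇔ Leq (pow X n) B (∃P X n A)
∃P-adj (fin k)   n       A B = Finite.∃-adj k n A B
∃P-adj omega     zero    A B = mk⇔ (λ B≤A → λ { fzero → Fibre.const≼fibre⇒≤M∃ omega 0 A B fzero B≤A })
                                   (λ B≤∃A → Fibre.≤M∃⇒const≼fibre omega 0 A B fzero (B≤∃A fzero))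
∃P-adj omega     (suc n) A B = mk⇔ (Omega.∃-intro n A B) (Omega.∃-elim n A B)

∀P-adj : ∀ X n A B → Leq (pow X (suc n)) A ((proj X n *) B) ⇔ Leq (pow X n) (∀P X n A) B
∀P-adj (fin k)   n       A B = Finite.∀-adj k n A B
∀P-adj omega     zero    A B = mk⇔ (λ A≤B → λ { fzero → Fibre.fibre≼const⇒∀≤M omega 0 A B fzero A≤B })
                                   (λ ∀A≤B → Fibre.∀≤M⇒fibre≼const omega 0 A B fzero (∀A≤B fzero))
∀P-adj omega     (suc n) A B = mk⇔ (Omega.∀-intro n A B) (Omega.∀-elim n A B)

Equiv-refl : ∀ X (A : Pred X) → Equiv X A A
Equiv-refl X A = refl≤ A , refl≤ A
  where open IsBrouwerAlgebra (brouwer X)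

⊇⇒Leq : ∀ Y (P Q : Pred Y) → (∀ b h → Q b ∋ h → P b ∋ h) → Leq Y P Q
⊇⇒Leq Y P Q Q⊆P = Equivalence.from (Leq⇔UniformLeq Y {P} {Q})
  (encode tailᶜ , λ b h h∈Q → reduction (P b) tail-⇓ (Q⊆P b h h∈Q))

module BeckChevalley (X : Obj) (n m : ℕ) (s : El (pow X n) → El (pow X m)) (A : Pred (pow X (suc m))) where

  times1-glue : ∀ b x → times1 X n m s (glue X n (b , x)) ≡ glue X m (s b , x)
  times1-glue b x = cong (λ p → glue X m (s (proj₁ p) , proj₂ p)) (split-glue X n (b , x))

  ∃-BC : Equiv (pow X n) (∃P X n ((times1 X n m s *) A)) ((s *) (∃P X m A))
  ∃-BC = ⊇⇒Leq (pow X n) _ _ (λ { b h (x , h₀≡ , t∈A) →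
                 x , h₀≡ , subst (λ j → A j ∋ tail h) (sym (times1-glue b x)) t∈A })
       , ⊇⇒Leq (pow X n) _ _ (λ { b h (x , h₀≡ , t∈A) →
                 x , h₀≡ , subst (λ j → A j ∋ tail h) (times1-glue b x) t∈A })

  ∀-BC : Equiv (pow X n) (∀P X n ((times1 X n m s *) A)) ((s *) (∀P X m A))
  ∀-BC = ⊇⇒Leq (pow X n) _ _ (λ b h H x →
                 subst (λ j → Φ[ h 0 ]⟨ enc X x ⌢ tail h ⟩∈ A j) (sym (times1-glue b x)) (H x))
       , ⊇⇒Leq (pow X n) _ _ (λ b h H x →
                 subst (λ j → Φ[ h 0 ]⟨ enc X x ⌢ tail h ⟩∈ A j) (times1-glue b x) (H x))

theorem4p9 : IsFirstOrderHyperdoctrineP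
theorem4p9 = record
  { brouwer  = brouwer
  ; hom-mono = hom-mono
  ; hom-⊕    = λ X Y f _ A B → Equiv-refl X _
  ; hom-⊗    = λ X Y f _ A B → Equiv-refl X _
  ; hom-→    = λ X Y f _ A B → Equiv-refl X _
  ; hom-bot  = λ X Y f _ → Equiv-refl X _
  ; hom-top  = λ X Y f _ → Equiv-refl X _
  ; eqP      = eqP
  ; eqP-spec = eqP-spec
  ; ∃P       = ∃P
  ; ∀P       = ∀P
  ; ∃P-adj   = ∃P-adj
  ; ∀P-adj   = ∀P-adj
  ; ∃P-BC    = λ X n m s _ A → BeckChevalley.∃-BC X n m s A
  ; ∀P-BC    = λ X n m s _ A → BeckChevalley.∀-BC X n m s A
  }
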